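{- For all positive integers $d$ and $m$, \[ E_{d^m} = \sum_{\tau} (-1)^{\ell(\tau)} \kappa_\tau\, E^+_{m\tau} \qquad\text{and}\qquad H_{d^m} = \sum_{\tau} (-1)^{\ell(\tau)} \kappa_\tau\, H^+_{m\tau}, \] where both sums are over all stack partitions $\tau=(d_1^{m_1},\dots,d_s^{m_s})$ of $d$ in which each multiplicity $m_i$ is a power of $2$.
   Context: $\mathsf{P\Lambda}$ denotes the $\mathbb{Q}$-algebra of polysymmetric functions: formal power series of bounded degree in variables $x_{i,j}$ ($i,j\ge1$), $x_{i,j}$ of degree $i$, invariant under every permutation of $x_{i,1},x_{i,2},\dots$ for each fixed $i$. A stack is a pair of positive integers $d^m$ (degree $d$, multiplicity $m$); a stack partition $\tau\Vdash n$ is a finite weakly decreasing sequence of stacks $(d_1^{m_1},\dots,d_s^{m_s})$ with $\sum d_im_i=n$; an ordinary partition $\alpha\vdash n$ has all multiplicities $1$; $\ell(\tau)=s$, $\operatorname{area}(\tau)=\sum m_i$. $M_\tau=\sum_\alpha x_{d_1,\alpha_1}^{m_1}\cdots x_{d_s,\alpha_s}^{m_s}$ over sequences $\alpha$ of positive integers with $\alpha_i\ne\alpha_j$ whenever $d_i=d_j$, $i\ne j$. Define $H_d=\sum_{\alpha\Vdash d}M_\alpha$, $E^+_d=\sum_{\alpha\vdash d}M_\alpha$, $E_d=\sum_{\alpha\vdash d}(-1)^{\ell(\alpha)}M_\alpha$, $H^+_d=\sum_{\alpha\Vdash d}(-1)^{\operatorname{area}(\alpha)}M_\alpha$. For each such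 $F$, $F_{d^m}$ is $F_d$ with each $x_{i,j}$ replaced by $x_{i,j}^m$, and $F_\tau=\prod_i F_{d_i^{m_i}}$. For a positive integer $m$, $m\tau$ is the stack partition obtained from $\tau$ by multiplying every multiplicity by $m$. Let $m_{i,j}(\tau)$ be the number of occurrences of the stack $i^j$ in $\tau$, $N_j(\tau)=\sum_i m_{i,j}(\tau)$, and $\kappa_\tau=\prod_j\binom{N_j(\tau)}{m_{1,j}(\tau),\,m_{2,j}(\tau),\,\dots}$ (multinomial coefficients, product over $j$ with $N_j(\tau)>0$). -}

module Defs where

open import Data.Nat using (ℕ; zero; suc; _+_; _*_; _∸_; _^_; _≤ᵇ_; _<ᵇ_; _≡ᵇ_; _≤_)
open import Data.Nat.Combinatorics using (_C_)
open import Data.Nat.Divisibility using (_∣?_)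
open import Data.Nat.DivMod using (_/_)
open import Data.Integer using (ℤ; +_; -1ℤ; 0ℤ; 1ℤ) renaming (_+_ to _+ℤ_; _*_ to _*ℤ_; _^_ to _^ℤ_)
open import Data.Bool using (Bool; true; false; if_then_else_; _∧_; _∨_)
open import Data.List using (List; []; _∷_; _++_; map; concatMap; foldr; length; applyUpTo)
open import Data.Bool.ListAction using (any; all)
open import Data.Vec using (Vec; []; _∷_)
open import Data.Product using (_×_; _,_; proj₁; proj₂)
open import Relation.Nullary.Decidable using (⌊_⌋)
open import Relation.Binary.PropositionalEquality using (_≡_)

-- Series in the variables x_{i,j}, given by their coefficients.
-- A monomial  Π x_{i,j}^{e_{i,j}}  (finitely supported) is represented by
-- an exponent array  e : Vec (Vec ℕ N) D, row index r (0-based) standing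
-- for degree i = r+1, column index c for j = c+1.  Every monomial arises
-- (for large enough D, N; padding by zeros).  All series below have integer
-- coefficients (ℤ ⊂ ℚ).

Mono : ℕ → ℕ → Set
Mono D N = Vec (Vec ℕ N) D

Series : Set
Series = (D N : ℕ) → Mono D N → ℤ

_≈S_ : Series → Series → Set
f ≈S g = ∀ D N (e : Mono D N) → f D N e ≡ g D N e

sumℤ : List ℤ → ℤ
sumℤ = foldr _+ℤ_ 0ℤ

0S : Series
0S _ _ _ = 0ℤ

_+S_ : Series → Series → Series
(f +S g) D N e = f D N e +ℤ g D N e

scaleS : ℤ → Series → Series
scaleS c f D N e = c *ℤ f D N e

isZeroV : ∀ {n} → Vec ℕ n → Bool
isZeroV [] = true
isZeroV (x ∷ xs) = (x ≡ᵇ 0) ∧ isZeroV xs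

isZeroM : ∀ {D N} → Mono D N → Bool
isZeroM [] = true
isZeroM (r ∷ rs) = isZeroV r ∧ isZeroM rs

1S : Series
1S D N e = if isZeroM e then 1ℤ else 0ℤ

belowV : ∀ {n} → Vec ℕ n → List (Vec ℕ n)
belowV [] = [] ∷ []
belowV (x ∷ xs) = concatMap (λ a → map (a ∷_) (belowV xs)) (applyUpTo (λ k → k) (suc x))

belowM : ∀ {D N} → Mono D N → List (Mono D N)
belowM [] = [] ∷ []
belowM (r ∷ rs) = concatMap (λ a → map (a ∷_) (belowM rs)) (belowV r)

subV : ∀ {n} → Vec ℕ n → Vec ℕ n → Vec ℕ n
subV [] [] = []
subV (x ∷ xs) (y ∷ ys) = (x ∸ y) ∷ subV xs ys

subM : ∀ {D N} → Mono D N → Mono D N → Mono D N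
subM [] [] = []
subM (r ∷ rs) (s ∷ ss) = subV r s ∷ subM rs ss

_·S_ : Series → Series → Series
(f ·S g) D N e = sumℤ (map (λ e₁ → f D N e₁ *ℤ g D N (subM e e₁)) (belowM e))

sumS : List Series → Series
sumS = foldr _+S_ 0S

prodS : List Series → Series
prodS = foldr _·S_ 1S

-- substitution x_{i,j} ↦ x_{i,j}^m  (m ≥ 1; the m = 0 clause is never used)
allDivV : ℕ → ∀ {n} → Vec ℕ n → Bool
allDivV m [] = true
allDivV m (x ∷ xs) = ⌊ m ∣? x ⌋ ∧ allDivV m xs

allDivM : ℕ → ∀ {D N} → Mono D N → Bool
allDivM m [] = true
allDivM m (r ∷ rs) = allDivV m r ∧ allDivM m rs

divV : (k : ℕ) → ∀ {n} → Vec ℕ n → Vec ℕ n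
divV k [] = []
divV k (x ∷ xs) = (x / suc k) ∷ divV k xs

divM : (k : ℕ) → ∀ {D N} → Mono D N → Mono D N
divM k [] = []
divM k (r ∷ rs) = divV k r ∷ divM k rs

substPow : ℕ → Series → Series
substPow zero f = 0S
substPow (suc k) f D N e = if allDivM (suc k) e then f D N (divM k e) else 0ℤ

-- Stacks d^m as pairs (d , m); stack partitions as lists of stacks.

Stack : Set
Stack = ℕ × ℕ

_≥ˢ_ : Stack → Stack → Bool
(a , b) ≥ˢ (c , d) = (c <ᵇ a) ∨ ((a ≡ᵇ c) ∧ (d ≤ᵇ b))

_==ˢ_ : Stack → Stack → Bool
(a , b) ==ˢ (c , d) = (a ≡ᵇ c) ∧ (b ≡ᵇ d)

eqL : List Stack → List Stack → Bool
eqL [] [] = true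
eqL [] (_ ∷ _) = false
eqL (_ ∷ _) [] = false
eqL (s ∷ ss) (t ∷ ts) = (s ==ˢ t) ∧ eqL ss ts

insertˢ : Stack → List Stack → List Stack
insertˢ s [] = s ∷ []
insertˢ s (t ∷ ts) = if s ≥ˢ t then s ∷ t ∷ ts else t ∷ insertˢ s ts

sortDesc : List Stack → List Stack
sortDesc = foldr insertˢ []

isDecr : List Stack → Bool
isDecr [] = true
isDecr (s ∷ []) = true
isDecr (s ∷ t ∷ ts) = (s ≥ˢ t) ∧ isDecr (t ∷ ts)

filterB : ∀ {A : Set} → (A → Bool) → List A → List A
filterB p [] = []
filterB p (x ∷ xs) = if p x then x ∷ filterB p xs else filterB p xs

range1 : ℕ → List ℕ
range1 n = applyUpTo suc n

weight : List Stack → ℕ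
weight = foldr (λ s w → proj₁ s * proj₂ s + w) 0

area : List Stack → ℕ
area = foldr (λ s w → proj₂ s + w) 0

stacksUpTo : ℕ → List Stack
stacksUpTo n = concatMap (λ a → map (a ,_) (range1 n)) (range1 n)

listsUpTo : ℕ → List Stack → List (List Stack)
listsUpTo zero S = [] ∷ []
listsUpTo (suc k) S = [] ∷ concatMap (λ s → map (s ∷_) (listsUpTo k S)) S

-- all stack partitions τ ⊩ n (each exactly once, weakly decreasing);
-- every such τ has length ≤ n and all degrees/multiplicities in [1..n]
stackPartitions : ℕ → List (List Stack)
stackPartitions n = filterB (λ τ → isDecr τ ∧ (weight τ ≡ᵇ n)) (listsUpTo n (stacksUpTo n))

ordinaryPartitions : ℕ → List (List Stack)
ordinaryPartitions n = filterB (all (λ s → proj₂ s ≡ᵇ 1)) (stackPartitions n)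

-- Monomial polysymmetric functions M_τ: sum of the distinct monomials
-- whose multiset of stacks { i^{e_{i,j}} : e_{i,j} > 0 } equals τ.

stacksRow : ℕ → ∀ {N} → Vec ℕ N → List Stack
stacksRow i [] = []
stacksRow i (c ∷ cs) = if c ≡ᵇ 0 then stacksRow i cs else (i , c) ∷ stacksRow i cs

stacksFrom : ℕ → ∀ {D N} → Mono D N → List Stack
stacksFrom i [] = []
stacksFrom i (r ∷ rs) = stacksRow i r ++ stacksFrom (suc i) rs

stacksOf : ∀ {D N} → Mono D N → List Stack
stacksOf = stacksFrom 1

M : List Stack → Series
M τ D N e = if eqL (sortDesc (stacksOf e)) (sortDesc τ) then 1ℤ else 0ℤ

sign : ℕ → ℤ
sign n = -1ℤ ^ℤ n

H : ℕ → Series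
H d = sumS (map M (stackPartitions d))

E⁺ : ℕ → Series
E⁺ d = sumS (map M (ordinaryPartitions d))

E : ℕ → Series
E d = sumS (map (λ α → scaleS (sign (length α)) (M α)) (ordinaryPartitions d))

H⁺ : ℕ → Series
H⁺ d = sumS (map (λ α → scaleS (sign (area α)) (M α)) (stackPartitions d))

atStack : (ℕ → Series) → Stack → Series
atStack F (d , m) = substPow m (F d)

atPartition : (ℕ → Series) → List Stack → Series
atPartition F τ = prodS (map (atStack F) τ)

scaleMult : ℕ → List Stack → List Stack
scaleMult m = map (λ s → (proj₁ s , m * proj₂ s))

countStack : Stack → List Stack → ℕ
countStack s = foldr (λ t c → (if s ==ˢ t then 1 else 0) + c) 0

sumℕ : List ℕ → ℕ
sumℕ = foldr _+_ 0

productℕ : List ℕ → ℕ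
productℕ = foldr _*_ 1

multinomial : List ℕ → ℕ
multinomial [] = 1
multinomial (k ∷ ks) = ((k + sumℕ ks) C k) * multinomial ks

-- all degrees and multiplicities of τ are ≤ weight τ, so ranging over
-- [1 .. weight τ] covers all (i , j) with m_{i,j}(τ) > 0
κ : List Stack → ℕ
κ τ = productℕ (map (λ j → multinomial (map (λ i → countStack (i , j) τ) (range1 (weight τ))))
                    (range1 (weight τ)))

isPow2 : ℕ → Bool
isPow2 m = any (λ k → (2 ^ k) ≡ᵇ m) (applyUpTo (λ k → k) (suc m))

pow2StackPartitions : ℕ → List (List Stack)
pow2StackPartitions d = filterB (all (λ s → isPow2 (proj₂ s))) (stackPartitions d)

rhs : (ℕ → Series) → ℕ → ℕ → Series
rhs F⁺ d m = sumS (map (λ τ → scaleS (sign (length τ) *ℤ + κ τ) (atPartition F⁺ (scaleMult m τ)))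
                       (pow2StackPartitions d))

-- Every series involved is weighted: its coefficient on a monomial of degree d is a product
-- ∏ φ(e_ij) of one weight φ over the exponents, and substituting x ↦ x^q dilates φ. Reading weights
-- as power series in one variable y, the stack d^m of E has weight 1 − y^m, that of H has weight
-- 1/(1 − y^m), the multiplicity q of E⁺ has weight 1 + y^q and that of H⁺ has weight 1/(1 + y^q).
-- The binary expansion 1/(1 − y) = ∏_{k ≥ 0} (1 + y^(2^k)) therefore writes ∑_d E_{d^m} t^d as
-- ∏_k (∑_i E⁺_{i^(m·2^k)} t^(i·2^k))^(-1), and similarly for H. Expanding the inverses gives the sum
-- over stack partitions with multiplicities 2^k, each with sign (-1)^ℓ and κ_τ orderings of its
-- stacks of equal multiplicity. The proof peels the factors off one k at a time: the partial sums
-- over τ with multiplicities below 2^K and the weighted series with the truncated product as weight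
-- satisfy the same recursion in K (by Pascal's rule for κ on one hand and convolution of weights on
-- the other), and for K = d they are the two sides of the identity.

module Submission where

open import Data.Bool.Base using (Bool; true; false; T; not; _∧_; _∨_; if_then_else_)
open import Data.Bool.ListAction using (all)
open import Data.Bool.Properties using (T-∧; T-∨; ∧-identityʳ; ∧-zeroʳ)
open import Data.Empty using (⊥-elim)
open import Data.Integer.Base as ℤ using (ℤ; -_; 0ℤ; 1ℤ; -1ℤ; _+_; _*_; _-_)
open import Data.Integer.Properties
open import Data.Integer.Tactic.RingSolver using (solve-∀)
open import Data.List.Base using (List; []; _∷_; _++_; _∷ʳ_; map; concatMap; foldr; applyUpTo; upTo; length)
open import Data.List.Membership.Propositional using (_∈_)
open import Data.List.Membership.Propositional.Properties using (∈-applyUpTo⁺)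
open import Data.List.Properties using (map-++; map-∘; map-cong; map-cong-local; applyUpTo-∷ʳ)
open import Data.List.Relation.Unary.All as All using (All; []; _∷_)
import Data.List.Relation.Unary.All.Properties as All
open import Data.List.Relation.Unary.AllPairs using ([]; _∷_)
open import Data.List.Relation.Unary.Any as Any using (here; there)
open import Data.List.Relation.Unary.Any.Properties using (any⁺; any⁻)
open import Data.List.Relation.Unary.Unique.Propositional using (Unique)
import Data.List.Relation.Unary.Unique.Propositional.Properties as Unique
open import Data.Nat.Base as ℕ using (ℕ; zero; suc; _∸_; _≤_; _<_; _≤ᵇ_; _<ᵇ_; _≡ᵇ_; z≤n; s≤s; z<s; _^_)
open import Data.Nat.Combinatorics using (_C_; nCn≡1; nCk+nC[k+1]≡[n+1]C[k+1])
open import Data.Nat.DivMod using (_/_; m*n/n≡m; m<n⇒m/n≡0; m/n≡1+[m∸n]/n; m≥n⇒m/n>0)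
open import Data.Nat.Divisibility using (_∣_; _∣?_; divides; _∣0; ∣-refl; ∣m∣n⇒∣m+n; ∣m+n∣m⇒∣n; >⇒∤; ∣⇒≤; m∣m*n)
open import Data.Nat.Induction using (<-rec)
open import Data.Nat.ListAction.Properties using (sum-++; product-++)
import Data.Nat.Properties as ℕ
open import Data.Nat.Tactic.RingSolver using () renaming (solve-∀ to ℕ-solve-∀)
open import Data.Product.Base using (_×_; _,_; proj₁; proj₂; Σ)
open import Data.Sum.Base using (_⊎_; inj₁; inj₂)
open import Data.Vec.Base using (Vec; []; _∷_; zipWith) renaming (sum to sumᵛ)
open import Data.Vec.Relation.Binary.Pointwise.Inductive using (Pointwise; []; _∷_)
open import Function.Base using (_∘_; id)
open import Function.Bundles using (Equivalence; _⇔_; mk⇔)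
open import Relation.Binary.Definitions using (Tri; tri<; tri≈; tri>)
open import Relation.Binary.PropositionalEquality
  using (_≡_; _≢_; _≗_; refl; sym; trans; cong; cong₂; subst; module ≡-Reasoning)
open import Relation.Nullary.Decidable using (⌊_⌋; yes; no)
open import Relation.Nullary.Negation.Core using (¬_)

open import Defs

open Equivalence using (to; from)
open import Algebra.Properties.CommutativeSemigroup +-commutativeSemigroup using ()
  renaming (interchange to +-interchange)
open import Algebra.Properties.CommutativeSemigroup *-commutativeSemigroup using ()
  renaming (interchange to *-interchange; x∙yz≈y∙xz to *-left-comm; xy∙z≈y∙xz to *-rotate)
open import Algebra.Properties.CommutativeSemigroup ℕ.+-commutativeSemigroup using ()
  renaming (interchange to ℕ-+-interchange; x∙yz≈y∙xz to ℕ-+-left-comm)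
open import Algebra.Properties.CommutativeSemigroup ℕ.*-commutativeSemigroup using ()
  renaming (x∙yz≈y∙xz to ℕ-*-left-comm)

private variable
  A B : Set
  n D N : ℕ

𝟙 : Bool → ℤ
𝟙 true  = 1ℤ
𝟙 false = 0ℤ

𝟙-∧ : ∀ a b → 𝟙 (a ∧ b) ≡ 𝟙 a * 𝟙 b
𝟙-∧ true  b = sym (*-identityˡ (𝟙 b))
𝟙-∧ false b = refl

if-𝟙 : ∀ b → (if b then 1ℤ else 0ℤ) ≡ 𝟙 b
if-𝟙 true  = refl
if-𝟙 false = refl

δ₀ : ℕ → ℤ
δ₀ x = 𝟙 (x ≡ᵇ 0)

∑ : List A → (A → ℤ) → ℤ
∑ L f = sumℤ (map f L)

syntax ∑ L (λ x → e) = ∑[ x ← L ] e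

∑-++ : (L L′ : List A) (f : A → ℤ) → ∑ (L ++ L′) f ≡ ∑ L f + ∑ L′ f
∑-++ []      L′ f = sym (+-identityˡ _)
∑-++ (x ∷ L) L′ f = trans (cong (f x +_) (∑-++ L L′ f)) (sym (+-assoc (f x) _ _))

∑-map : (g : A → B) (L : List A) (f : B → ℤ) → ∑ (map g L) f ≡ ∑ L (f ∘ g)
∑-map g []      f = refl
∑-map g (x ∷ L) f = cong (f (g x) +_) (∑-map g L f)

∑-concatMap : (g : A → List B) (L : List A) (f : B → ℤ) →
              ∑ (concatMap g L) f ≡ ∑[ a ← L ] ∑ (g a) f
∑-concatMap g []      f = refl
∑-concatMap g (x ∷ L) f =
  trans (∑-++ (g x) (concatMap g L) f) (cong (∑ (g x) f +_) (∑-concatMap g L f))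

∑-cong : (L : List A) {f g : A → ℤ} → (∀ x → f x ≡ g x) → ∑ L f ≡ ∑ L g
∑-cong []      f≗g = refl
∑-cong (x ∷ L) f≗g = cong₂ _+_ (f≗g x) (∑-cong L f≗g)

∑-cong-All : {P : A → Set} (L : List A) {f g : A → ℤ} →
             All P L → (∀ x → P x → f x ≡ g x) → ∑ L f ≡ ∑ L g
∑-cong-All []      []         f≗g = refl
∑-cong-All (x ∷ L) (px ∷ pxs) f≗g = cong₂ _+_ (f≗g x px) (∑-cong-All L pxs f≗g)

∑-zero : (L : List A) {f : A → ℤ} → (∀ x → f x ≡ 0ℤ) → ∑ L f ≡ 0ℤ
∑-zero []      f≗0 = refl
∑-zero (x ∷ L) f≗0 = cong₂ _+_ (f≗0 x) (∑-zero L f≗0)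

∑-distrib-+ : (L : List A) (f g : A → ℤ) → ∑[ x ← L ] (f x + g x) ≡ ∑ L f + ∑ L g
∑-distrib-+ []      f g = refl
∑-distrib-+ (x ∷ L) f g =
  trans (cong ((f x + g x) +_) (∑-distrib-+ L f g)) (+-interchange (f x) (g x) _ _)

∑-*ˡ : (L : List A) (c : ℤ) (f : A → ℤ) → ∑[ x ← L ] (c * f x) ≡ c * ∑ L f
∑-*ˡ []      c f = sym (*-zeroʳ c)
∑-*ˡ (x ∷ L) c f = trans (cong (c * f x +_) (∑-*ˡ L c f)) (sym (*-distribˡ-+ c (f x) _))

∑-*ʳ : (L : List A) (c : ℤ) (f : A → ℤ) → ∑[ x ← L ] (f x * c) ≡ ∑ L f * c
∑-*ʳ L c f = trans (∑-cong L (λ x → *-comm (f x) c)) (trans (∑-*ˡ L c f) (*-comm c _))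

∑-neg : (L : List A) (f : A → ℤ) → ∑[ x ← L ] (- f x) ≡ - ∑ L f
∑-neg []      f = refl
∑-neg (x ∷ L) f = trans (cong (- f x +_) (∑-neg L f)) (sym (neg-distrib-+ (f x) _))

∑-comm : (L : List A) (L′ : List B) (f : A → B → ℤ) →
         ∑[ a ← L ] ∑[ b ← L′ ] f a b ≡ ∑[ b ← L′ ] ∑[ a ← L ] f a b
∑-comm []      L′ f = sym (∑-zero L′ (λ _ → refl))
∑-comm (x ∷ L) L′ f =
  trans (cong (∑ L′ (f x) +_) (∑-comm L L′ f)) (sym (∑-distrib-+ L′ (f x) _))

∑-filterB : (p : A → Bool) (L : List A) (f : A → ℤ) →
            ∑ (filterB p L) f ≡ ∑[ x ← L ] (𝟙 (p x) * f x)
∑-filterB p []      f = refl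
∑-filterB p (x ∷ L) f with p x
... | true  = cong₂ _+_ (sym (*-identityˡ (f x))) (∑-filterB p L f)
... | false = trans (∑-filterB p L f) (sym (trans (cong (_+ rest) (*-zeroˡ (f x))) (+-identityˡ rest)))
  where rest = ∑[ y ← L ] (𝟙 (p y) * f y)

∑-𝟙-split : (L : List A) (p : A → Bool) (f : A → ℤ) →
            ∑[ x ← L ] (𝟙 (p x) * f x) + ∑[ x ← L ] (𝟙 (not (p x)) * f x) ≡ ∑ L f
∑-𝟙-split L p f = trans (sym (∑-distrib-+ L _ _)) (∑-cong L λ x →
  trans (sym (*-distribʳ-+ (f x) (𝟙 (p x)) _)) (trans (cong (_* f x) (𝟙+𝟙-not (p x))) (*-identityˡ (f x))))
  where
  𝟙+𝟙-not : ∀ b → 𝟙 b + 𝟙 (not b) ≡ 1ℤ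
  𝟙+𝟙-not true  = refl
  𝟙+𝟙-not false = refl

∑< : ℕ → (ℕ → ℤ) → ℤ
∑< zero    f = 0ℤ
∑< (suc n) f = f 0 + ∑< n (f ∘ suc)

∑<-zero : ∀ n {f} → (∀ k → f k ≡ 0ℤ) → ∑< n f ≡ 0ℤ
∑<-zero zero    _   = refl
∑<-zero (suc n) f≗0 = cong₂ _+_ (f≗0 0) (∑<-zero n (f≗0 ∘ suc))

∑<-δ : ∀ n y (G : ℕ → ℤ) → ∑< n (λ k → 𝟙 (k ≡ᵇ y) * G k) ≡ 𝟙 (y <ᵇ n) * G y
∑<-δ zero    y       G = sym (*-zeroˡ (G y))
∑<-δ (suc n) zero    G = trans (cong₂ _+_ (*-identityˡ (G 0)) (∑<-zero n (λ k → *-zeroˡ (G (suc k)))))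
                               (trans (+-identityʳ _) (sym (*-identityˡ (G 0))))
∑<-δ (suc n) (suc y) G = trans (cong₂ _+_ (*-zeroˡ (G 0)) (∑<-δ n y (G ∘ suc))) (+-identityˡ _)

∑<-cong-< : ∀ n {f g : ℕ → ℤ} → (∀ x → x < n → f x ≡ g x) → ∑< n f ≡ ∑< n g
∑<-cong-< zero    _   = refl
∑<-cong-< (suc n) f≗g = cong₂ _+_ (f≗g 0 z<s) (∑<-cong-< n (λ x x<n → f≗g (suc x) (s≤s x<n)))

∑<-last : ∀ n (f : ℕ → ℤ) → ∑< (suc n) f ≡ ∑< n f + f n
∑<-last zero    f = trans (+-identityʳ (f 0)) (sym (+-identityˡ (f 0)))
∑<-last (suc n) f = trans (cong (f 0 +_) (∑<-last n (f ∘ suc))) (sym (+-assoc (f 0) _ _))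

∑<-reverse : ∀ n (f : ℕ → ℤ) → ∑< (suc n) f ≡ ∑< (suc n) (λ x → f (n ∸ x))
∑<-reverse zero    f = refl
∑<-reverse (suc n) f = begin
    f 0 + ∑< (suc n) (f ∘ suc)
  ≡⟨ cong (f 0 +_) (∑<-reverse n (f ∘ suc)) ⟩
    f 0 + ∑< (suc n) (λ x → f (suc (n ∸ x)))
  ≡⟨ +-comm (f 0) _ ⟩
    ∑< (suc n) (λ x → f (suc (n ∸ x))) + f 0
  ≡⟨ cong₂ _+_ (∑<-cong-< (suc n) (λ x x<n → cong f (sym (ℕ.+-∸-assoc 1 (ℕ.≤-pred x<n)))))
               (cong f (sym (ℕ.n∸n≡0 (suc n)))) ⟩
    ∑< (suc n) (λ x → f (suc n ∸ x)) + f (suc n ∸ suc n)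
  ≡⟨ ∑<-last (suc n) (λ x → f (suc n ∸ x)) ⟨
    ∑< (suc (suc n)) (λ x → f (suc n ∸ x))
  ∎
  where open ≡-Reasoning

∑-applyUpTo : (f : ℕ → A) (n : ℕ) (g : A → ℤ) → ∑ (applyUpTo f n) g ≡ ∑< n (g ∘ f)
∑-applyUpTo f zero    g = refl
∑-applyUpTo f (suc n) g = cong (g (f 0) +_) (∑-applyUpTo (f ∘ suc) n g)

T-ext : ∀ {a b} → (T a → T b) → (T b → T a) → a ≡ b
T-ext {true}  {true}  _ _ = refl
T-ext {true}  {false} f _ = ⊥-elim (f _)
T-ext {false} {true}  _ g = ⊥-elim (g _)
T-ext {false} {false} _ _ = refl

T⇒≡true : ∀ {b} → T b → b ≡ true
T⇒≡true {true} _ = refl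

≡true⇒T : ∀ {b} → b ≡ true → T b
≡true⇒T refl = _

≡false⇒¬T : ∀ {b} → b ≡ false → ¬ T b
≡false⇒¬T {true} ()

¬T⇒≡false : ∀ {b} → ¬ T b → b ≡ false
¬T⇒≡false {true}  ¬b = ⊥-elim (¬b _)
¬T⇒≡false {false} _  = refl

∧-true : ∀ {a b} → (a ∧ b) ≡ true → a ≡ true × b ≡ true
∧-true {true} {true} _ = refl , refl

all-true : (p : A → Bool) (L : List A) → all p L ≡ true → All (λ x → p x ≡ true) L
all-true p []      _ = []
all-true p (x ∷ L) q with ∧-true {p x} q
... | px , pL = px ∷ all-true p L pL

≤ᵇ-true : ∀ {m n} → m ≤ n → (m ≤ᵇ n) ≡ true
≤ᵇ-true = T⇒≡true ∘ ℕ.≤⇒≤ᵇ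

≤ᵇ-false : ∀ {m n} → ¬ m ≤ n → (m ≤ᵇ n) ≡ false
≤ᵇ-false {m} {n} m≰n = ¬T⇒≡false (m≰n ∘ ℕ.≤ᵇ⇒≤ m n)

<ᵇ-true : ∀ {m n} → m < n → (m <ᵇ n) ≡ true
<ᵇ-true = T⇒≡true ∘ ℕ.<⇒<ᵇ

<ᵇ-false : ∀ {m n} → ¬ m < n → (m <ᵇ n) ≡ false
<ᵇ-false {m} {n} m≮n = ¬T⇒≡false (m≮n ∘ ℕ.<ᵇ⇒< m n)

≡ᵇ-true : ∀ {m n} → m ≡ n → (m ≡ᵇ n) ≡ true
≡ᵇ-true {m} {n} = T⇒≡true ∘ ℕ.≡⇒≡ᵇ m n

≡ᵇ-false⇒≢ : ∀ {m n} → (m ≡ᵇ n) ≡ false → m ≢ n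
≡ᵇ-false⇒≢ {m} m≢m refl with () ← trans (sym m≢m) (T⇒≡true (ℕ.≡⇒≡ᵇ m m refl))

≡ᵇ-false : ∀ {m n} → m ≢ n → (m ≡ᵇ n) ≡ false
≡ᵇ-false {m} {n} m≢n = ¬T⇒≡false (m≢n ∘ ℕ.≡ᵇ⇒≡ m n)

-- Products of series

atMost : ℕ → List ℕ
atMost x = upTo (suc x)

atMost-≤ : ∀ x → All (_≤ x) (atMost x)
atMost-≤ x = All.applyUpTo⁺₁ id (suc x) ℕ.≤-pred

∑-atMost-extend : ∀ {y x} → y ≤ x → (g : ℕ → ℤ) →
                  ∑ (atMost y) g ≡ ∑[ b ← atMost x ] (𝟙 (b <ᵇ suc y) * g b)
∑-atMost-extend {y} {x} y≤x g =
  trans (∑-applyUpTo id (suc y) g)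
        (trans (go y x y≤x g) (sym (∑-applyUpTo id (suc x) (λ b → 𝟙 (b <ᵇ suc y) * g b))))
  where
  go : ∀ y x → y ≤ x → (g : ℕ → ℤ) → ∑< (suc y) g ≡ ∑< (suc x) (λ b → 𝟙 (b <ᵇ suc y) * g b)
  go zero    x       _         g = cong₂ _+_ (sym (*-identityˡ (g 0)))
                                             (sym (∑<-zero x (λ b → *-zeroˡ (g (suc b)))))
  go (suc y) (suc x) (s≤s y≤x) g = cong₂ _+_ (sym (*-identityˡ (g 0))) (go y x y≤x (g ∘ suc))

Exchangeable : (A → List A) → (A → A → A) → Set
Exchangeable {A} B _−_ = ∀ x (K : A → A → A → ℤ) →
  ∑[ a ← B x ] ∑[ b ← B (x − a) ] K a b ((x − a) − b) ≡
  ∑[ b ← B x ] ∑[ a ← B (x − b) ] K a b ((x − b) − a)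

atMost-exchangeable : Exchangeable atMost _∸_
atMost-exchangeable x K = begin
    ∑[ a ← atMost x ] ∑[ b ← atMost (x ∸ a) ] K a b (x ∸ a ∸ b)
  ≡⟨ flatten (λ a b → K a b (x ∸ a ∸ b)) ⟩
    ∑[ a ← atMost x ] ∑[ b ← atMost x ] (𝟙 (a ℕ.+ b <ᵇ suc x) * K a b (x ∸ a ∸ b))
  ≡⟨ ∑-comm (atMost x) (atMost x) (λ a b → 𝟙 (a ℕ.+ b <ᵇ suc x) * K a b (x ∸ a ∸ b)) ⟩
    ∑[ b ← atMost x ] ∑[ a ← atMost x ] (𝟙 (a ℕ.+ b <ᵇ suc x) * K a b (x ∸ a ∸ b))
  ≡⟨ ∑-cong (atMost x) (λ b → ∑-cong (atMost x) (λ a →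
       cong₂ (λ u v → 𝟙 (u <ᵇ suc x) * K a b v) (ℕ.+-comm a b) (∸-swap a b))) ⟩
    ∑[ b ← atMost x ] ∑[ a ← atMost x ] (𝟙 (b ℕ.+ a <ᵇ suc x) * K a b (x ∸ b ∸ a))
  ≡⟨ flatten (λ b a → K a b (x ∸ b ∸ a)) ⟨
    ∑[ b ← atMost x ] ∑[ a ← atMost (x ∸ b) ] K a b (x ∸ b ∸ a)
  ∎
  where
  open ≡-Reasoning
  ∸-swap : ∀ a b → x ∸ a ∸ b ≡ x ∸ b ∸ a
  ∸-swap a b = trans (ℕ.∸-+-assoc x a b) (trans (cong (x ∸_) (ℕ.+-comm a b)) (sym (ℕ.∸-+-assoc x b a)))
  fits : ∀ {a} b → a ≤ x → (b <ᵇ suc (x ∸ a)) ≡ (a ℕ.+ b <ᵇ suc x)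
  fits {a} b a≤x = T-ext
    (λ t → ℕ.<⇒<ᵇ (s≤s (subst (_≤ x) (ℕ.+-comm b a)
                          (ℕ.m≤o∸n⇒m+n≤o b a≤x (ℕ.≤-pred (ℕ.<ᵇ⇒< b _ t))))))
    (λ t → ℕ.<⇒<ᵇ (s≤s (ℕ.m+n≤o⇒m≤o∸n b (subst (_≤ x) (ℕ.+-comm a b)
                                              (ℕ.≤-pred (ℕ.<ᵇ⇒< (a ℕ.+ b) _ t))))))
  flatten : (G : ℕ → ℕ → ℤ) →
    ∑[ a ← atMost x ] ∑[ b ← atMost (x ∸ a) ] G a b ≡
    ∑[ a ← atMost x ] ∑[ b ← atMost x ] (𝟙 (a ℕ.+ b <ᵇ suc x) * G a b)
  flatten G = ∑-cong-All (atMost x) (atMost-≤ x) λ a a≤x →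
    trans (∑-atMost-extend (ℕ.m∸n≤m x a) (G a))
          (∑-cong (atMost x) (λ b → cong (λ c → 𝟙 c * G a b) (fits b a≤x)))

choices : (A → List A) → ∀ {n} → Vec A n → List (Vec A n)
choices B []       = [] ∷ []
choices B (x ∷ xs) = concatMap (λ a → map (a ∷_) (choices B xs)) (B x)

∑-choices-∷ : (B : A → List A) (x : A) {n : ℕ} (xs : Vec A n) (F : Vec A (suc n) → ℤ) →
              ∑ (choices B (x ∷ xs)) F ≡ ∑[ a ← B x ] ∑[ as ← choices B xs ] F (a ∷ as)
∑-choices-∷ B x xs F = trans (∑-concatMap (λ a → map (a ∷_) (choices B xs)) (B x) F)
                             (∑-cong (B x) (λ a → ∑-map (a ∷_) (choices B xs) F))

choices-exchangeable : (B : A → List A) (s : A → A → A) → Exchangeable B s →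
                       ∀ n → Exchangeable (choices B {n}) (zipWith s)
choices-exchangeable B s exch zero    []       K = refl
choices-exchangeable {A} B s exch (suc n) (x ∷ xs) K = begin
    ∑[ a ← choices B (x ∷ xs) ] ∑[ b ← choices B (zipWith s (x ∷ xs) a) ]
      K a b (zipWith s (zipWith s (x ∷ xs) a) b)
  ≡⟨ split K ⟩
    ∑[ a₀ ← B x ] ∑[ b₀ ← B (s x a₀) ] Kₜ a₀ b₀ (s (s x a₀) b₀)
  ≡⟨ exch x Kₜ ⟩
    ∑[ b₀ ← B x ] ∑[ a₀ ← B (s x b₀) ] Kₜ a₀ b₀ (s (s x b₀) a₀)
  ≡⟨ ∑-cong (B x) (λ b₀ → ∑-cong (B (s x b₀)) (λ a₀ →
       choices-exchangeable B s exch n xs (λ as bs cs → K (a₀ ∷ as) (b₀ ∷ bs) (s (s x b₀) a₀ ∷ cs)))) ⟩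
    ∑[ b₀ ← B x ] ∑[ a₀ ← B (s x b₀) ] ∑[ bs ← choices B xs ] ∑[ as ← choices B (zipWith s xs bs) ]
      K (a₀ ∷ as) (b₀ ∷ bs) (s (s x b₀) a₀ ∷ zipWith s (zipWith s xs bs) as)
  ≡⟨ split (λ b a → K a b) ⟨
    ∑[ b ← choices B (x ∷ xs) ] ∑[ a ← choices B (zipWith s (x ∷ xs) b) ]
      K a b (zipWith s (zipWith s (x ∷ xs) b) a)
  ∎
  where
  open ≡-Reasoning
  Kₜ : A → A → A → ℤ
  Kₜ a₀ b₀ c₀ = ∑[ as ← choices B xs ] ∑[ bs ← choices B (zipWith s xs as) ]
                  K (a₀ ∷ as) (b₀ ∷ bs) (c₀ ∷ zipWith s (zipWith s xs as) bs)
  split : (K : Vec A (suc n) → Vec A (suc n) → Vec A (suc n) → ℤ) →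
    ∑[ a ← choices B (x ∷ xs) ] ∑[ b ← choices B (zipWith s (x ∷ xs) a) ]
      K a b (zipWith s (zipWith s (x ∷ xs) a) b) ≡
    ∑[ a₀ ← B x ] ∑[ b₀ ← B (s x a₀) ] ∑[ as ← choices B xs ] ∑[ bs ← choices B (zipWith s xs as) ]
      K (a₀ ∷ as) (b₀ ∷ bs) (s (s x a₀) b₀ ∷ zipWith s (zipWith s xs as) bs)
  split K = trans (∑-choices-∷ B x xs _) (∑-cong (B x) λ a₀ →
    trans (∑-cong (choices B xs) (λ as → ∑-choices-∷ B (s x a₀) (zipWith s xs as) _))
          (∑-comm (choices B xs) (B (s x a₀)) _))

∏ᵛ : (A → ℤ) → Vec A n → ℤ
∏ᵛ g []       = 1ℤ
∏ᵛ g (x ∷ xs) = g x * ∏ᵛ g xs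

∏ᵛ₂ : (A → A → ℤ) → Vec A n → Vec A n → ℤ
∏ᵛ₂ g []       []       = 1ℤ
∏ᵛ₂ g (x ∷ xs) (a ∷ as) = g x a * ∏ᵛ₂ g xs as

∏ᵛ-cong : {f g : A → ℤ} → (∀ x → f x ≡ g x) → (v : Vec A n) → ∏ᵛ f v ≡ ∏ᵛ g v
∏ᵛ-cong f≗g []      = refl
∏ᵛ-cong f≗g (x ∷ v) = cong₂ _*_ (f≗g x) (∏ᵛ-cong f≗g v)

∏ᵛ₂-cong : {f g : A → A → ℤ} → (∀ x y → f x y ≡ g x y) → (v w : Vec A n) → ∏ᵛ₂ f v w ≡ ∏ᵛ₂ g v w
∏ᵛ₂-cong f≗g []      []      = refl
∏ᵛ₂-cong f≗g (x ∷ v) (y ∷ w) = cong₂ _*_ (f≗g x y) (∏ᵛ₂-cong f≗g v w)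

∏ᵛ-* : (f g : A → ℤ) (v : Vec A n) → ∏ᵛ f v * ∏ᵛ g v ≡ ∏ᵛ (λ x → f x * g x) v
∏ᵛ-* f g []      = refl
∏ᵛ-* f g (x ∷ v) = trans (*-interchange (f x) _ (g x) _) (cong (f x * g x *_) (∏ᵛ-* f g v))

∏ᵛ-*-zipWith : (s : A → A → A) (f h : A → ℤ) (xs as : Vec A n) →
               ∏ᵛ f as * ∏ᵛ h (zipWith s xs as) ≡ ∏ᵛ₂ (λ x a → f a * h (s x a)) xs as
∏ᵛ-*-zipWith s f h []       []       = refl
∏ᵛ-*-zipWith s f h (x ∷ xs) (a ∷ as) =
  trans (*-interchange (f a) _ (h (s x a)) _) (cong (f a * h (s x a) *_) (∏ᵛ-*-zipWith s f h xs as))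

∑-choices-∏ᵛ₂ : (B : A → List A) (g : A → A → ℤ) (xs : Vec A n) →
                ∑ (choices B xs) (∏ᵛ₂ g xs) ≡ ∏ᵛ (λ x → ∑ (B x) (g x)) xs
∑-choices-∏ᵛ₂ B g []       = refl
∑-choices-∏ᵛ₂ B g (x ∷ xs) = begin
    ∑ (choices B (x ∷ xs)) (∏ᵛ₂ g (x ∷ xs))
  ≡⟨ ∑-choices-∷ B x xs _ ⟩
    ∑[ a ← B x ] ∑[ as ← choices B xs ] (g x a * ∏ᵛ₂ g xs as)
  ≡⟨ ∑-cong (B x) (λ a → ∑-*ˡ (choices B xs) (g x a) _) ⟩
    ∑[ a ← B x ] (g x a * ∑ (choices B xs) (∏ᵛ₂ g xs))
  ≡⟨ ∑-*ʳ (B x) _ (g x) ⟩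
    ∑ (B x) (g x) * ∑ (choices B xs) (∏ᵛ₂ g xs)
  ≡⟨ cong (∑ (B x) (g x) *_) (∑-choices-∏ᵛ₂ B g xs) ⟩
    ∑ (B x) (g x) * ∏ᵛ (λ x → ∑ (B x) (g x)) xs
  ∎
  where open ≡-Reasoning

monomialsBelow : Mono D N → List (Mono D N)
monomialsBelow = choices (choices atMost)

_∸ᵐ_ : Mono D N → Mono D N → Mono D N
_∸ᵐ_ = zipWith (zipWith _∸_)

∏ᵉ : (ℕ → ℤ) → Mono D N → ℤ
∏ᵉ φ = ∏ᵛ (∏ᵛ φ)

∏ᵉ-cong : {f g : ℕ → ℤ} → (∀ x → f x ≡ g x) → (e : Mono D N) → ∏ᵉ f e ≡ ∏ᵉ g e
∏ᵉ-cong f≗g = ∏ᵛ-cong (∏ᵛ-cong f≗g)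

∏ᵉ-* : (f g : ℕ → ℤ) (e : Mono D N) → ∏ᵉ f e * ∏ᵉ g e ≡ ∏ᵉ (λ x → f x * g x) e
∏ᵉ-* f g []      = refl
∏ᵉ-* f g (r ∷ e) = trans (*-interchange (∏ᵛ f r) _ (∏ᵛ g r) _) (cong₂ _*_ (∏ᵛ-* f g r) (∏ᵉ-* f g e))

·S-coefficient : (f g : Series) (e : Mono D N) →
                 (f ·S g) D N e ≡ ∑[ a ← monomialsBelow e ] (f D N a * g D N (e ∸ᵐ a))
·S-coefficient {D} {N} f g e =
  trans (cong (λ L → ∑[ a ← L ] (f D N a * g D N (subM e a))) (belowM≡ e))
        (∑-cong (monomialsBelow e) (λ a → cong (λ c → f D N a * g D N c) (subM≡ e a)))
  where
  belowV≡ : (v : Vec ℕ n) → belowV v ≡ choices atMost v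
  belowV≡ []       = refl
  belowV≡ (x ∷ xs) = cong (λ L → concatMap (λ a → map (a ∷_) L) (atMost x)) (belowV≡ xs)
  belowM≡ : ∀ {D} (e : Mono D N) → belowM e ≡ monomialsBelow e
  belowM≡ []       = refl
  belowM≡ (r ∷ rs) = cong₂ (λ L R → concatMap (λ a → map (a ∷_) L) R) (belowM≡ rs) (belowV≡ r)
  subV≡ : (v w : Vec ℕ n) → subV v w ≡ zipWith _∸_ v w
  subV≡ []       []       = refl
  subV≡ (x ∷ xs) (y ∷ ys) = cong ((x ∸ y) ∷_) (subV≡ xs ys)
  subM≡ : ∀ {D} (e a : Mono D N) → subM e a ≡ e ∸ᵐ a
  subM≡ []       []       = refl
  subM≡ (r ∷ rs) (s ∷ ss) = cong₂ _∷_ (subV≡ r s) (subM≡ rs ss)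

·S-congʳ : (f : Series) {g h : Series} → g ≈S h → (f ·S g) ≈S (f ·S h)
·S-congʳ f g≈h D N e = ∑-cong (belowM e) (λ a → cong (f D N a *_) (g≈h D N (subM e a)))

·S-lcomm : (f g h : Series) → (f ·S (g ·S h)) ≈S (g ·S (f ·S h))
·S-lcomm f g h D N e = begin
    (f ·S (g ·S h)) D N e
  ≡⟨ expand f g h ⟩
    ∑[ a ← monomialsBelow e ] ∑[ b ← monomialsBelow (e ∸ᵐ a) ]
      (f D N a * (g D N b * h D N ((e ∸ᵐ a) ∸ᵐ b)))
  ≡⟨ exchangeable e (λ a b c → f D N a * (g D N b * h D N c)) ⟩
    ∑[ b ← monomialsBelow e ] ∑[ a ← monomialsBelow (e ∸ᵐ b) ]
      (f D N a * (g D N b * h D N ((e ∸ᵐ b) ∸ᵐ a)))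
  ≡⟨ ∑-cong (monomialsBelow e) (λ b → ∑-cong (monomialsBelow (e ∸ᵐ b)) (λ a →
       *-left-comm (f D N a) (g D N b) _)) ⟩
    ∑[ b ← monomialsBelow e ] ∑[ a ← monomialsBelow (e ∸ᵐ b) ]
      (g D N b * (f D N a * h D N ((e ∸ᵐ b) ∸ᵐ a)))
  ≡⟨ expand g f h ⟨
    (g ·S (f ·S h)) D N e
  ∎
  where
  open ≡-Reasoning
  exchangeable : Exchangeable (monomialsBelow {D} {N}) _∸ᵐ_
  exchangeable = choices-exchangeable _ _ (choices-exchangeable atMost _∸_ atMost-exchangeable N) D
  expand : (f g h : Series) → (f ·S (g ·S h)) D N e ≡
    ∑[ a ← monomialsBelow e ] ∑[ b ← monomialsBelow (e ∸ᵐ a) ] (f D N a * (g D N b * h D N ((e ∸ᵐ a) ∸ᵐ b)))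
  expand f g h = trans (·S-coefficient f (g ·S h) e) (∑-cong (monomialsBelow e) λ a →
    trans (cong (f D N a *_) (·S-coefficient g h (e ∸ᵐ a))) (sym (∑-*ˡ (monomialsBelow (e ∸ᵐ a)) (f D N a) _)))

·S-∑ : (f : Series) (L : List A) (w v : A → ℤ) (g : A → Series) (e : Mono D N) →
       (f ·S (λ D N e → ∑[ x ← L ] (w x * (v x * g x D N e)))) D N e ≡ ∑[ x ← L ] (w x * (v x * (f ·S g x) D N e))
·S-∑ {D = D} {N} f L w v g e = begin
    ∑[ a ← belowM e ] (f D N a * ∑[ x ← L ] (w x * (v x * g x D N (subM e a))))
  ≡⟨ ∑-cong (belowM e) (λ a → trans (sym (∑-*ˡ L (f D N a) _)) (∑-cong L (λ x → rotate (f D N a) (w x) (v x) _))) ⟩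
    ∑[ a ← belowM e ] ∑[ x ← L ] (w x * (v x * (f D N a * g x D N (subM e a))))
  ≡⟨ ∑-comm (belowM e) L _ ⟩
    ∑[ x ← L ] ∑[ a ← belowM e ] (w x * (v x * (f D N a * g x D N (subM e a))))
  ≡⟨ ∑-cong L (λ x → trans (∑-*ˡ (belowM e) (w x) _) (cong (w x *_) (∑-*ˡ (belowM e) (v x) _))) ⟩
    ∑[ x ← L ] (w x * (v x * (f ·S g x) D N e))
  ∎
  where
  open ≡-Reasoning
  rotate : ∀ a b c d → a * (b * (c * d)) ≡ b * (c * (a * d))
  rotate = solve-∀

prodS-insertˢ : (g : Stack → Series) (s : Stack) (L : List Stack) →
                prodS (map g (insertˢ s L)) ≈S (g s ·S prodS (map g L))
prodS-insertˢ g s []      D N e = refl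
prodS-insertˢ g s (t ∷ L) D N e with s ≥ˢ t
... | true  = refl
... | false = trans (·S-congʳ (g t) (prodS-insertˢ g s L) D N e) (·S-lcomm (g t) (g s) (prodS (map g L)) D N e)

sumS-map : (g : A → Series) (L : List A) (e : Mono D N) → sumS (map g L) D N e ≡ ∑[ x ← L ] g x D N e
sumS-map g []      e = refl
sumS-map {D = D} {N} g (x ∷ L) e = cong (g x D N e +_) (sumS-map g L e)

-- sequences ℕ → ℤ as power series in one variable y, multiplied by ⋆
_⋆_ : (ℕ → ℤ) → (ℕ → ℤ) → ℕ → ℤ
(f ⋆ h) n = ∑[ x ← atMost n ] (f x * h (n ∸ x))

∑-∏ᵉ-⋆ : (f h : ℕ → ℤ) (e : Mono D N) →
         ∑[ a ← monomialsBelow e ] (∏ᵉ f a * ∏ᵉ h (e ∸ᵐ a)) ≡ ∏ᵉ (f ⋆ h) e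
∑-∏ᵉ-⋆ f h e = begin
    ∑[ a ← monomialsBelow e ] (∏ᵉ f a * ∏ᵉ h (e ∸ᵐ a))
  ≡⟨ ∑-cong (monomialsBelow e) (λ a → ∏ᵛ-*-zipWith (zipWith _∸_) (∏ᵛ f) (∏ᵛ h) e a) ⟩
    ∑ (monomialsBelow e) (∏ᵛ₂ (λ r a → ∏ᵛ f a * ∏ᵛ h (zipWith _∸_ r a)) e)
  ≡⟨ ∑-cong (monomialsBelow e) (∏ᵛ₂-cong (λ r a → ∏ᵛ-*-zipWith _∸_ f h r a) e) ⟩
    ∑ (monomialsBelow e) (∏ᵛ₂ (∏ᵛ₂ (λ x b → f b * h (x ∸ b))) e)
  ≡⟨ ∑-choices-∏ᵛ₂ (choices atMost) _ e ⟩
    ∏ᵛ (λ r → ∑ (choices atMost r) (∏ᵛ₂ (λ x b → f b * h (x ∸ b)) r)) e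
  ≡⟨ ∏ᵛ-cong (λ r → ∑-choices-∏ᵛ₂ atMost _ r) e ⟩
    ∏ᵉ (f ⋆ h) e
  ∎
  where open ≡-Reasoning

⋆-comm : ∀ (f h : ℕ → ℤ) n → (f ⋆ h) n ≡ (h ⋆ f) n
⋆-comm f h n = begin
    (f ⋆ h) n
  ≡⟨ ∑-applyUpTo id (suc n) (λ x → f x * h (n ∸ x)) ⟩
    ∑< (suc n) (λ x → f x * h (n ∸ x))
  ≡⟨ ∑<-reverse n (λ x → f x * h (n ∸ x)) ⟩
    ∑< (suc n) (λ x → f (n ∸ x) * h (n ∸ (n ∸ x)))
  ≡⟨ ∑<-cong-< (suc n) (λ x x≤n → trans (cong (f (n ∸ x) *_) (cong h (ℕ.m∸[m∸n]≡n (ℕ.≤-pred x≤n))))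
                                        (*-comm (f (n ∸ x)) (h x))) ⟩
    ∑< (suc n) (λ x → h x * f (n ∸ x))
  ≡⟨ ∑-applyUpTo id (suc n) (λ x → h x * f (n ∸ x)) ⟨
    (h ⋆ f) n
  ∎
  where open ≡-Reasoning

⋆-congˡ : ∀ {f f′ : ℕ → ℤ} (h : ℕ → ℤ) → (∀ x → f x ≡ f′ x) → ∀ n → (f ⋆ h) n ≡ (f′ ⋆ h) n
⋆-congˡ h f≗f′ n = ∑-cong (atMost n) (λ x → cong (_* h (n ∸ x)) (f≗f′ x))

⋆-congʳ : ∀ (f : ℕ → ℤ) {h h′ : ℕ → ℤ} → (∀ x → h x ≡ h′ x) → ∀ n → (f ⋆ h) n ≡ (f ⋆ h′) n
⋆-congʳ f h≗h′ n = ∑-cong (atMost n) (λ x → cong (f x *_) (h≗h′ (n ∸ x)))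

⋆-left-comm : ∀ (f g h : ℕ → ℤ) n → (f ⋆ (g ⋆ h)) n ≡ (g ⋆ (f ⋆ h)) n
⋆-left-comm f g h n = begin
    ∑[ a ← atMost n ] (f a * ∑[ b ← atMost (n ∸ a) ] (g b * h (n ∸ a ∸ b)))
  ≡⟨ ∑-cong (atMost n) (λ a → sym (∑-*ˡ (atMost (n ∸ a)) (f a) _)) ⟩
    ∑[ a ← atMost n ] ∑[ b ← atMost (n ∸ a) ] (f a * (g b * h (n ∸ a ∸ b)))
  ≡⟨ atMost-exchangeable n (λ a b c → f a * (g b * h c)) ⟩
    ∑[ b ← atMost n ] ∑[ a ← atMost (n ∸ b) ] (f a * (g b * h (n ∸ b ∸ a)))
  ≡⟨ ∑-cong (atMost n) (λ b → trans (∑-cong (atMost (n ∸ b)) (λ a → *-left-comm (f a) (g b) _))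
                                    (∑-*ˡ (atMost (n ∸ b)) (g b) _)) ⟩
    ∑[ b ← atMost n ] (g b * ∑[ a ← atMost (n ∸ b) ] (f a * h (n ∸ b ∸ a)))
  ∎
  where open ≡-Reasoning

δ₀-⋆ : ∀ (h : ℕ → ℤ) n → (δ₀ ⋆ h) n ≡ h n
δ₀-⋆ h n = trans (∑-applyUpTo id (suc n) (λ x → δ₀ x * h (n ∸ x)))
  (trans (cong₂ _+_ (*-identityˡ (h n)) (∑<-zero n (λ x → *-zeroˡ (h (n ∸ suc x))))) (+-identityʳ (h n)))

⋆-δ₀ˡ : (f h : ℕ → ℤ) (n : ℕ) → ((λ x → δ₀ x * f x) ⋆ h) n ≡ f 0 * h n
⋆-δ₀ˡ f h n = trans (∑-applyUpTo id (suc n) (λ x → δ₀ x * f x * h (n ∸ x)))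
  (trans (cong₂ _+_ (cong (_* h n) (*-identityˡ (f 0))) (∑<-zero n (λ _ → refl))) (+-identityʳ _))

⋆-cancel : ∀ (b c ψ : ℕ → ℤ) → (∀ n → (b ⋆ c) n ≡ δ₀ n) → ∀ n → (b ⋆ (c ⋆ ψ)) n ≡ ψ n
⋆-cancel b c ψ b⋆c≡δ₀ n = begin
    (b ⋆ (c ⋆ ψ)) n
  ≡⟨ ⋆-congʳ b (⋆-comm c ψ) n ⟩
    (b ⋆ (ψ ⋆ c)) n
  ≡⟨ ⋆-left-comm b ψ c n ⟩
    (ψ ⋆ (b ⋆ c)) n
  ≡⟨ ⋆-congʳ ψ b⋆c≡δ₀ n ⟩
    (ψ ⋆ δ₀) n
  ≡⟨ trans (⋆-comm ψ δ₀ n) (δ₀-⋆ ψ n) ⟩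
    ψ n
  ∎
  where open ≡-Reasoning

onePlusPow : ℕ → ℕ → ℤ
onePlusPow q x = δ₀ x + 𝟙 (x ≡ᵇ q)

onePlusPow-⋆ : ∀ q (h : ℕ → ℤ) n → 1 ≤ q → (onePlusPow q ⋆ h) n ≡ h n + 𝟙 (q ≤ᵇ n) * h (n ∸ q)
onePlusPow-⋆ (suc k) h n _ = begin
    ∑[ x ← atMost n ] ((δ₀ x + 𝟙 (x ≡ᵇ suc k)) * h (n ∸ x))
  ≡⟨ ∑-cong (atMost n) (λ x → *-distribʳ-+ (h (n ∸ x)) (δ₀ x) (𝟙 (x ≡ᵇ suc k))) ⟩
    ∑[ x ← atMost n ] (δ₀ x * h (n ∸ x) + 𝟙 (x ≡ᵇ suc k) * h (n ∸ x))
  ≡⟨ ∑-distrib-+ (atMost n) (λ x → δ₀ x * h (n ∸ x)) (λ x → 𝟙 (x ≡ᵇ suc k) * h (n ∸ x)) ⟩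
    (δ₀ ⋆ h) n + ∑[ x ← atMost n ] (𝟙 (x ≡ᵇ suc k) * h (n ∸ x))
  ≡⟨ cong₂ _+_ (δ₀-⋆ h n) (trans (∑-applyUpTo id (suc n) (λ x → 𝟙 (x ≡ᵇ suc k) * h (n ∸ x)))
                                 (∑<-δ (suc n) (suc k) (λ x → h (n ∸ x)))) ⟩
    h n + 𝟙 (k <ᵇ n) * h (n ∸ suc k)
  ∎
  where open ≡-Reasoning

-- Degrees and weighted series

choices-pointwise : (B : A → List A) (R : A → A → Set) → (∀ x → All (λ a → R a x) (B x)) →
                    (xs : Vec A n) → All (λ as → Pointwise R as xs) (choices B xs)
choices-pointwise B R B⊆R []       = [] ∷ []
choices-pointwise B R B⊆R (x ∷ xs) = All.concat⁺ (All.map⁺ (All.map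
  (λ Rax → All.map⁺ (All.map (Rax ∷_) (choices-pointwise B R B⊆R xs))) (B⊆R x)))

_≤ᵐ_ : Mono D N → Mono D N → Set
_≤ᵐ_ = Pointwise (Pointwise _≤_)

monomialsBelow-≤ᵐ : (e : Mono D N) → All (_≤ᵐ e) (monomialsBelow e)
monomialsBelow-≤ᵐ = choices-pointwise _ _ (choices-pointwise atMost _≤_ atMost-≤)

degreeFrom : ℕ → Mono D N → ℕ
degreeFrom i []       = 0
degreeFrom i (r ∷ rs) = i ℕ.* sumᵛ r ℕ.+ degreeFrom (suc i) rs

degree : Mono D N → ℕ
degree = degreeFrom 1

degree-∸ᵐ : {a e : Mono D N} → a ≤ᵐ e → degree a ℕ.+ degree (e ∸ᵐ a) ≡ degree e
degree-∸ᵐ = go 1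
  where
  sum-∸ : {a r : Vec ℕ n} → Pointwise _≤_ a r → sumᵛ a ℕ.+ sumᵛ (zipWith _∸_ r a) ≡ sumᵛ r
  sum-∸ []         = refl
  sum-∸ {a = a ∷ as} {x ∷ xs} (a≤x ∷ as≤xs) =
    trans (ℕ-+-interchange a (sumᵛ as) (x ∸ a) _) (cong₂ ℕ._+_ (ℕ.m+[n∸m]≡n a≤x) (sum-∸ as≤xs))
  go : ∀ i {D} {a e : Mono D N} → a ≤ᵐ e → degreeFrom i a ℕ.+ degreeFrom i (e ∸ᵐ a) ≡ degreeFrom i e
  go i []                       = refl
  go i {a = a ∷ as} {r ∷ rs} (a≤r ∷ as≤rs) =
    trans (ℕ-+-interchange (i ℕ.* sumᵛ a) _ (i ℕ.* sumᵛ (zipWith _∸_ r a)) _)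
          (cong₂ ℕ._+_ (trans (sym (ℕ.*-distribˡ-+ i (sumᵛ a) _)) (cong (i ℕ.*_) (sum-∸ a≤r)))
                       (go (suc i) as≤rs))

∏ᵉ-cong-≤ : ∀ {f g : ℕ → ℤ} B → (∀ x → x ≤ B → f x ≡ g x) →
            (e : Mono D N) → degree e ≤ B → ∏ᵉ f e ≡ ∏ᵉ g e
∏ᵉ-cong-≤ {f = f} {g} B f≗g = go 0
  where
  row : (r : Vec ℕ n) → sumᵛ r ≤ B → ∏ᵛ f r ≡ ∏ᵛ g r
  row []      _ = refl
  row (x ∷ r) s≤B = cong₂ _*_ (f≗g x (ℕ.m+n≤o⇒m≤o x s≤B)) (row r (ℕ.m+n≤o⇒n≤o x s≤B))
  go : ∀ i {D} (e : Mono D N) → degreeFrom (suc i) e ≤ B → ∏ᵉ f e ≡ ∏ᵉ g e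
  go i []       _   = refl
  go i (r ∷ rs) d≤B = cong₂ _*_
    (row r (ℕ.≤-trans (ℕ.m≤m+n (sumᵛ r) (i ℕ.* sumᵛ r)) (ℕ.m+n≤o⇒m≤o (suc i ℕ.* sumᵛ r) d≤B)))
    (go (suc i) rs (ℕ.m+n≤o⇒n≤o (suc i ℕ.* sumᵛ r) d≤B))

δ₀-degree : (e : Mono D N) → δ₀ (degree e) ≡ ∏ᵉ δ₀ e
δ₀-degree = go 0
  where
  +-≡0 : ∀ a b → (a ℕ.+ b ≡ᵇ 0) ≡ ((a ≡ᵇ 0) ∧ (b ≡ᵇ 0))
  +-≡0 zero    b = refl
  +-≡0 (suc a) b = refl
  suc-*-≡0 : ∀ i s → (suc i ℕ.* s ≡ᵇ 0) ≡ (s ≡ᵇ 0)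
  suc-*-≡0 i zero    = cong (_≡ᵇ 0) (ℕ.*-zeroʳ i)
  suc-*-≡0 i (suc s) = refl
  row : (r : Vec ℕ n) → δ₀ (sumᵛ r) ≡ ∏ᵛ δ₀ r
  row []      = refl
  row (x ∷ r) = trans (cong 𝟙 (+-≡0 x (sumᵛ r))) (trans (𝟙-∧ (x ≡ᵇ 0) _) (cong (δ₀ x *_) (row r)))
  go : ∀ i {D} (e : Mono D N) → δ₀ (degreeFrom (suc i) e) ≡ ∏ᵉ δ₀ e
  go i []       = refl
  go i (r ∷ rs) = trans (cong 𝟙 (+-≡0 (suc i ℕ.* sumᵛ r) _))
    (trans (𝟙-∧ (suc i ℕ.* sumᵛ r ≡ᵇ 0) _)
           (cong₂ _*_ (trans (cong 𝟙 (suc-*-≡0 i (sumᵛ r))) (row r)) (go (suc i) rs)))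

𝟙-isZeroM : (e : Mono D N) → 𝟙 (isZeroM e) ≡ ∏ᵉ δ₀ e
𝟙-isZeroM []      = refl
𝟙-isZeroM (r ∷ e) = trans (𝟙-∧ (isZeroV r) _) (cong₂ _*_ (row r) (𝟙-isZeroM e))
  where
  row : (r : Vec ℕ n) → 𝟙 (isZeroV r) ≡ ∏ᵛ δ₀ r
  row []      = refl
  row (x ∷ r) = trans (𝟙-∧ (x ≡ᵇ 0) _) (cong (δ₀ x *_) (row r))

weighted : ℕ → (ℕ → ℤ) → Series
weighted i φ D N e = 𝟙 (degree e ≡ᵇ i) * ∏ᵉ φ e

weighted-cong-≤ : ∀ n {f g : ℕ → ℤ} → (∀ x → x ≤ n → f x ≡ g x) → weighted n f ≈S weighted n g
weighted-cong-≤ n f≗g D N e with degree e ≡ᵇ n in deg≡n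
... | false = refl
... | true  = cong (1ℤ *_) (∏ᵉ-cong-≤ n f≗g e (ℕ.≤-reflexive (ℕ.≡ᵇ⇒≡ (degree e) n (≡true⇒T deg≡n))))

-- Substituting x ↦ x^q

_∣ᵇ_ : ℕ → ℕ → Bool
q ∣ᵇ x = ⌊ q ∣? x ⌋

-- x ÷ 0 = 0; every use below has a nonzero divisor.
_÷_ : ℕ → ℕ → ℕ
x ÷ zero  = 0
x ÷ suc k = x / suc k

dilate : ℕ → (ℕ → ℤ) → ℕ → ℤ
dilate q φ x = 𝟙 (q ∣ᵇ x) * φ (x ÷ q)

∣ᵇ-true : ∀ {q x} → q ∣ x → (q ∣ᵇ x) ≡ true
∣ᵇ-true {q} {x} q∣x with q ∣? x
... | yes _   = refl
... | no  q∤x = ⊥-elim (q∤x q∣x)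

dilate-0 : ∀ q φ → dilate q φ 0 ≡ φ 0
dilate-0 q φ rewrite ∣ᵇ-true (q ∣0) = trans (*-identityˡ _) (cong φ (0÷ q))
  where
  0÷ : ∀ q → 0 ÷ q ≡ 0
  0÷ zero    = refl
  0÷ (suc k) = refl

substPow-cong : ∀ q {F G} → F ≈S G → substPow q F ≈S substPow q G
substPow-cong zero    F≈G D N e = refl
substPow-cong (suc k) F≈G D N e with allDivM (suc k) e
... | true  = F≈G D N (divM k e)
... | false = refl

∏ᵉ-dilate : ∀ k φ (e : Mono D N) → ∏ᵉ (dilate (suc k) φ) e ≡ 𝟙 (allDivM (suc k) e) * ∏ᵉ φ (divM k e)
∏ᵉ-dilate k φ []      = refl
∏ᵉ-dilate k φ (r ∷ e) = trans (cong₂ _*_ (row r) (∏ᵉ-dilate k φ e))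
  (trans (*-interchange (𝟙 (allDivV (suc k) r)) _ _ _)
         (cong (_* (∏ᵛ φ (divV k r) * ∏ᵉ φ (divM k e))) (sym (𝟙-∧ (allDivV (suc k) r) _))))
  where
  row : (r : Vec ℕ n) → ∏ᵛ (dilate (suc k) φ) r ≡ 𝟙 (allDivV (suc k) r) * ∏ᵛ φ (divV k r)
  row []      = refl
  row (x ∷ r) = trans (cong (dilate (suc k) φ x *_) (row r))
    (trans (*-interchange (𝟙 (suc k ∣ᵇ x)) _ _ _)
           (cong (_* (φ (x / suc k) * ∏ᵛ φ (divV k r))) (sym (𝟙-∧ (suc k ∣ᵇ x) _))))

degree-divM : ∀ k (e : Mono D N) → allDivM (suc k) e ≡ true → degree (divM k e) ℕ.* suc k ≡ degree e
degree-divM k = rows 1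
  where
  ∣-true : ∀ x → (suc k ∣ᵇ x) ≡ true → x / suc k ℕ.* suc k ≡ x
  ∣-true x t with suc k ∣? x
  ∣-true .(q ℕ.* suc k) t | yes (divides q refl) = cong (ℕ._* suc k) (m*n/n≡m q (suc k))
  row : (r : Vec ℕ n) → allDivV (suc k) r ≡ true → sumᵛ (divV k r) ℕ.* suc k ≡ sumᵛ r
  row []      _ = refl
  row (x ∷ r) t with ∧-true {suc k ∣ᵇ x} t
  ... | x∣ , r∣ = trans (ℕ.*-distribʳ-+ (suc k) (x / suc k) _) (cong₂ ℕ._+_ (∣-true x x∣) (row r r∣))
  rows : ∀ j {D} (e : Mono D N) → allDivM (suc k) e ≡ true → degreeFrom j (divM k e) ℕ.* suc k ≡ degreeFrom j e
  rows j []      _ = refl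
  rows j (r ∷ e) t with ∧-true {allDivV (suc k) r} t
  ... | r∣ , e∣ = trans (ℕ.*-distribʳ-+ (suc k) (j ℕ.* sumᵛ (divV k r)) _)
    (cong₂ ℕ._+_ (trans (ℕ.*-assoc j _ (suc k)) (cong (j ℕ.*_) (row r r∣))) (rows (suc j) e e∣))

substPow-weighted : ∀ q i φ → 1 ≤ q → substPow q (weighted i φ) ≈S weighted (q ℕ.* i) (dilate q φ)
substPow-weighted (suc k) i φ _ D N e rewrite ∏ᵉ-dilate k φ e with allDivM (suc k) e in divisible
... | true  = trans (cong (λ b → 𝟙 b * ∏ᵉ φ (divM k e)) same-degree)
                    (cong (𝟙 (degree e ≡ᵇ suc k ℕ.* i) *_) (sym (*-identityˡ _)))
  where
  same-degree : (degree (divM k e) ≡ᵇ i) ≡ (degree e ≡ᵇ suc k ℕ.* i)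
  same-degree = T-ext
    (λ t → ℕ.≡⇒≡ᵇ (degree e) (suc k ℕ.* i) (trans (sym (degree-divM k e divisible))
                              (trans (cong (ℕ._* suc k) (ℕ.≡ᵇ⇒≡ (degree (divM k e)) i t)) (ℕ.*-comm i (suc k)))))
    (λ t → ℕ.≡⇒≡ᵇ (degree (divM k e)) i (ℕ.*-cancelʳ-≡ _ i (suc k)
             (trans (degree-divM k e divisible) (trans (ℕ.≡ᵇ⇒≡ _ _ t) (ℕ.*-comm (suc k) i)))))
... | false = sym (trans (cong (𝟙 (degree e ≡ᵇ suc k ℕ.* i) *_) (*-zeroˡ (∏ᵉ φ (divM k e))))
                         (*-zeroʳ (𝟙 (degree e ≡ᵇ suc k ℕ.* i))))

atStack-weighted : ∀ {F φ} → (∀ i → F i ≈S weighted i φ) → ∀ i q → 1 ≤ q →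
                   atStack F (i , q) ≈S weighted (q ℕ.* i) (dilate q φ)
atStack-weighted {φ = φ} F≈ i q 1≤q D N e =
  trans (substPow-cong q (F≈ i) D N e) (substPow-weighted q i φ 1≤q D N e)

==ˢ⇒≡ : ∀ s t → T (s ==ˢ t) → s ≡ t
==ˢ⇒≡ (a , b) (c , d) t with T-∧ .to t
... | a≡c , b≡d = cong₂ _,_ (ℕ.≡ᵇ⇒≡ a c a≡c) (ℕ.≡ᵇ⇒≡ b d b≡d)

==ˢ-refl : ∀ s → (s ==ˢ s) ≡ true
==ˢ-refl (a , b) rewrite ≡ᵇ-true {a} refl | ≡ᵇ-true {b} refl = refl

==ˢ-false : ∀ {s t} → s ≢ t → (s ==ˢ t) ≡ false
==ˢ-false {s} {t} s≢t = ¬T⇒≡false (s≢t ∘ ==ˢ⇒≡ s t)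

eqL⇒≡ : ∀ α β → T (eqL α β) → α ≡ β
eqL⇒≡ []      []      _ = refl
eqL⇒≡ (s ∷ α) (t ∷ β) p with T-∧ .to p
... | s≡t , α≡β = cong₂ _∷_ (==ˢ⇒≡ s t s≡t) (eqL⇒≡ α β α≡β)

eqL-refl : ∀ α → eqL α α ≡ true
eqL-refl []      = refl
eqL-refl (s ∷ α) rewrite ==ˢ-refl s = eqL-refl α

eqL-comm : ∀ α β → eqL α β ≡ eqL β α
eqL-comm α β = T-ext (flipped α β) (flipped β α)
  where
  flipped : ∀ α β → T (eqL α β) → T (eqL β α)
  flipped α β p rewrite eqL⇒≡ α β p = ≡true⇒T (eqL-refl β)

_≽_ : Stack → Stack → Set
(a , b) ≽ (c , d) = c < a ⊎ (a ≡ c × d ≤ b)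

≥ˢ⇒≽ : ∀ s t → T (s ≥ˢ t) → s ≽ t
≥ˢ⇒≽ (a , b) (c , d) p with T-∨ .to p
... | inj₁ c<a = inj₁ (ℕ.<ᵇ⇒< c a c<a)
... | inj₂ q with T-∧ .to q
...   | a≡c , d≤b = inj₂ (ℕ.≡ᵇ⇒≡ a c a≡c , ℕ.≤ᵇ⇒≤ d b d≤b)

≽⇒≥ˢ : ∀ s t → s ≽ t → (s ≥ˢ t) ≡ true
≽⇒≥ˢ (a , b) (c , d)  (inj₁ c<a)         rewrite <ᵇ-true c<a = refl
≽⇒≥ˢ (a , b) (.a , d) (inj₂ (refl , d≤b)) rewrite <ᵇ-false (ℕ.<-irrefl {a} refl) | ≡ᵇ-true {a} refl = ≤ᵇ-true d≤b

≥ˢ-refl : ∀ s → (s ≥ˢ s) ≡ true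
≥ˢ-refl (a , b) = ≽⇒≥ˢ (a , b) (a , b) (inj₂ (refl , ℕ.≤-refl))

≥ˢ-false⇒≢ : ∀ {s t} → (s ≥ˢ t) ≡ false → s ≢ t
≥ˢ-false⇒≢ {s} s≱s refl with () ← trans (sym s≱s) (≥ˢ-refl s)

≥ˢ-total : ∀ s t → (s ≥ˢ t) ≡ false → (t ≥ˢ s) ≡ true
≥ˢ-total (a , b) (c , d) s≱t = ≽⇒≥ˢ (c , d) (a , b) (flip (ℕ.<-cmp a c))
  where
  s⋡t : ¬ (a , b) ≽ (c , d)
  s⋡t s≽t with () ← trans (sym s≱t) (≽⇒≥ˢ (a , b) (c , d) s≽t)
  flip : Tri (a < c) (a ≡ c) (c < a) → (c , d) ≽ (a , b)
  flip (tri< a<c _ _)    = inj₁ a<c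
  flip (tri> _ _ c<a)    = ⊥-elim (s⋡t (inj₁ c<a))
  flip (tri≈ _ refl _) with d ℕ.≤? b
  ... | yes d≤b = ⊥-elim (s⋡t (inj₂ (refl , d≤b)))
  ... | no  d≰b = inj₂ (refl , ℕ.<⇒≤ (ℕ.≰⇒> d≰b))

≥ˢ-trans : ∀ s t u → (s ≥ˢ t) ≡ true → (t ≥ˢ u) ≡ true → (s ≥ˢ u) ≡ true
≥ˢ-trans s t u s≥t t≥u = ≽⇒≥ˢ s u (≽-trans s t u (≥ˢ⇒≽ s t (≡true⇒T s≥t)) (≥ˢ⇒≽ t u (≡true⇒T t≥u)))
  where
  ≽-trans : ∀ s t u → s ≽ t → t ≽ u → s ≽ u
  ≽-trans _ _ _ (inj₁ p)         (inj₁ q)         = inj₁ (ℕ.<-trans q p)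
  ≽-trans _ _ _ (inj₁ p)         (inj₂ (refl , _)) = inj₁ p
  ≽-trans _ _ _ (inj₂ (refl , _)) (inj₁ q)         = inj₁ q
  ≽-trans _ _ _ (inj₂ (refl , p)) (inj₂ (refl , q)) = inj₂ (refl , ℕ.≤-trans q p)

≥ˢ-antisym : ∀ s t → (s ≥ˢ t) ≡ true → (t ≥ˢ s) ≡ true → s ≡ t
≥ˢ-antisym s t s≥t t≥s = ≽-antisym s t (≥ˢ⇒≽ s t (≡true⇒T s≥t)) (≥ˢ⇒≽ t s (≡true⇒T t≥s))
  where
  ≽-antisym : ∀ s t → s ≽ t → t ≽ s → s ≡ t
  ≽-antisym _ _ (inj₁ p)         (inj₁ q)         = ⊥-elim (ℕ.<-asym p q)
  ≽-antisym _ _ (inj₁ p)         (inj₂ (refl , _)) = ⊥-elim (ℕ.<-irrefl refl p)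
  ≽-antisym _ _ (inj₂ (refl , _)) (inj₁ q)         = ⊥-elim (ℕ.<-irrefl refl q)
  ≽-antisym (a , _) _ (inj₂ (refl , p)) (inj₂ (_ , q)) = cong (a ,_) (ℕ.≤-antisym q p)

headBelow : Stack → List Stack → Bool
headBelow u []      = true
headBelow u (t ∷ _) = u ≥ˢ t

isDecr-∷ : ∀ t L → isDecr (t ∷ L) ≡ (headBelow t L ∧ isDecr L)
isDecr-∷ t []      = refl
isDecr-∷ t (_ ∷ _) = refl

isDecr-head : ∀ t L → isDecr (t ∷ L) ≡ true → headBelow t L ≡ true
isDecr-head t L p = proj₁ (∧-true (trans (sym (isDecr-∷ t L)) p))

isDecr-tail : ∀ t L → isDecr (t ∷ L) ≡ true → isDecr L ≡ true
isDecr-tail t L p = proj₂ (∧-true (trans (sym (isDecr-∷ t L)) p))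

isDecr-insertˢ : ∀ s L → isDecr L ≡ true → isDecr (insertˢ s L) ≡ true
isDecr-insertˢ s []      _ = refl
isDecr-insertˢ s (t ∷ L) p with s ≥ˢ t in s≥t
... | true  = trans (isDecr-∷ s (t ∷ L)) (cong₂ _∧_ s≥t p)
... | false = trans (isDecr-∷ t (insertˢ s L))
  (cong₂ _∧_ (head-insert L (isDecr-head t L p)) (isDecr-insertˢ s L (isDecr-tail t L p)))
  where
  head-insert : ∀ L → headBelow t L ≡ true → headBelow t (insertˢ s L) ≡ true
  head-insert []      _ = ≥ˢ-total s t s≥t
  head-insert (u ∷ L) q with s ≥ˢ u
  ... | true  = ≥ˢ-total s t s≥t
  ... | false = q

isDecr-sortDesc : ∀ L → isDecr (sortDesc L) ≡ true
isDecr-sortDesc []      = refl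
isDecr-sortDesc (s ∷ L) = isDecr-insertˢ s (sortDesc L) (isDecr-sortDesc L)

insertˢ-head : ∀ t L → headBelow t L ≡ true → insertˢ t L ≡ t ∷ L
insertˢ-head t []      _ = refl
insertˢ-head t (u ∷ L) p rewrite p = refl

sortDesc-isDecr : ∀ L → isDecr L ≡ true → sortDesc L ≡ L
sortDesc-isDecr []      _ = refl
sortDesc-isDecr (t ∷ L) p =
  trans (cong (insertˢ t) (sortDesc-isDecr L (isDecr-tail t L p))) (insertˢ-head t L (isDecr-head t L p))

foldr-insertˢ : (f : Stack → A → A) (z : A) → (∀ s t a → f s (f t a) ≡ f t (f s a)) →
                ∀ s L → foldr f z (insertˢ s L) ≡ f s (foldr f z L)
foldr-insertˢ f z comm s []      = refl
foldr-insertˢ f z comm s (t ∷ L) with s ≥ˢ t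
... | true  = refl
... | false = trans (cong (f t) (foldr-insertˢ f z comm s L)) (comm t s _)

foldr-sortDesc : (f : Stack → A → A) (z : A) → (∀ s t a → f s (f t a) ≡ f t (f s a)) →
                 ∀ L → foldr f z (sortDesc L) ≡ foldr f z L
foldr-sortDesc f z comm []      = refl
foldr-sortDesc f z comm (s ∷ L) =
  trans (foldr-insertˢ f z comm s (sortDesc L)) (cong (f s) (foldr-sortDesc f z comm L))

weight-insertˢ : ∀ s L → weight (insertˢ s L) ≡ proj₁ s ℕ.* proj₂ s ℕ.+ weight L
weight-insertˢ = foldr-insertˢ _ 0 (λ s t → ℕ-+-left-comm (proj₁ s ℕ.* proj₂ s) _)

length-insertˢ : ∀ s L → length (insertˢ s L) ≡ suc (length L)
length-insertˢ = foldr-insertˢ _ 0 (λ _ _ _ → refl)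

countStack-insertˢ : ∀ u s L → countStack u (insertˢ s L) ≡ (if u ==ˢ s then 1 else 0) ℕ.+ countStack u L
countStack-insertˢ u = foldr-insertˢ _ 0 (λ s t → ℕ-+-left-comm (if u ==ˢ s then 1 else 0) _)

all-insertˢ : ∀ (p : Stack → Bool) s L → all p (insertˢ s L) ≡ (p s ∧ all p L)
all-insertˢ p s L = trans (all-foldr (insertˢ s L))
  (trans (foldr-insertˢ _ true (λ s t b → ∧-left-comm (p s) (p t) b) s L) (cong (p s ∧_) (sym (all-foldr L))))
  where
  all-foldr : ∀ L → all p L ≡ foldr (λ s b → p s ∧ b) true L
  all-foldr []      = refl
  all-foldr (s ∷ L) = cong (p s ∧_) (all-foldr L)
  ∧-left-comm : ∀ a b c → a ∧ (b ∧ c) ≡ b ∧ (a ∧ c)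
  ∧-left-comm true  b c = refl
  ∧-left-comm false true c = refl
  ∧-left-comm false false c = refl

all-sortDesc : ∀ (p : Stack → Bool) L → all p (sortDesc L) ≡ all p L
all-sortDesc p []      = refl
all-sortDesc p (s ∷ L) = trans (all-insertˢ p s (sortDesc L)) (cong (p s ∧_) (all-sortDesc p L))

weight-sortDesc : ∀ L → weight (sortDesc L) ≡ weight L
weight-sortDesc = foldr-sortDesc _ 0 (λ s t → ℕ-+-left-comm (proj₁ s ℕ.* proj₂ s) _)

removeˢ : Stack → List Stack → List Stack
removeˢ s []      = []
removeˢ s (t ∷ L) = if s ==ˢ t then L else t ∷ removeˢ s L

removeˢ-insertˢ : ∀ s L → removeˢ s (insertˢ s L) ≡ L
removeˢ-insertˢ s []      rewrite ==ˢ-refl s = refl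
removeˢ-insertˢ s (t ∷ L) with s ≥ˢ t in s≥t
... | true  rewrite ==ˢ-refl s = refl
... | false rewrite ==ˢ-false {s} {t} (≥ˢ-false⇒≢ s≥t) = cong (t ∷_) (removeˢ-insertˢ s L)

countStack-≤head : ∀ s t L → isDecr (t ∷ L) ≡ true → 0 < countStack s L → (t ≥ˢ s) ≡ true
countStack-≤head s t (u ∷ L) p c with s ==ˢ u in s≡u
... | true  rewrite ==ˢ⇒≡ s u (≡true⇒T s≡u) = isDecr-head t (u ∷ L) p
... | false = ≥ˢ-trans t u s (isDecr-head t (u ∷ L) p) (countStack-≤head s u L (isDecr-tail t (u ∷ L) p) c)

insertˢ-removeˢ : ∀ s τ → isDecr τ ≡ true → 0 < countStack s τ → insertˢ s (removeˢ s τ) ≡ τ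
insertˢ-removeˢ s (t ∷ τ) p c with s ==ˢ t in s≡t
... | true rewrite ==ˢ⇒≡ s t (≡true⇒T s≡t) = insertˢ-head t τ (isDecr-head t τ p)
... | false with s ≥ˢ t in s≥t
...   | true  with () ← trans (sym s≡t)
                    (trans (cong (s ==ˢ_) (sym (≥ˢ-antisym s t s≥t (countStack-≤head s t τ p c)))) (==ˢ-refl s))
...   | false = cong (t ∷_) (insertˢ-removeˢ s τ (isDecr-tail t τ p) c)

countStack-removeˢ : ∀ s τ u → isDecr τ ≡ true → 0 < countStack s τ →
                     countStack u τ ≡ (if u ==ˢ s then 1 else 0) ℕ.+ countStack u (removeˢ s τ)
countStack-removeˢ s τ u p c =
  trans (cong (countStack u) (sym (insertˢ-removeˢ s τ p c))) (countStack-insertˢ u s (removeˢ s τ))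

countStack-All : {P : Stack → Set} → ∀ s τ → All P τ → 0 < countStack s τ → P s
countStack-All s (t ∷ τ) (pt ∷ pτ) c with s ==ˢ t in s≡t
... | true rewrite ==ˢ⇒≡ s t (≡true⇒T s≡t) = pt
... | false = countStack-All s τ pτ c

isDecr-removeˢ : ∀ s τ → isDecr τ ≡ true → isDecr (removeˢ s τ) ≡ true
isDecr-removeˢ s []      _ = refl
isDecr-removeˢ s (t ∷ τ) p with s ==ˢ t
... | true  = isDecr-tail t τ p
... | false = trans (isDecr-∷ t (removeˢ s τ)) (cong₂ _∧_ (head t τ p) (isDecr-removeˢ s τ (isDecr-tail t τ p)))
  where
  head : ∀ t τ → isDecr (t ∷ τ) ≡ true → headBelow t (removeˢ s τ) ≡ true
  head t []      _ = refl
  head t (u ∷ τ) p with s ==ˢ u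
  head t (u ∷ [])     p | true  = refl
  head t (u ∷ w ∷ τ) p | true  =
    ≥ˢ-trans t u w (isDecr-head t (u ∷ w ∷ τ) p) (isDecr-head u (w ∷ τ) (isDecr-tail t (u ∷ w ∷ τ) p))
  head t (u ∷ τ)     p | false = isDecr-head t (u ∷ τ) p

-- Enumerating stack partitions

inRange1 : ℕ → ℕ → Bool
inRange1 n zero    = false
inRange1 n (suc d) = d <ᵇ n

∑-range1-δ : ∀ n d (G : ℕ → ℤ) → ∑[ b ← range1 n ] (𝟙 (b ≡ᵇ d) * G b) ≡ 𝟙 (inRange1 n d) * G d
∑-range1-δ n zero    G = trans (∑-applyUpTo suc n _) (trans (∑<-zero n (λ k → *-zeroˡ (G (suc k)))) (sym (*-zeroˡ (G 0))))
∑-range1-δ n (suc d) G = trans (∑-applyUpTo suc n _) (∑<-δ n d (G ∘ suc))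

stackInRange : ℕ → Stack → Bool
stackInRange n (a , b) = inRange1 n a ∧ inRange1 n b

∑-stacksUpTo-δ : ∀ n s (G : Stack → ℤ) →
                 ∑[ t ← stacksUpTo n ] (𝟙 (t ==ˢ s) * G t) ≡ 𝟙 (stackInRange n s) * G s
∑-stacksUpTo-δ n (c , d) G = begin
    ∑[ t ← stacksUpTo n ] (𝟙 (t ==ˢ (c , d)) * G t)
  ≡⟨ ∑-concatMap (λ a → map (a ,_) (range1 n)) (range1 n) _ ⟩
    ∑[ a ← range1 n ] ∑[ t ← map (a ,_) (range1 n) ] (𝟙 (t ==ˢ (c , d)) * G t)
  ≡⟨ ∑-cong (range1 n) (λ a → ∑-map (a ,_) (range1 n) _) ⟩
    ∑[ a ← range1 n ] ∑[ b ← range1 n ] (𝟙 ((a ≡ᵇ c) ∧ (b ≡ᵇ d)) * G (a , b))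
  ≡⟨ ∑-cong (range1 n) (λ a → ∑-cong (range1 n) (λ b →
       trans (cong (_* G (a , b)) (𝟙-∧ (a ≡ᵇ c) (b ≡ᵇ d))) (*-rotate (𝟙 (a ≡ᵇ c)) _ _))) ⟩
    ∑[ a ← range1 n ] ∑[ b ← range1 n ] (𝟙 (b ≡ᵇ d) * (𝟙 (a ≡ᵇ c) * G (a , b)))
  ≡⟨ ∑-cong (range1 n) (λ a → ∑-range1-δ n d _) ⟩
    ∑[ a ← range1 n ] (𝟙 (inRange1 n d) * (𝟙 (a ≡ᵇ c) * G (a , d)))
  ≡⟨ ∑-cong (range1 n) (λ a → *-left-comm (𝟙 (inRange1 n d)) (𝟙 (a ≡ᵇ c)) _) ⟩
    ∑[ a ← range1 n ] (𝟙 (a ≡ᵇ c) * (𝟙 (inRange1 n d) * G (a , d)))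
  ≡⟨ ∑-range1-δ n c _ ⟩
    𝟙 (inRange1 n c) * (𝟙 (inRange1 n d) * G (c , d))
  ≡⟨ trans (sym (*-assoc (𝟙 (inRange1 n c)) _ _)) (cong (_* G (c , d)) (sym (𝟙-∧ (inRange1 n c) _))) ⟩
    𝟙 (stackInRange n (c , d)) * G (c , d)
  ∎
  where
  open ≡-Reasoning

∑-listsUpTo-δ : ∀ n k β (G : List Stack → ℤ) →
                ∑[ α ← listsUpTo k (stacksUpTo n) ] (𝟙 (eqL α β) * G α) ≡
                𝟙 ((length β ≤ᵇ k) ∧ all (stackInRange n) β) * G β
∑-listsUpTo-δ n zero    []      G = +-identityʳ _
∑-listsUpTo-δ n zero    (_ ∷ _) G = trans (+-identityʳ _) (*-zeroˡ (G []))
∑-listsUpTo-δ n (suc k) []      G =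
  trans (cong (1ℤ * G [] +_) (trans (∑-concatMap (λ s → map (s ∷_) Ls) (stacksUpTo n) _)
                                    (∑-zero (stacksUpTo n) λ s →
         trans (∑-map (s ∷_) Ls (λ α → 𝟙 (eqL α []) * G α)) (∑-zero Ls (λ α → *-zeroˡ (G (s ∷ α)))))))
        (+-identityʳ _)
  where Ls = listsUpTo k (stacksUpTo n)
∑-listsUpTo-δ n (suc k) (b ∷ β) G = begin
    0ℤ * G [] + ∑[ α ← concatMap (λ s → map (s ∷_) Ls) S ] (𝟙 (eqL α (b ∷ β)) * G α)
  ≡⟨ trans (cong (_+ ∑[ α ← concatMap (λ s → map (s ∷_) Ls) S ] (𝟙 (eqL α (b ∷ β)) * G α)) (*-zeroˡ (G [])))
           (+-identityˡ _) ⟩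
    ∑[ α ← concatMap (λ s → map (s ∷_) Ls) S ] (𝟙 (eqL α (b ∷ β)) * G α)
  ≡⟨ ∑-concatMap (λ s → map (s ∷_) Ls) S _ ⟩
    ∑[ s ← S ] ∑[ α ← map (s ∷_) Ls ] (𝟙 (eqL α (b ∷ β)) * G α)
  ≡⟨ ∑-cong S (λ s → ∑-map (s ∷_) Ls _) ⟩
    ∑[ s ← S ] ∑[ α ← Ls ] (𝟙 ((s ==ˢ b) ∧ eqL α β) * G (s ∷ α))
  ≡⟨ ∑-cong S (λ s → trans (∑-cong Ls (λ α → trans (cong (_* G (s ∷ α)) (𝟙-∧ (s ==ˢ b) (eqL α β)))
                                                     (*-assoc (𝟙 (s ==ˢ b)) _ _)))
                           (∑-*ˡ Ls (𝟙 (s ==ˢ b)) _)) ⟩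
    ∑[ s ← S ] (𝟙 (s ==ˢ b) * ∑[ α ← Ls ] (𝟙 (eqL α β) * G (s ∷ α)))
  ≡⟨ ∑-cong S (λ s → cong (𝟙 (s ==ˢ b) *_) (∑-listsUpTo-δ n k β (G ∘ (s ∷_)))) ⟩
    ∑[ s ← S ] (𝟙 (s ==ˢ b) * (𝟙 (fits β) * G (s ∷ β)))
  ≡⟨ ∑-stacksUpTo-δ n b _ ⟩
    𝟙 (stackInRange n b) * (𝟙 (fits β) * G (b ∷ β))
  ≡⟨ trans (sym (*-assoc (𝟙 (stackInRange n b)) _ _)) (cong (_* G (b ∷ β)) combine) ⟩
    𝟙 ((length β <ᵇ suc k) ∧ (stackInRange n b ∧ all (stackInRange n) β)) * G (b ∷ β)
  ∎
  where
  open ≡-Reasoning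
  S  = stacksUpTo n
  Ls = listsUpTo k S
  fits : List Stack → Bool
  fits β = (length β ≤ᵇ k) ∧ all (stackInRange n) β
  ≤ᵇ⇒<ᵇ : ∀ m → (m ≤ᵇ k) ≡ (m <ᵇ suc k)
  ≤ᵇ⇒<ᵇ zero    = refl
  ≤ᵇ⇒<ᵇ (suc m) = refl
  combine : 𝟙 (stackInRange n b) * 𝟙 (fits β) ≡ 𝟙 ((length β <ᵇ suc k) ∧ (stackInRange n b ∧ all (stackInRange n) β))
  combine rewrite ≤ᵇ⇒<ᵇ (length β) | 𝟙-∧ (length β <ᵇ suc k) (all (stackInRange n) β)
                | 𝟙-∧ (length β <ᵇ suc k) (stackInRange n b ∧ all (stackInRange n) β)
                | 𝟙-∧ (stackInRange n b) (all (stackInRange n) β) =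
    *-left-comm (𝟙 (stackInRange n b)) (𝟙 (length β <ᵇ suc k)) _

positive : Stack → Bool
positive (a , b) = (0 <ᵇ a) ∧ (0 <ᵇ b)

isStackPartition : ℕ → List Stack → Bool
isStackPartition n τ = isDecr τ ∧ ((weight τ ≡ᵇ n) ∧ all positive τ)

Bounded : ℕ → Stack → Set
Bounded n (a , b) = a ≤ n × b ≤ n

all-positive-bounded : ∀ n τ → all positive τ ≡ true → weight τ ≤ n → All (Bounded n) τ
all-positive-bounded n []                    _ _   = []
all-positive-bounded n ((suc a , suc b) ∷ τ) p w≤n =
  (ℕ.≤-trans (ℕ.m≤m*n (suc a) (suc b)) ab≤n , ℕ.≤-trans (ℕ.m≤n*m (suc b) (suc a)) ab≤n)
  ∷ all-positive-bounded n τ p (ℕ.m+n≤o⇒n≤o (suc a ℕ.* suc b) w≤n)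
  where ab≤n = ℕ.m+n≤o⇒m≤o (suc a ℕ.* suc b) w≤n

length≤weight : ∀ τ → all positive τ ≡ true → length τ ≤ weight τ
length≤weight []                    _ = z≤n
length≤weight ((suc a , suc b) ∷ τ) p =
  s≤s (ℕ.≤-trans (length≤weight τ p) (ℕ.m≤n+m (weight τ) (b ℕ.+ a ℕ.* suc b)))

isStackPartition⇒isDecr : ∀ {d} τ → isStackPartition d τ ≡ true → isDecr τ ≡ true
isStackPartition⇒isDecr {d} τ valid = proj₁ (∧-true {isDecr τ} valid)

isStackPartition⇒weight : ∀ {d} τ → isStackPartition d τ ≡ true → weight τ ≡ d
isStackPartition⇒weight {d} τ valid =
  ℕ.≡ᵇ⇒≡ (weight τ) d (≡true⇒T (proj₁ (∧-true {weight τ ≡ᵇ d} (proj₂ (∧-true {isDecr τ} valid)))))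

isStackPartition⇒positive : ∀ {d} τ → isStackPartition d τ ≡ true → all positive τ ≡ true
isStackPartition⇒positive {d} τ valid = proj₂ (∧-true {weight τ ≡ᵇ d} (proj₂ (∧-true {isDecr τ} valid)))

isStackPartition⇒bounded : ∀ {d} τ → isStackPartition d τ ≡ true → All (Bounded d) τ
isStackPartition⇒bounded {d} τ valid =
  all-positive-bounded d τ (isStackPartition⇒positive τ valid) (ℕ.≤-reflexive (isStackPartition⇒weight τ valid))

inRange⇔positive-bounded : ∀ n τ → all (stackInRange n) τ ≡ true ⇔
                           (all positive τ ≡ true × All (Bounded n) τ)
inRange⇔positive-bounded n τ = mk⇔ (⇒ τ) (⇐ τ)
  where
  ⇒ : ∀ τ → all (stackInRange n) τ ≡ true → all positive τ ≡ true × All (Bounded n) τ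
  ⇒ []                    _ = refl , []
  ⇒ ((suc a , suc b) ∷ τ) p with ∧-true {stackInRange n (suc a , suc b)} p
  ... | ab , pτ with ∧-true {a <ᵇ n} ab | ⇒ τ pτ
  ...   | a<n , b<n | posτ , bndτ =
    posτ , (ℕ.<ᵇ⇒< a n (≡true⇒T a<n) , ℕ.<ᵇ⇒< b n (≡true⇒T b<n)) ∷ bndτ
  ⇒ ((zero  , _)     ∷ τ) ()
  ⇒ ((suc a , zero)  ∷ τ) p with () ← proj₂ (∧-true {a <ᵇ n} (proj₁ (∧-true {inRange1 n (suc a) ∧ false} p)))
  ⇐ : ∀ τ → all positive τ ≡ true × All (Bounded n) τ → all (stackInRange n) τ ≡ true
  ⇐ []                    _ = refl
  ⇐ ((suc a , suc b) ∷ τ) (p , (a<n , b<n) ∷ bnd)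
    rewrite <ᵇ-true a<n | <ᵇ-true b<n = ⇐ τ (p , bnd)

isStackPartition-filter : ∀ n τ →
  (((length τ ≤ᵇ n) ∧ all (stackInRange n) τ) ∧ (isDecr τ ∧ (weight τ ≡ᵇ n))) ≡ isStackPartition n τ
isStackPartition-filter n τ = T-ext ⇒ ⇐
  where
  ⇒ : T (((length τ ≤ᵇ n) ∧ all (stackInRange n) τ) ∧ (isDecr τ ∧ (weight τ ≡ᵇ n))) → T (isStackPartition n τ)
  ⇒ t with T-∧ {(length τ ≤ᵇ n) ∧ all (stackInRange n) τ} .to t
  ... | lr , dw with T-∧ {length τ ≤ᵇ n} .to lr | T-∧ {isDecr τ} .to dw
  ...   | _ , r | d , w =
    T-∧ {isDecr τ} .from (d , T-∧ {weight τ ≡ᵇ n} .from (w , ≡true⇒T (proj₁ (inRange⇔positive-bounded n τ .to (T⇒≡true r)))))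
  ⇐ : T (isStackPartition n τ) → T (((length τ ≤ᵇ n) ∧ all (stackInRange n) τ) ∧ (isDecr τ ∧ (weight τ ≡ᵇ n)))
  ⇐ t with T-∧ {isDecr τ} .to t
  ... | d , wp with T-∧ {weight τ ≡ᵇ n} .to wp
  ...   | w , p = T-∧ .from (T-∧ {length τ ≤ᵇ n} .from (ℕ.≤⇒≤ᵇ (ℕ.≤-trans (length≤weight τ pos) w≤n) , ≡true⇒T in-range) ,
                             T-∧ .from (d , w))
    where
    pos = T⇒≡true p
    w≤n = ℕ.≤-reflexive (ℕ.≡ᵇ⇒≡ (weight τ) n w)
    in-range = inRange⇔positive-bounded n τ .from (pos , all-positive-bounded n τ pos w≤n)

∑-stackPartitions-δ : ∀ n β (g : List Stack → ℤ) →
                      ∑[ α ← stackPartitions n ] (𝟙 (eqL α β) * g α) ≡ 𝟙 (isStackPartition n β) * g β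
∑-stackPartitions-δ n β g = begin
    ∑[ α ← stackPartitions n ] (𝟙 (eqL α β) * g α)
  ≡⟨ ∑-filterB sorted-of-weight-n (listsUpTo n (stacksUpTo n)) _ ⟩
    ∑[ α ← listsUpTo n (stacksUpTo n) ] (𝟙 (sorted-of-weight-n α) * (𝟙 (eqL α β) * g α))
  ≡⟨ ∑-cong (listsUpTo n (stacksUpTo n)) (λ α → *-left-comm (𝟙 (sorted-of-weight-n α)) (𝟙 (eqL α β)) (g α)) ⟩
    ∑[ α ← listsUpTo n (stacksUpTo n) ] (𝟙 (eqL α β) * (𝟙 (sorted-of-weight-n α) * g α))
  ≡⟨ ∑-listsUpTo-δ n n β _ ⟩
    𝟙 ((length β ≤ᵇ n) ∧ all (stackInRange n) β) * (𝟙 (sorted-of-weight-n β) * g β)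
  ≡⟨ trans (sym (*-assoc (𝟙 ((length β ≤ᵇ n) ∧ all (stackInRange n) β)) _ _))
           (cong (_* g β) (trans (sym (𝟙-∧ ((length β ≤ᵇ n) ∧ all (stackInRange n) β) (sorted-of-weight-n β)))
                                 (cong 𝟙 (isStackPartition-filter n β)))) ⟩
    𝟙 (isStackPartition n β) * g β
  ∎
  where
  open ≡-Reasoning
  sorted-of-weight-n : List Stack → Bool
  sorted-of-weight-n τ = isDecr τ ∧ (weight τ ≡ᵇ n)

stackPartitions-valid : ∀ n → All (λ τ → isStackPartition n τ ≡ true) (stackPartitions n)
stackPartitions-valid n = All.map (λ {τ} → valid τ) (filterB-All _ _ (listsUpTo-inRange n))
  where
  filterB-All : {P : A → Set} (p : A → Bool) (L : List A) → All P L →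
                All (λ x → P x × p x ≡ true) (filterB p L)
  filterB-All p []      []         = []
  filterB-All p (x ∷ L) (px ∷ pxs) with p x in eq
  ... | true  = (px , eq) ∷ filterB-All p L pxs
  ... | false = filterB-All p L pxs
  stacksUpTo-inRange : All (λ s → stackInRange n s ≡ true) (stacksUpTo n)
  stacksUpTo-inRange = All.concat⁺ (All.map⁺ (All.applyUpTo⁺₁ suc n λ a<n →
    All.map⁺ (All.applyUpTo⁺₁ suc n λ b<n → cong₂ _∧_ (<ᵇ-true a<n) (<ᵇ-true b<n))))
  listsUpTo-inRange : ∀ k → All (λ τ → all (stackInRange n) τ ≡ true) (listsUpTo k (stacksUpTo n))
  listsUpTo-inRange zero    = refl ∷ []
  listsUpTo-inRange (suc k) = refl ∷ All.concat⁺ (All.map⁺ (All.map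
    (λ s-in → All.map⁺ (All.map (cong₂ _∧_ s-in) (listsUpTo-inRange k))) stacksUpTo-inRange))
  valid : ∀ τ → all (stackInRange n) τ ≡ true × (isDecr τ ∧ (weight τ ≡ᵇ n)) ≡ true → isStackPartition n τ ≡ true
  valid τ (r , dw) = cong₂ _∧_ (proj₁ (∧-true {isDecr τ} dw))
    (cong₂ _∧_ (proj₂ (∧-true {isDecr τ} dw)) (proj₁ (inRange⇔positive-bounded n τ .to r)))

-- The four families as weighted series

weight-stacksOf : (e : Mono D N) → weight (stacksOf e) ≡ degree e
weight-stacksOf = go 1
  where
  weight-++ : ∀ L L′ → weight (L ++ L′) ≡ weight L ℕ.+ weight L′
  weight-++ []      L′ = refl
  weight-++ (s ∷ L) L′ = trans (cong (proj₁ s ℕ.* proj₂ s ℕ.+_) (weight-++ L L′)) (sym (ℕ.+-assoc (proj₁ s ℕ.* proj₂ s) _ _))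
  row : ∀ i (r : Vec ℕ n) → weight (stacksRow i r) ≡ i ℕ.* sumᵛ r
  row i []          = sym (ℕ.*-zeroʳ i)
  row i (zero  ∷ r) = row i r
  row i (suc c ∷ r) = trans (cong (i ℕ.* suc c ℕ.+_) (row i r)) (sym (ℕ.*-distribˡ-+ i (suc c) _))
  go : ∀ i {D} (e : Mono D N) → weight (stacksFrom i e) ≡ degreeFrom i e
  go i []       = refl
  go i (r ∷ rs) = trans (weight-++ (stacksRow i r) _) (cong₂ ℕ._+_ (row i r) (go (suc i) rs))

all-positive-stacksOf : (e : Mono D N) → all positive (stacksOf e) ≡ true
all-positive-stacksOf = go 0
  where
  ++-positive : ∀ L L′ → all positive L ≡ true → all positive L′ ≡ true → all positive (L ++ L′) ≡ true
  ++-positive []      L′ _ q = q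
  ++-positive (s ∷ L) L′ p q with ∧-true {positive s} p
  ... | ps , pL = cong₂ _∧_ ps (++-positive L L′ pL q)
  row : ∀ i (r : Vec ℕ n) → all positive (stacksRow (suc i) r) ≡ true
  row i []          = refl
  row i (zero  ∷ r) = row i r
  row i (suc c ∷ r) = row i r
  go : ∀ i {D} (e : Mono D N) → all positive (stacksFrom (suc i) e) ≡ true
  go i []      = refl
  go i (r ∷ e) = ++-positive (stacksRow (suc i) r) _ (row i r) (go (suc i) e)

-- a zero exponent contributes no stack
unital : (ℕ → ℤ) → ℕ → ℤ
unital h zero    = 1ℤ
unital h (suc n) = h (suc n)

∏ᵐ : (ℕ → ℤ) → List Stack → ℤ
∏ᵐ h = foldr (λ s r → h (proj₂ s) * r) 1ℤ

∏ᵐ-stacksOf : ∀ h (e : Mono D N) → ∏ᵐ h (stacksOf e) ≡ ∏ᵉ (unital h) e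
∏ᵐ-stacksOf h = go 1
  where
  ++-∏ᵐ : ∀ L L′ → ∏ᵐ h (L ++ L′) ≡ ∏ᵐ h L * ∏ᵐ h L′
  ++-∏ᵐ []      L′ = sym (*-identityˡ _)
  ++-∏ᵐ (s ∷ L) L′ = trans (cong (h (proj₂ s) *_) (++-∏ᵐ L L′)) (sym (*-assoc (h (proj₂ s)) _ _))
  row : ∀ i (r : Vec ℕ n) → ∏ᵐ h (stacksRow i r) ≡ ∏ᵛ (unital h) r
  row i []          = refl
  row i (zero  ∷ r) = trans (row i r) (sym (*-identityˡ _))
  row i (suc c ∷ r) = cong (h (suc c) *_) (row i r)
  go : ∀ i {D} (e : Mono D N) → ∏ᵐ h (stacksFrom i e) ≡ ∏ᵉ (unital h) e
  go i []      = refl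
  go i (r ∷ e) = trans (++-∏ᵐ (stacksRow i r) _) (cong₂ _*_ (row i r) (go (suc i) e))

∑-∏ᵐ-M : ∀ h d → (λ D N e → ∑[ α ← stackPartitions d ] (∏ᵐ h α * M α D N e)) ≈S weighted d (unital h)
∑-∏ᵐ-M h d D N e = begin
    ∑[ α ← stackPartitions d ] (∏ᵐ h α * M α D N e)
  ≡⟨ ∑-cong-All (stackPartitions d) (stackPartitions-valid d) (λ α valid →
       trans (cong (∏ᵐ h α *_) (trans (if-𝟙 _) (cong 𝟙 (M-sorted α (isStackPartition⇒isDecr α valid)))))
             (*-comm (∏ᵐ h α) _)) ⟩
    ∑[ α ← stackPartitions d ] (𝟙 (eqL α β) * ∏ᵐ h α)
  ≡⟨ ∑-stackPartitions-δ d β (∏ᵐ h) ⟩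
    𝟙 (isStackPartition d β) * ∏ᵐ h β
  ≡⟨ cong₂ _*_ (cong 𝟙 β-valid) (trans (foldr-sortDesc _ 1ℤ (λ s t → *-left-comm (h (proj₂ s)) (h (proj₂ t))) (stacksOf e))
                                        (∏ᵐ-stacksOf h e)) ⟩
    weighted d (unital h) D N e
  ∎
  where
  open ≡-Reasoning
  β = sortDesc (stacksOf e)
  M-sorted : ∀ α → isDecr α ≡ true → eqL β (sortDesc α) ≡ eqL α β
  M-sorted α p = trans (cong (eqL β) (sortDesc-isDecr α p)) (eqL-comm β α)
  β-valid : isStackPartition d β ≡ (degree e ≡ᵇ d)
  β-valid rewrite isDecr-sortDesc (stacksOf e) | weight-sortDesc (stacksOf e) | weight-stacksOf e
                | all-sortDesc positive (stacksOf e) | all-positive-stacksOf e = ∧-identityʳ _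

ordinary : List Stack → Bool
ordinary = all (λ s → proj₂ s ≡ᵇ 1)

∑-ordinaryPartitions : ∀ d (c : List Stack → ℤ) (e : Mono D N) →
  ∑[ α ← ordinaryPartitions d ] (c α * M α D N e) ≡ ∑[ α ← stackPartitions d ] (𝟙 (ordinary α) * c α * M α D N e)
∑-ordinaryPartitions d c e = trans (∑-filterB ordinary (stackPartitions d) _)
  (∑-cong (stackPartitions d) (λ α → sym (*-assoc (𝟙 (ordinary α)) _ _)))

hᴱ hᴱ⁺ hᴴ hᴴ⁺ : ℕ → ℤ
hᴱ  x = 𝟙 (x ≡ᵇ 1) * -1ℤ
hᴱ⁺ x = 𝟙 (x ≡ᵇ 1)
hᴴ  x = 1ℤ
hᴴ⁺ x = sign x

E-weighted : ∀ d → E d ≈S weighted d (unital hᴱ)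
E-weighted d D N e = begin
    E d D N e
  ≡⟨ sumS-map (λ α → scaleS (sign (length α)) (M α)) (ordinaryPartitions d) e ⟩
    ∑[ α ← ordinaryPartitions d ] (sign (length α) * M α D N e)
  ≡⟨ ∑-ordinaryPartitions d (sign ∘ length) e ⟩
    ∑[ α ← stackPartitions d ] (𝟙 (ordinary α) * sign (length α) * M α D N e)
  ≡⟨ ∑-cong (stackPartitions d) (λ α → cong (_* M α D N e) (coefficient α)) ⟩
    ∑[ α ← stackPartitions d ] (∏ᵐ hᴱ α * M α D N e)
  ≡⟨ ∑-∏ᵐ-M hᴱ d D N e ⟩
    weighted d (unital hᴱ) D N e
  ∎
  where
  open ≡-Reasoning
  coefficient : ∀ α → 𝟙 (ordinary α) * sign (length α) ≡ ∏ᵐ hᴱ α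
  coefficient []      = refl
  coefficient (s ∷ α) =
    trans (cong (_* sign (suc (length α))) (𝟙-∧ (proj₂ s ≡ᵇ 1) _))
          (trans (regroup (𝟙 (proj₂ s ≡ᵇ 1)) _ (sign (length α))) (cong (hᴱ (proj₂ s) *_) (coefficient α)))
    where
    regroup : ∀ a b c → (a * b) * (-1ℤ * c) ≡ (a * -1ℤ) * (b * c)
    regroup = solve-∀

E⁺-weighted : ∀ d → E⁺ d ≈S weighted d (unital hᴱ⁺)
E⁺-weighted d D N e = begin
    E⁺ d D N e
  ≡⟨ trans (sumS-map M (ordinaryPartitions d) e)
           (∑-cong (ordinaryPartitions d) (λ α → sym (*-identityˡ (M α D N e)))) ⟩
    ∑[ α ← ordinaryPartitions d ] (1ℤ * M α D N e)
  ≡⟨ ∑-ordinaryPartitions d (λ _ → 1ℤ) e ⟩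
    ∑[ α ← stackPartitions d ] (𝟙 (ordinary α) * 1ℤ * M α D N e)
  ≡⟨ ∑-cong (stackPartitions d) (λ α → cong (_* M α D N e) (trans (*-identityʳ _) (coefficient α))) ⟩
    ∑[ α ← stackPartitions d ] (∏ᵐ hᴱ⁺ α * M α D N e)
  ≡⟨ ∑-∏ᵐ-M hᴱ⁺ d D N e ⟩
    weighted d (unital hᴱ⁺) D N e
  ∎
  where
  open ≡-Reasoning
  coefficient : ∀ α → 𝟙 (ordinary α) ≡ ∏ᵐ hᴱ⁺ α
  coefficient []      = refl
  coefficient (s ∷ α) = trans (𝟙-∧ (proj₂ s ≡ᵇ 1) _) (cong (hᴱ⁺ (proj₂ s) *_) (coefficient α))

H-weighted : ∀ d → H d ≈S weighted d (unital hᴴ)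
H-weighted d D N e = begin
    H d D N e
  ≡⟨ sumS-map M (stackPartitions d) e ⟩
    ∑[ α ← stackPartitions d ] M α D N e
  ≡⟨ ∑-cong (stackPartitions d) (λ α → trans (sym (*-identityˡ (M α D N e))) (cong (_* M α D N e) (coefficient α))) ⟩
    ∑[ α ← stackPartitions d ] (∏ᵐ hᴴ α * M α D N e)
  ≡⟨ ∑-∏ᵐ-M hᴴ d D N e ⟩
    weighted d (unital hᴴ) D N e
  ∎
  where
  open ≡-Reasoning
  coefficient : ∀ α → 1ℤ ≡ ∏ᵐ hᴴ α
  coefficient []      = refl
  coefficient (s ∷ α) = trans (coefficient α) (sym (*-identityˡ _))

H⁺-weighted : ∀ d → H⁺ d ≈S weighted d (unital hᴴ⁺)
H⁺-weighted d D N e = begin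
    H⁺ d D N e
  ≡⟨ sumS-map (λ α → scaleS (sign (area α)) (M α)) (stackPartitions d) e ⟩
    ∑[ α ← stackPartitions d ] (sign (area α) * M α D N e)
  ≡⟨ ∑-cong (stackPartitions d) (λ α → cong (_* M α D N e) (coefficient α)) ⟩
    ∑[ α ← stackPartitions d ] (∏ᵐ hᴴ⁺ α * M α D N e)
  ≡⟨ ∑-∏ᵐ-M hᴴ⁺ d D N e ⟩
    weighted d (unital hᴴ⁺) D N e
  ∎
  where
  open ≡-Reasoning
  coefficient : ∀ α → sign (area α) ≡ ∏ᵐ hᴴ⁺ α
  coefficient []      = refl
  coefficient (s ∷ α) = trans (^-distribˡ-+-* -1ℤ (proj₂ s) (area α)) (cong (sign (proj₂ s) *_) (coefficient α))

-- Multinomial coefficients and κ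

𝟙ℕ : Bool → ℕ
𝟙ℕ true  = 1
𝟙ℕ false = 0

∑ℕ : List A → (A → ℕ) → ℕ
∑ℕ L f = sumℕ (map f L)

∑ℕ-cong : (L : List A) {f g : A → ℕ} → (∀ x → f x ≡ g x) → ∑ℕ L f ≡ ∑ℕ L g
∑ℕ-cong []      f≗g = refl
∑ℕ-cong (x ∷ L) f≗g = cong₂ ℕ._+_ (f≗g x) (∑ℕ-cong L f≗g)

∑ℕ-*ˡ : (L : List A) (a : ℕ) (f : A → ℕ) → ∑ℕ L (λ x → a ℕ.* f x) ≡ a ℕ.* ∑ℕ L f
∑ℕ-*ˡ []      a f = sym (ℕ.*-zeroʳ a)
∑ℕ-*ˡ (x ∷ L) a f = trans (cong (a ℕ.* f x ℕ.+_) (∑ℕ-*ˡ L a f)) (sym (ℕ.*-distribˡ-+ a (f x) _))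

∑ℕ-*ʳ : (L : List A) (a : ℕ) (f : A → ℕ) → ∑ℕ L (λ x → f x ℕ.* a) ≡ ∑ℕ L f ℕ.* a
∑ℕ-*ʳ L a f = trans (∑ℕ-cong L (λ x → ℕ.*-comm (f x) a)) (trans (∑ℕ-*ˡ L a f) (ℕ.*-comm a _))

+-∑ℕ : (L : List A) (f : A → ℕ) → ℤ.+ (∑ℕ L f) ≡ ∑[ x ← L ] (ℤ.+ (f x))
+-∑ℕ []      f = refl
+-∑ℕ (x ∷ L) f = trans (pos-+ (f x) _) (cong (ℤ.+ (f x) +_) (+-∑ℕ L f))

+-𝟙ℕ-* : ∀ b k → ℤ.+ (𝟙ℕ b ℕ.* k) ≡ 𝟙 b * ℤ.+ k
+-𝟙ℕ-* true  k = trans (cong ℤ.+_ (ℕ.+-identityʳ k)) (sym (*-identityˡ (ℤ.+ k)))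
+-𝟙ℕ-* false k = refl

∑ℕ-positive : ∀ c {L : List ℕ} {i} → i ∈ L → 0 < c i → 0 < ∑ℕ L c
∑ℕ-positive c {x ∷ L} (here refl) 0<ci = ℕ.<-≤-trans 0<ci (ℕ.m≤m+n (c x) _)
∑ℕ-positive c {x ∷ L} (there i∈L) 0<ci = ℕ.<-≤-trans (∑ℕ-positive c i∈L 0<ci) (ℕ.m≤n+m _ (c x))

decrementAt : ℕ → (ℕ → ℕ) → ℕ → ℕ
decrementAt i c x = if x ≡ᵇ i then c x ∸ 1 else c x

decrementAt-self : ∀ i c → decrementAt i c i ≡ c i ∸ 1
decrementAt-self i c rewrite ≡ᵇ-true {i} refl = refl

decrementAt-other : ∀ {i x} c → x ≢ i → decrementAt i c x ≡ c x
decrementAt-other c x≢i rewrite ≡ᵇ-false x≢i = refl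

map-decrementAt : ∀ i c (L : List ℕ) → All (i ≢_) L → map (decrementAt i c) L ≡ map c L
map-decrementAt i c []      []           = refl
map-decrementAt i c (x ∷ L) (i≢x ∷ i≢L) = cong₂ _∷_ (decrementAt-other c (i≢x ∘ sym)) (map-decrementAt i c L i≢L)

∑ℕ-decrementAt : ∀ {i} c {L : List ℕ} → Unique L → i ∈ L → 0 < c i → suc (∑ℕ L (decrementAt i c)) ≡ ∑ℕ L c
∑ℕ-decrementAt {i} c {x ∷ L} (x≢L ∷ _) (here refl) 0<ci
  rewrite decrementAt-self x c | map-decrementAt x c L x≢L =
  cong (ℕ._+ sumℕ (map c L)) (ℕ.suc-pred (c x) {{ℕ.>-nonZero 0<ci}})
∑ℕ-decrementAt {i} c {x ∷ L} (x≢L ∷ uL) (there i∈L) 0<ci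
  rewrite decrementAt-other {i} {x} c (λ { refl → All.lookup x≢L i∈L refl }) =
  trans (sym (ℕ.+-suc (c x) _)) (cong (c x ℕ.+_) (∑ℕ-decrementAt c uL i∈L 0<ci))

multinomial-∷ʳ-0 : ∀ l → multinomial (l ∷ʳ 0) ≡ multinomial l
multinomial-∷ʳ-0 []      = refl
multinomial-∷ʳ-0 (k ∷ l) = cong₂ (λ s m → ((k ℕ.+ s) C k) ℕ.* m) (sum-∷ʳ-0 l) (multinomial-∷ʳ-0 l)
  where
  sum-∷ʳ-0 : ∀ l → sumℕ (l ∷ʳ 0) ≡ sumℕ l
  sum-∷ʳ-0 l = trans (sum-++ l (0 ∷ [])) (ℕ.+-identityʳ _)

multinomial-zeros : ∀ c {L : List ℕ} → All (λ y → c y ≡ 0) L → multinomial (map c L) ≡ 1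
multinomial-zeros c []            = refl
multinomial-zeros c (cy≡0 ∷ L≡0) rewrite cy≡0 | multinomial-zeros c L≡0 = ℕ.+-identityʳ _

-- Pascal's rule C(a + s, a) = C(a − 1 + s, a − 1) + C(a + s − 1, a), for one factor of a multinomial
binomial-step : ∀ a s m t → (s ≡ 0 → m ≡ 1 × t ≡ 0 × 0 < a) → (0 < s → m ≡ t) →
  ((a ℕ.+ s) C a) ℕ.* m ≡ 𝟙ℕ (0 <ᵇ a) ℕ.* ((((a ∸ 1) ℕ.+ s) C (a ∸ 1)) ℕ.* m) ℕ.+ ((a ℕ.+ ℕ.pred s) C a) ℕ.* t
binomial-step a       zero    m t s≡0 _ with s≡0 refl
binomial-step (suc k) zero    m t _ _ | refl , refl , _ rewrite ℕ.+-identityʳ k | nCn≡1 (suc k) | nCn≡1 k = refl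
binomial-step zero    (suc s) m t _ m≡t rewrite m≡t z<s = refl
binomial-step (suc k) (suc s) m t _ m≡t rewrite m≡t z<s | ℕ.+-suc k s =
  trans (cong (ℕ._* t) (sym (nCk+nC[k+1]≡[n+1]C[k+1] (suc (k ℕ.+ s)) k)))
        (trans (ℕ.*-distribʳ-+ t (suc (k ℕ.+ s) C k) _) (cong (ℕ._+ (suc (k ℕ.+ s) C suc k) ℕ.* t) (sym (ℕ.+-identityʳ _))))

multinomial-pascal : ∀ c {L : List ℕ} → Unique L → 0 < ∑ℕ L c →
  multinomial (map c L) ≡ ∑ℕ L (λ i → 𝟙ℕ (0 <ᵇ c i) ℕ.* multinomial (map (decrementAt i c) L))
multinomial-pascal c {x ∷ L} (x≢L ∷ uL) 0<Σ = begin
    ((c x ℕ.+ s) C c x) ℕ.* m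
  ≡⟨ binomial-step (c x) s m t when-empty (multinomial-pascal c uL) ⟩
    𝟙ℕ (0 <ᵇ c x) ℕ.* ((((c x ∸ 1) ℕ.+ s) C (c x ∸ 1)) ℕ.* m) ℕ.+ ((c x ℕ.+ ℕ.pred s) C c x) ℕ.* t
  ≡⟨ cong₂ (λ u v → 𝟙ℕ (0 <ᵇ c x) ℕ.* u ℕ.+ v) (sym head-term)
           (sym (trans (∑ℕ-cong-∈ tail-term) (∑ℕ-*ˡ L ((c x ℕ.+ ℕ.pred s) C c x) _))) ⟩
    𝟙ℕ (0 <ᵇ c x) ℕ.* multinomial (map (decrementAt x c) (x ∷ L)) ℕ.+
    ∑ℕ L (λ i → 𝟙ℕ (0 <ᵇ c i) ℕ.* multinomial (map (decrementAt i c) (x ∷ L)))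
  ∎
  where
  open ≡-Reasoning
  s = ∑ℕ L c
  m = multinomial (map c L)
  t = ∑ℕ L (λ i → 𝟙ℕ (0 <ᵇ c i) ℕ.* multinomial (map (decrementAt i c) L))
  zeros : ∀ L → ∑ℕ L c ≡ 0 → All (λ y → c y ≡ 0) L
  zeros []      _  = []
  zeros (y ∷ L) eq = ℕ.m+n≡0⇒m≡0 (c y) eq ∷ zeros L (ℕ.m+n≡0⇒n≡0 (c y) eq)
  terms-zero : ∀ {L′} → All (λ y → c y ≡ 0) L′ → ∑ℕ L′ (λ i → 𝟙ℕ (0 <ᵇ c i) ℕ.* multinomial (map (decrementAt i c) L)) ≡ 0
  terms-zero []            = refl
  terms-zero (cy≡0 ∷ L≡0) rewrite cy≡0 = terms-zero L≡0
  when-empty : s ≡ 0 → m ≡ 1 × t ≡ 0 × 0 < c x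
  when-empty s≡0 = multinomial-zeros c (zeros L s≡0) , terms-zero (zeros L s≡0) ,
                   subst (0 <_) (trans (cong (c x ℕ.+_) s≡0) (ℕ.+-identityʳ (c x))) 0<Σ
  head-term : multinomial (map (decrementAt x c) (x ∷ L)) ≡ (((c x ∸ 1) ℕ.+ s) C (c x ∸ 1)) ℕ.* m
  head-term rewrite decrementAt-self x c | map-decrementAt x c L x≢L = refl
  ∑ℕ-cong-∈ : ∀ {f g : ℕ → ℕ} → (∀ {i} → i ∈ L → f i ≡ g i) → ∑ℕ L f ≡ ∑ℕ L g
  ∑ℕ-cong-∈ f≗g = cong sumℕ (map-cong-local (All.tabulate f≗g))
  tail-term : ∀ {i} → i ∈ L → 𝟙ℕ (0 <ᵇ c i) ℕ.* multinomial (map (decrementAt i c) (x ∷ L))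
                            ≡ ((c x ℕ.+ ℕ.pred s) C c x) ℕ.* (𝟙ℕ (0 <ᵇ c i) ℕ.* multinomial (map (decrementAt i c) L))
  tail-term {i} i∈L with c i in ci
  ... | zero  = sym (ℕ.*-zeroʳ ((c x ℕ.+ ℕ.pred s) C c x))
  ... | suc k rewrite decrementAt-other {i} {x} c (λ { refl → All.lookup x≢L i∈L refl }) =
    trans (ℕ.+-identityʳ _) (trans (cong (λ z → ((c x ℕ.+ z) C c x) ℕ.* multinomial (map (decrementAt i c) L)) s-1)
                                    (cong (((c x ℕ.+ ℕ.pred s) C c x) ℕ.*_) (sym (ℕ.+-identityʳ _))))
    where s-1 = cong ℕ.pred (∑ℕ-decrementAt c uL i∈L (subst (0 <_) (sym ci) z<s))

range1-unique : ∀ W → Unique (range1 W)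
range1-unique W = Unique.applyUpTo⁺₁ suc W (λ i<j _ → ℕ.<⇒≢ i<j ∘ ℕ.suc-injective)

∈-range1 : ∀ {W x} → 1 ≤ x → x ≤ W → x ∈ range1 W
∈-range1 {W} {suc x} _ x≤W = ∈-applyUpTo⁺ suc x≤W

range1-positive : ∀ d → All (1 ≤_) (range1 d)
range1-positive d = All.applyUpTo⁺₂ suc d (λ _ → s≤s z≤n)

map-update-absent : ∀ {J} (a : ℕ) (g : ℕ → ℕ) {L} → All (J ≢_) L →
                    map (λ j → if j ≡ᵇ J then a else g j) L ≡ map g L
map-update-absent a g []            = refl
map-update-absent a g {y ∷ _} (J≢y ∷ J≢L) =
  cong₂ _∷_ (cong (λ b → if b then a else g y) (≡ᵇ-false (J≢y ∘ sym))) (map-update-absent a g J≢L)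

productℕ-at : ∀ (L : List ℕ) {J} (g : ℕ → ℕ) a → J ∈ L → Unique L →
  productℕ (map (λ j → if j ≡ᵇ J then a else g j) L) ≡ a ℕ.* productℕ (map (λ j → if j ≡ᵇ J then 1 else g j) L)
productℕ-at (x ∷ L) g a (here refl) (x≢L ∷ _)
  rewrite ≡ᵇ-true {x} refl | map-update-absent a g x≢L | map-update-absent 1 g x≢L =
  cong (a ℕ.*_) (sym (ℕ.+-identityʳ _))
productℕ-at (x ∷ L) {J} g a (there J∈L) (x≢L ∷ uL)
  rewrite ≡ᵇ-false {x} {J} (λ { refl → All.lookup x≢L J∈L refl }) | productℕ-at L g a J∈L uL =
  ℕ-*-left-comm (g x) a _

κ-upTo : ℕ → List Stack → ℕ
κ-upTo W τ = productℕ (map (λ j → multinomial (map (λ i → countStack (i , j) τ) (range1 W))) (range1 W))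

column : List Stack → ℕ → ℕ → ℕ
column τ j i = countStack (i , j) τ

κ-upTo-column : ∀ W J τ τ′ → (∀ j → j ≢ J → column τ′ j ≗ column τ j) →
  κ-upTo W τ′ ≡ productℕ (map (λ j → if j ≡ᵇ J then multinomial (map (column τ′ J) (range1 W))
                                              else multinomial (map (column τ j) (range1 W))) (range1 W))
κ-upTo-column W J τ τ′ same = cong productℕ (map-cong (λ j → by-column j (j ≡ᵇ J) refl) (range1 W))
  where
  by-column : ∀ j b → (j ≡ᵇ J) ≡ b → multinomial (map (column τ′ j) (range1 W)) ≡
              (if b then multinomial (map (column τ′ J) (range1 W)) else multinomial (map (column τ j) (range1 W)))
  by-column j true  j≡J rewrite ℕ.≡ᵇ⇒≡ j J (≡true⇒T j≡J) = refl
  by-column j false j≢J = cong multinomial (map-cong (same j (≡ᵇ-false⇒≢ j≢J)) (range1 W))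

column-removeˢ-other : ∀ i J τ → isDecr τ ≡ true → 0 < countStack (i , J) τ →
                       ∀ j → j ≢ J → column (removeˢ (i , J) τ) j ≗ column τ j
column-removeˢ-other i J τ sorted occurs j j≢J a = sym (trans (countStack-removeˢ (i , J) τ (a , j) sorted occurs)
  (cong (λ b → (if b then 1 else 0) ℕ.+ column (removeˢ (i , J) τ) j a) (==ˢ-false {a , j} {i , J} (j≢J ∘ cong proj₂))))

column-removeˢ : ∀ i J τ → isDecr τ ≡ true → 0 < countStack (i , J) τ →
                 column (removeˢ (i , J) τ) J ≗ decrementAt i (column τ J)
column-removeˢ i J τ sorted occurs a with countStack-removeˢ (i , J) τ (a , J) sorted occurs
... | eq rewrite ≡ᵇ-true {J} refl with a ≡ᵇ i
...   | true  = sym (cong (_∸ 1) eq)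
...   | false = sym eq

-- Pascal's rule for the factor of column J; removing a stack of multiplicity J leaves the other columns alone.
κ-pascal : ∀ W J τ → isDecr τ ≡ true → J ∈ range1 W → 0 < ∑ℕ (range1 W) (column τ J) →
  κ-upTo W τ ≡ ∑ℕ (range1 W) (λ i → 𝟙ℕ (0 <ᵇ countStack (i , J) τ) ℕ.* κ-upTo W (removeˢ (i , J) τ))
κ-pascal W J τ sorted J∈L 0<column = sym (begin
    ∑ℕ L (λ i → 𝟙ℕ (0 <ᵇ c i) ℕ.* κ-upTo W (removeˢ (i , J) τ))
  ≡⟨ ∑ℕ-cong L removed ⟩
    ∑ℕ L (λ i → 𝟙ℕ (0 <ᵇ c i) ℕ.* with-column (multinomial (map (decrementAt i c) L)))
  ≡⟨ ∑ℕ-cong L (λ i → trans (cong (𝟙ℕ (0 <ᵇ c i) ℕ.*_) (productℕ-at L g _ J∈L (range1-unique W)))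
                             (sym (ℕ.*-assoc (𝟙ℕ (0 <ᵇ c i)) _ _))) ⟩
    ∑ℕ L (λ i → 𝟙ℕ (0 <ᵇ c i) ℕ.* multinomial (map (decrementAt i c) L) ℕ.* with-column 1)
  ≡⟨ ∑ℕ-*ʳ L (with-column 1) _ ⟩
    ∑ℕ L (λ i → 𝟙ℕ (0 <ᵇ c i) ℕ.* multinomial (map (decrementAt i c) L)) ℕ.* with-column 1
  ≡⟨ cong (ℕ._* with-column 1) (multinomial-pascal c (range1-unique W) 0<column) ⟨
    multinomial (map c L) ℕ.* with-column 1
  ≡⟨ productℕ-at L g _ J∈L (range1-unique W) ⟨
    with-column (multinomial (map c L))
  ≡⟨ κ-upTo-column W J τ τ (λ _ _ _ → refl) ⟨
    κ-upTo W τ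
  ∎)
  where
  open ≡-Reasoning
  L = range1 W
  c = column τ J
  g : ℕ → ℕ
  g j = multinomial (map (column τ j) L)
  with-column : ℕ → ℕ
  with-column a = productℕ (map (λ j → if j ≡ᵇ J then a else g j) L)
  removed : ∀ i → 𝟙ℕ (0 <ᵇ c i) ℕ.* κ-upTo W (removeˢ (i , J) τ) ≡
                  𝟙ℕ (0 <ᵇ c i) ℕ.* with-column (multinomial (map (decrementAt i c) L))
  removed i with c i in ci
  ... | zero  = refl
  ... | suc _ = cong (ℕ._+ 0) (trans (κ-upTo-column W J τ (removeˢ (i , J) τ) (column-removeˢ-other i J τ sorted occurs))
                                     (cong (with-column ∘ multinomial) (map-cong (column-removeˢ i J τ sorted occurs) L)))
    where
    occurs : 0 < countStack (i , J) τ
    occurs = subst (0 <_) (sym ci) z<s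

countStack-outside : ∀ W τ a b → All (Bounded W) τ → W < a ⊎ W < b → countStack (a , b) τ ≡ 0
countStack-outside W []      a b _            _   = refl
countStack-outside W (t ∷ τ) a b (t≤W ∷ τ≤W) out =
  trans (cong (λ x → (if x then 1 else 0) ℕ.+ countStack (a , b) τ) (==ˢ-false (outside t≤W out)))
        (countStack-outside W τ a b τ≤W out)
  where
  outside : ∀ {t} → Bounded W t → W < a ⊎ W < b → (a , b) ≢ t
  outside (a≤W , _) (inj₁ W<a) refl = ℕ.<⇒≱ W<a a≤W
  outside (_ , b≤W) (inj₂ W<b) refl = ℕ.<⇒≱ W<b b≤W

κ-upTo-suc : ∀ W τ → All (Bounded W) τ → κ-upTo (suc W) τ ≡ κ-upTo W τ
κ-upTo-suc W τ τ≤W = begin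
    productℕ (map (factor (range1 (suc W))) (range1 (suc W)))
  ≡⟨ cong (productℕ ∘ map (factor (range1 (suc W)))) (sym (applyUpTo-∷ʳ suc W)) ⟩
    productℕ (map (factor (range1 (suc W))) (range1 W ∷ʳ suc W))
  ≡⟨ trans (cong productℕ (map-++ (factor (range1 (suc W))) (range1 W) _))
           (product-++ (map (factor (range1 (suc W))) (range1 W)) (factor (range1 (suc W)) (suc W) ∷ [])) ⟩
    productℕ (map (factor (range1 (suc W))) (range1 W)) ℕ.* (factor (range1 (suc W)) (suc W) ℕ.* 1)
  ≡⟨ cong₂ ℕ._*_ (cong productℕ (map-cong shorter-column (range1 W)))
                 (cong (ℕ._* 1) (multinomial-zeros (column τ (suc W)) (All.universal top-column-zero (range1 (suc W))))) ⟩
    κ-upTo W τ ℕ.* 1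
  ≡⟨ ℕ.*-identityʳ _ ⟩
    κ-upTo W τ
  ∎
  where
  open ≡-Reasoning
  factor : List ℕ → ℕ → ℕ
  factor L j = multinomial (map (column τ j) L)
  top-column-zero : ∀ i → column τ (suc W) i ≡ 0
  top-column-zero i = countStack-outside W τ i (suc W) τ≤W (inj₂ ℕ.≤-refl)
  shorter-column : ∀ j → factor (range1 (suc W)) j ≡ factor (range1 W) j
  shorter-column j = begin
      multinomial (map (column τ j) (range1 (suc W)))
    ≡⟨ cong (multinomial ∘ map (column τ j)) (sym (applyUpTo-∷ʳ suc W)) ⟩
      multinomial (map (column τ j) (range1 W ∷ʳ suc W))
    ≡⟨ cong multinomial (map-++ (column τ j) (range1 W) _) ⟩
      multinomial (map (column τ j) (range1 W) ∷ʳ column τ j (suc W))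
    ≡⟨ cong (λ z → multinomial (map (column τ j) (range1 W) ∷ʳ z)) (countStack-outside W τ (suc W) j τ≤W (inj₁ ℕ.≤-refl)) ⟩
      multinomial (map (column τ j) (range1 W) ∷ʳ 0)
    ≡⟨ multinomial-∷ʳ-0 (map (column τ j) (range1 W)) ⟩
      multinomial (map (column τ j) (range1 W))
    ∎

κ-upTo-weight : ∀ W τ → all positive τ ≡ true → weight τ ≤ W → κ-upTo W τ ≡ κ τ
κ-upTo-weight W τ pos w≤W =
  trans (cong (λ z → κ-upTo z τ) (sym (ℕ.m∸n+n≡m w≤W))) (extend (W ∸ weight τ))
  where
  bounded : ∀ k → All (Bounded (k ℕ.+ weight τ)) τ
  bounded k = all-positive-bounded (k ℕ.+ weight τ) τ pos (ℕ.m≤n+m (weight τ) k)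
  extend : ∀ k → κ-upTo (k ℕ.+ weight τ) τ ≡ κ τ
  extend zero    = refl
  extend (suc k) = trans (κ-upTo-suc (k ℕ.+ weight τ) τ (bounded k)) (extend k)

stackWeight : Stack → ℕ
stackWeight (a , b) = a ℕ.* b

isStackPartition-insertˢ : ∀ s d τ → positive s ≡ true → isStackPartition d τ ≡ true →
                           isStackPartition (stackWeight s ℕ.+ d) (insertˢ s τ) ≡ true
isStackPartition-insertˢ s d τ pos valid =
  cong₂ _∧_ (isDecr-insertˢ s τ (isStackPartition⇒isDecr τ valid))
    (cong₂ _∧_ (≡ᵇ-true (trans (weight-insertˢ s τ) (cong (stackWeight s ℕ.+_) (isStackPartition⇒weight τ valid))))
               (trans (all-insertˢ positive s τ) (cong₂ _∧_ pos (isStackPartition⇒positive τ valid))))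

weight-removeˢ : ∀ s τ → isDecr τ ≡ true → 0 < countStack s τ → stackWeight s ℕ.+ weight (removeˢ s τ) ≡ weight τ
weight-removeˢ s τ sorted occurs =
  trans (sym (weight-insertˢ s (removeˢ s τ))) (cong weight (insertˢ-removeˢ s τ sorted occurs))

isStackPartition-removeˢ : ∀ s d τ → isStackPartition (stackWeight s ℕ.+ d) τ ≡ true → 0 < countStack s τ →
                           isStackPartition d (removeˢ s τ) ≡ true
isStackPartition-removeˢ s d τ valid occurs = cong₂ _∧_ (isDecr-removeˢ s τ sorted) (cong₂ _∧_ weight-ok positive-ok)
  where
  sorted = isStackPartition⇒isDecr τ valid
  weight-ok : (weight (removeˢ s τ) ≡ᵇ d) ≡ true
  weight-ok = ≡ᵇ-true (ℕ.+-cancelˡ-≡ (stackWeight s) _ _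
                (trans (weight-removeˢ s τ sorted occurs) (isStackPartition⇒weight τ valid)))
  positive-ok : all positive (removeˢ s τ) ≡ true
  positive-ok = proj₂ (∧-true {positive s} (trans (sym (all-insertˢ positive s (removeˢ s τ)))
    (trans (cong (all positive) (insertˢ-removeˢ s τ sorted occurs)) (isStackPartition⇒positive τ valid))))

eqL-insertˢ : ∀ s τ τ′ → isDecr τ ≡ true → eqL τ (insertˢ s τ′) ≡ ((0 <ᵇ countStack s τ) ∧ eqL τ′ (removeˢ s τ))
eqL-insertˢ s τ τ′ sorted = T-ext ⇒ ⇐
  where
  ⇒ : T (eqL τ (insertˢ s τ′)) → T ((0 <ᵇ countStack s τ) ∧ eqL τ′ (removeˢ s τ))
  ⇒ t with eqL⇒≡ τ _ t
  ... | refl rewrite countStack-insertˢ s s τ′ | ==ˢ-refl s | removeˢ-insertˢ s τ′ | eqL-refl τ′ = _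
  ⇐ : T ((0 <ᵇ countStack s τ) ∧ eqL τ′ (removeˢ s τ)) → T (eqL τ (insertˢ s τ′))
  ⇐ t with T-∧ {0 <ᵇ countStack s τ} .to t
  ... | occurs , τ′≡ with eqL⇒≡ τ′ _ τ′≡
  ...   | refl rewrite insertˢ-removeˢ s τ sorted (ℕ.<ᵇ⇒< 0 _ occurs) | eqL-refl τ = _

∑-stackPartitions-insertˢ : ∀ s d (G : List Stack → ℤ) → positive s ≡ true →
  ∑[ τ ← stackPartitions (stackWeight s ℕ.+ d) ] (𝟙 (0 <ᵇ countStack s τ) * G τ) ≡
  ∑[ τ′ ← stackPartitions d ] G (insertˢ s τ′)
∑-stackPartitions-insertˢ s d G pos = sym (begin
    ∑[ τ′ ← stackPartitions d ] G (insertˢ s τ′)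
  ≡⟨ ∑-cong-All (stackPartitions d) (stackPartitions-valid d) (λ τ′ valid →
       sym (trans (∑-stackPartitions-δ total (insertˢ s τ′) G)
                  (trans (cong (λ b → 𝟙 b * G (insertˢ s τ′)) (isStackPartition-insertˢ s d τ′ pos valid))
                         (*-identityˡ _)))) ⟩
    ∑[ τ′ ← stackPartitions d ] ∑[ τ ← stackPartitions total ] (𝟙 (eqL τ (insertˢ s τ′)) * G τ)
  ≡⟨ ∑-comm (stackPartitions d) (stackPartitions total) _ ⟩
    ∑[ τ ← stackPartitions total ] ∑[ τ′ ← stackPartitions d ] (𝟙 (eqL τ (insertˢ s τ′)) * G τ)
  ≡⟨ ∑-cong-All (stackPartitions total) (stackPartitions-valid total) containing ⟩
    ∑[ τ ← stackPartitions total ] (𝟙 (0 <ᵇ countStack s τ) * G τ)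
  ∎)
  where
  open ≡-Reasoning
  total = stackWeight s ℕ.+ d
  containing : ∀ τ → isStackPartition total τ ≡ true →
    ∑[ τ′ ← stackPartitions d ] (𝟙 (eqL τ (insertˢ s τ′)) * G τ) ≡ 𝟙 (0 <ᵇ countStack s τ) * G τ
  containing τ valid = begin
      ∑[ τ′ ← stackPartitions d ] (𝟙 (eqL τ (insertˢ s τ′)) * G τ)
    ≡⟨ ∑-cong (stackPartitions d) (λ τ′ → trans (cong (λ b → 𝟙 b * G τ) (eqL-insertˢ s τ τ′ sorted))
         (trans (cong (_* G τ) (𝟙-∧ (0 <ᵇ countStack s τ) _)) (*-assoc (𝟙 (0 <ᵇ countStack s τ)) _ _))) ⟩
      ∑[ τ′ ← stackPartitions d ] (𝟙 (0 <ᵇ countStack s τ) * (𝟙 (eqL τ′ (removeˢ s τ)) * G τ))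
    ≡⟨ ∑-*ˡ (stackPartitions d) (𝟙 (0 <ᵇ countStack s τ)) _ ⟩
      𝟙 (0 <ᵇ countStack s τ) * ∑[ τ′ ← stackPartitions d ] (𝟙 (eqL τ′ (removeˢ s τ)) * G τ)
    ≡⟨ cong (𝟙 (0 <ᵇ countStack s τ) *_) (∑-stackPartitions-δ d (removeˢ s τ) (λ _ → G τ)) ⟩
      𝟙 (0 <ᵇ countStack s τ) * (𝟙 (isStackPartition d (removeˢ s τ)) * G τ)
    ≡⟨ drop-validity (0 <ᵇ countStack s τ) refl ⟩
      𝟙 (0 <ᵇ countStack s τ) * G τ
    ∎
    where
    sorted = isStackPartition⇒isDecr τ valid
    drop-validity : ∀ b → (0 <ᵇ countStack s τ) ≡ b →
                    𝟙 b * (𝟙 (isStackPartition d (removeˢ s τ)) * G τ) ≡ 𝟙 b * G τ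
    drop-validity false _ = refl
    drop-validity true  occurs
      rewrite isStackPartition-removeˢ s d τ valid (ℕ.<ᵇ⇒< 0 _ (≡true⇒T occurs)) = cong (1ℤ *_) (*-identityˡ (G τ))

∑-stackPartitions-too-small : ∀ s d (G : List Stack → ℤ) → d < stackWeight s →
  ∑[ τ ← stackPartitions d ] (𝟙 (0 <ᵇ countStack s τ) * G τ) ≡ 0ℤ
∑-stackPartitions-too-small s d G d<s =
  trans (∑-cong-All (stackPartitions d) (stackPartitions-valid d) vanish) (∑-zero (stackPartitions d) (λ _ → refl))
  where
  vanish : ∀ τ → isStackPartition d τ ≡ true → 𝟙 (0 <ᵇ countStack s τ) * G τ ≡ 0ℤ
  vanish τ valid with 0 <ᵇ countStack s τ in occurs
  ... | false = refl
  ... | true  = ⊥-elim (ℕ.<⇒≱ d<s (ℕ.≤-trans (ℕ.m≤m+n (stackWeight s) _) (ℕ.≤-reflexive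
                  (trans (weight-removeˢ s τ (isStackPartition⇒isDecr τ valid) (ℕ.<ᵇ⇒< 0 _ (≡true⇒T occurs)))
                         (isStackPartition⇒weight τ valid)))))

-- Peeling off the multiplicity 2ᴷ

-- peel F m K Y d is the coefficient of tᵈ in Y · ∑_{i ≥ 1} F(i, m·2ᴷ) t^{i·2ᴷ}, so Peeling says
-- that Y (suc K) · (1 + ∑_{i ≥ 1} F(i, m·2ᴷ) t^{i·2ᴷ}) = Y K.
peel : (ℕ → Series) → ℕ → ℕ → (ℕ → Series) → ℕ → Series
peel F m K Y d D N e =
  ∑[ i ← range1 d ] (𝟙 (i ℕ.* 2 ^ K ≤ᵇ d) * (atStack F (i , m ℕ.* 2 ^ K) ·S Y (d ∸ i ℕ.* 2 ^ K)) D N e)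

Peeling : (ℕ → Series) → ℕ → (ℕ → ℕ → Series) → Set
Peeling F m Y = ∀ K d D N (e : Mono D N) → Y (suc K) d D N e ≡ Y K d D N e - peel F m K (Y (suc K)) d D N e

peeling-unique : ∀ F m {Y Z : ℕ → ℕ → Series} → Peeling F m Y → Peeling F m Z →
                 (∀ d → Y 0 d ≈S Z 0 d) → ∀ K d → Y K d ≈S Z K d
peeling-unique F m         peelY peelZ base zero    = base
peeling-unique F m {Y} {Z} peelY peelZ base (suc K) = <-rec (λ d → Y (suc K) d ≈S Z (suc K) d) step
  where
  step : ∀ d → (∀ {d′} → d′ < d → Y (suc K) d′ ≈S Z (suc K) d′) → Y (suc K) d ≈S Z (suc K) d
  step d smaller D N e = begin
      Y (suc K) d D N e
    ≡⟨ peelY K d D N e ⟩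
      Y K d D N e - peel F m K (Y (suc K)) d D N e
    ≡⟨ cong₂ _-_ (peeling-unique F m {Y} {Z} peelY peelZ base K d D N e)
                 (∑-cong-All (range1 d) (All.applyUpTo⁺₁ suc d (λ i<d → s≤s z≤n , i<d)) peeled-equal) ⟩
      Z K d D N e - peel F m K (Z (suc K)) d D N e
    ≡⟨ peelZ K d D N e ⟨
      Z (suc K) d D N e
    ∎
    where
    open ≡-Reasoning
    peeled-equal : ∀ i → 1 ≤ i × i ≤ d →
      𝟙 (i ℕ.* 2 ^ K ≤ᵇ d) * (atStack F (i , m ℕ.* 2 ^ K) ·S Y (suc K) (d ∸ i ℕ.* 2 ^ K)) D N e ≡
      𝟙 (i ℕ.* 2 ^ K ≤ᵇ d) * (atStack F (i , m ℕ.* 2 ^ K) ·S Z (suc K) (d ∸ i ℕ.* 2 ^ K)) D N e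
    peeled-equal i (1≤i , i≤d) = cong (𝟙 (i ℕ.* 2 ^ K ≤ᵇ d) *_)
      (·S-congʳ (atStack F (i , m ℕ.* 2 ^ K)) (smaller (∸-< (ℕ.≤-trans 1≤i i≤d) (ℕ.*-mono-≤ 1≤i (ℕ.m^n>0 2 K)))) D N e)
      where
      ∸-< : ∀ {d x} → 1 ≤ d → 1 ≤ x → d ∸ x < d
      ∸-< {suc d} {suc x} _ _ = s≤s (ℕ.m∸n≤m d x)

n<2^n : ∀ n → n < 2 ^ n
n<2^n zero    = z<s
n<2^n (suc n) = ℕ.≤-trans (ℕ.≤-reflexive (ℕ.+-comm 1 (suc n)))
                          (ℕ.+-mono-≤ (n<2^n n) (ℕ.≤-trans (ℕ.m^n>0 2 n) (ℕ.m≤m+n (2 ^ n) 0)))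

isPow2-2^ : ∀ K → isPow2 (2 ^ K) ≡ true
isPow2-2^ K = T⇒≡true (any⁺ _ (Any.map (λ { refl → ℕ.≡⇒≡ᵇ (2 ^ K) (2 ^ K) refl })
                                        (∈-applyUpTo⁺ id (s≤s (ℕ.<⇒≤ (n<2^n K))))))

isPow2-between : ∀ K n → isPow2 n ≡ true → 2 ^ K ≤ n → n < 2 ^ suc K → n ≡ 2 ^ K
isPow2-between K n pow lo hi with Any.satisfied (any⁻ (λ k → 2 ^ k ≡ᵇ n) (upTo (suc n)) (≡true⇒T pow))
... | k , 2^k≡n with ℕ.≡ᵇ⇒≡ (2 ^ k) n 2^k≡n
... | refl with ℕ.<-cmp k K
...   | tri≈ _ refl _ = refl
...   | tri< k<K _ _ = ⊥-elim (ℕ.<⇒≱ (ℕ.^-monoʳ-< 2 (s≤s (s≤s z≤n)) k<K) lo)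
...   | tri> _ _ K<k = ⊥-elim (ℕ.<⇒≱ hi (ℕ.^-monoʳ-≤ 2 K<k))

term : (ℕ → Series) → ℕ → List Stack → Series
term F m τ = atPartition F (scaleMult m τ)

signedκ : List Stack → ℤ
signedκ τ = sign (length τ) * ℤ.+ κ τ

multiplicitiesPow2 : List Stack → Bool
multiplicitiesPow2 = all (λ s → isPow2 (proj₂ s))

multiplicitiesBelow : ℕ → List Stack → Bool
multiplicitiesBelow K = all (λ s → proj₂ s <ᵇ 2 ^ K)

admissible : ℕ → List Stack → Bool
admissible K τ = multiplicitiesPow2 τ ∧ multiplicitiesBelow K τ

reachesTop : ℕ → List Stack → Bool
reachesTop K τ = admissible (suc K) τ ∧ not (multiplicitiesBelow K τ)

partialRhs : (ℕ → Series) → ℕ → ℕ → ℕ → Series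
partialRhs F m K d D N e = ∑[ τ ← stackPartitions d ] (𝟙 (admissible K τ) * (signedκ τ * term F m τ D N e))

term-insertˢ : ∀ F m s τ → term F m (insertˢ s τ) ≈S (atStack F (proj₁ s , m ℕ.* proj₂ s) ·S term F m τ)
term-insertˢ F m s τ D N e =
  trans (cong (λ L → prodS L D N e) (sym (map-∘ (insertˢ s τ))))
        (trans (prodS-insertˢ g s τ D N e) (·S-congʳ (g s) (λ D N e → cong (λ L → prodS L D N e) (map-∘ τ)) D N e))
  where
  g : Stack → Series
  g (i , j) = atStack F (i , m ℕ.* j)

multiplicitiesBelow-suc : ∀ K τ → multiplicitiesBelow K τ ≡ true → multiplicitiesBelow (suc K) τ ≡ true
multiplicitiesBelow-suc K []            _ = refl
multiplicitiesBelow-suc K ((a , b) ∷ τ) p with ∧-true {b <ᵇ 2 ^ K} p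
... | b< , τ< = cong₂ _∧_ (<ᵇ-true (ℕ.<-≤-trans (ℕ.<ᵇ⇒< b _ (≡true⇒T b<)) (ℕ.^-monoʳ-≤ 2 (ℕ.n≤1+n K))))
                          (multiplicitiesBelow-suc K τ τ<)

𝟙-admissible-suc : ∀ K τ → 𝟙 (admissible (suc K) τ) ≡ 𝟙 (admissible K τ) + 𝟙 (reachesTop K τ)
𝟙-admissible-suc K τ with multiplicitiesPow2 τ
... | false = refl
... | true with multiplicitiesBelow K τ in below
...   | true  rewrite multiplicitiesBelow-suc K τ below = refl
...   | false rewrite ∧-identityʳ (multiplicitiesBelow (suc K) τ) = sym (+-identityˡ _)

reachesTop-occurs : ∀ K τ → reachesTop K τ ≡ true → Σ ℕ (λ i → 0 < countStack (i , 2 ^ K) τ)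
reachesTop-occurs K τ top with ∧-true {admissible (suc K) τ} top
... | adm , notBelow with ∧-true {multiplicitiesPow2 τ} adm
...   | pow , below = go τ pow below (not-true notBelow)
  where
  not-true : ∀ {b} → not b ≡ true → b ≡ false
  not-true {false} _ = refl
  go : ∀ τ → multiplicitiesPow2 τ ≡ true → multiplicitiesBelow (suc K) τ ≡ true → multiplicitiesBelow K τ ≡ false →
       Σ ℕ (λ i → 0 < countStack (i , 2 ^ K) τ)
  go ((a , b) ∷ τ) pow below notBelow with ∧-true {isPow2 b} pow | ∧-true {b <ᵇ 2 ^ suc K} below
  ... | pow-b , pow-τ | b<2^K+1 , below-τ with b <ᵇ 2 ^ K in b<
  ...   | true  = let i , occ = go τ pow-τ below-τ notBelow in i , ℕ.<-≤-trans occ (ℕ.m≤n+m _ _)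
  ...   | false with isPow2-between K b pow-b (ℕ.≮⇒≥ (≡false⇒¬T b< ∘ ℕ.<⇒<ᵇ)) (ℕ.<ᵇ⇒< b _ (≡true⇒T b<2^K+1))
  ...     | refl = a , subst (λ z → 0 < (if z then 1 else 0) ℕ.+ countStack (a , 2 ^ K) τ)
                            (sym (==ˢ-refl (a , 2 ^ K))) z<s

reachesTop-insertˢ : ∀ K i τ → reachesTop K (insertˢ (i , 2 ^ K) τ) ≡ admissible (suc K) τ
reachesTop-insertˢ K i τ
  rewrite all-insertˢ (λ s → isPow2 (proj₂ s)) (i , 2 ^ K) τ | all-insertˢ (λ s → proj₂ s <ᵇ 2 ^ suc K) (i , 2 ^ K) τ
        | all-insertˢ (λ s → proj₂ s <ᵇ 2 ^ K) (i , 2 ^ K) τ | isPow2-2^ K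
        | <ᵇ-true (ℕ.^-monoʳ-< 2 (s≤s (s≤s z≤n)) (ℕ.n<1+n K)) | <ᵇ-false (ℕ.<-irrefl {2 ^ K} refl) =
  ∧-identityʳ _

κ-reachesTop : ∀ K d τ → isStackPartition d τ ≡ true → reachesTop K τ ≡ true →
  ℤ.+ κ τ ≡ ∑[ i ← range1 d ] (𝟙 (0 <ᵇ countStack (i , 2 ^ K) τ) * ℤ.+ κ-upTo d (removeˢ (i , 2 ^ K) τ))
κ-reachesTop K d τ valid top = begin
    ℤ.+ κ τ
  ≡⟨ cong (λ w → ℤ.+ κ-upTo w τ) weight≡d ⟩
    ℤ.+ κ-upTo d τ
  ≡⟨ cong ℤ.+_ (κ-pascal d J τ sorted (∈-range1 (ℕ.m^n>0 2 K) (proj₂ i₀-bounded))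
                         (∑ℕ-positive (column τ J) i₀∈L (proj₂ occurring))) ⟩
    ℤ.+ ∑ℕ L (λ i → 𝟙ℕ (0 <ᵇ countStack (i , J) τ) ℕ.* κ-upTo d (removeˢ (i , J) τ))
  ≡⟨ trans (+-∑ℕ L _) (∑-cong L (λ i → +-𝟙ℕ-* (0 <ᵇ countStack (i , J) τ) _)) ⟩
    ∑[ i ← L ] (𝟙 (0 <ᵇ countStack (i , J) τ) * ℤ.+ κ-upTo d (removeˢ (i , J) τ))
  ∎
  where
  open ≡-Reasoning
  J = 2 ^ K
  L = range1 d
  sorted = isStackPartition⇒isDecr τ valid
  weight≡d = isStackPartition⇒weight τ valid
  occurring = reachesTop-occurs K τ top
  i₀ = proj₁ occurring
  i₀-bounded = countStack-All (i₀ , J) τ (isStackPartition⇒bounded τ valid) (proj₂ occurring)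
  i₀-positive = countStack-All (i₀ , J) τ (all-true positive τ (isStackPartition⇒positive τ valid)) (proj₂ occurring)
  i₀∈L : i₀ ∈ L
  i₀∈L = ∈-range1 (ℕ.<ᵇ⇒< 0 i₀ (≡true⇒T (proj₁ (∧-true {0 <ᵇ i₀} i₀-positive)))) (proj₁ i₀-bounded)

module _ (F : ℕ → Series) (m K d : ℕ) {D N : ℕ} (e : Mono D N) where

  private
    J = 2 ^ K
    L = range1 d

  removalTerm : ℕ → List Stack → ℤ
  removalTerm i τ = 𝟙 (reachesTop K τ) * (sign (length τ) * ℤ.+ κ-upTo d (removeˢ (i , J) τ) * term F m τ D N e)

  reachesTop-expansion : ∀ τ → isStackPartition d τ ≡ true →
    𝟙 (reachesTop K τ) * (signedκ τ * term F m τ D N e) ≡ ∑[ i ← L ] (𝟙 (0 <ᵇ countStack (i , J) τ) * removalTerm i τ)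
  reachesTop-expansion τ valid with reachesTop K τ in top
  ... | false = sym (∑-zero L (λ i → *-zeroʳ (𝟙 (0 <ᵇ countStack (i , J) τ))))
  ... | true  = begin
      1ℤ * (s * ℤ.+ κ τ * t)
    ≡⟨ cong (λ k → 1ℤ * (s * k * t)) (κ-reachesTop K d τ valid top) ⟩
      1ℤ * (s * ∑[ i ← L ] (occurs i * κ′ i) * t)
    ≡⟨ cong (λ z → 1ℤ * (z * t)) (sym (∑-*ˡ L s _)) ⟩
      1ℤ * (∑[ i ← L ] (s * (occurs i * κ′ i)) * t)
    ≡⟨ trans (*-identityˡ _) (sym (∑-*ʳ L t _)) ⟩
      ∑[ i ← L ] (s * (occurs i * κ′ i) * t)
    ≡⟨ ∑-cong L (λ i → regroup s (occurs i) (κ′ i) t) ⟩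
      ∑[ i ← L ] (occurs i * (1ℤ * (s * κ′ i * t)))
    ∎
    where
    open ≡-Reasoning
    s = sign (length τ)
    t = term F m τ D N e
    occurs : ℕ → ℤ
    occurs i = 𝟙 (0 <ᵇ countStack (i , J) τ)
    κ′ : ℕ → ℤ
    κ′ i = ℤ.+ κ-upTo d (removeˢ (i , J) τ)
    regroup : ∀ s g h p → s * (g * h) * p ≡ g * (1ℤ * (s * h * p))
    regroup = solve-∀

  removalTerm-insertˢ : ∀ i τ′ → isStackPartition (d ∸ i ℕ.* J) τ′ ≡ true →
    removalTerm i (insertˢ (i , J) τ′) ≡
    - (𝟙 (admissible (suc K) τ′) * (signedκ τ′ * (atStack F (i , m ℕ.* J) ·S term F m τ′) D N e))
  removalTerm-insertˢ i τ′ valid = trans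
    (cong₂ _*_ (cong 𝟙 (reachesTop-insertˢ K i τ′))
      (cong₂ _*_ (cong₂ _*_ (cong sign (length-insertˢ (i , J) τ′))
                            (cong ℤ.+_ (trans (cong (κ-upTo d) (removeˢ-insertˢ (i , J) τ′))
                                              (κ-upTo-weight d τ′ (isStackPartition⇒positive τ′ valid) weight≤d))))
                 (term-insertˢ F m (i , J) τ′ D N e)))
    (regroup (𝟙 (admissible (suc K) τ′)) (sign (length τ′)) (ℤ.+ κ τ′) ((atStack F (i , m ℕ.* J) ·S term F m τ′) D N e))
    where
    weight≤d : weight τ′ ≤ d
    weight≤d = ℕ.≤-trans (ℕ.≤-reflexive (isStackPartition⇒weight τ′ valid)) (ℕ.m∸n≤m d (i ℕ.* J))
    regroup : ∀ a s k f → a * (-1ℤ * s * k * f) ≡ - (a * (s * k * f))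
    regroup = solve-∀

  removal-sum : ∀ i → 1 ≤ i →
    ∑[ τ ← stackPartitions d ] (𝟙 (0 <ᵇ countStack (i , J) τ) * removalTerm i τ) ≡
    - (𝟙 (i ℕ.* J ≤ᵇ d) * (atStack F (i , m ℕ.* J) ·S partialRhs F m (suc K) (d ∸ i ℕ.* J)) D N e)
  removal-sum i 1≤i with i ℕ.* J ℕ.≤? d
  ... | no  iJ≰d rewrite ≤ᵇ-false iJ≰d = ∑-stackPartitions-too-small (i , J) d (removalTerm i) (ℕ.≰⇒> iJ≰d)
  ... | yes iJ≤d rewrite ≤ᵇ-true iJ≤d = begin
      ∑[ τ ← stackPartitions d ] (𝟙 (0 <ᵇ countStack (i , J) τ) * removalTerm i τ)
    ≡⟨ cong (λ n → ∑[ τ ← stackPartitions n ] (𝟙 (0 <ᵇ countStack (i , J) τ) * removalTerm i τ))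
            (sym (ℕ.m+[n∸m]≡n iJ≤d)) ⟩
      ∑[ τ ← stackPartitions (i ℕ.* J ℕ.+ d′) ] (𝟙 (0 <ᵇ countStack (i , J) τ) * removalTerm i τ)
    ≡⟨ ∑-stackPartitions-insertˢ (i , J) d′ (removalTerm i) (cong₂ _∧_ (<ᵇ-true 1≤i) (<ᵇ-true (ℕ.m^n>0 2 K))) ⟩
      ∑[ τ′ ← stackPartitions d′ ] removalTerm i (insertˢ (i , J) τ′)
    ≡⟨ ∑-cong-All (stackPartitions d′) (stackPartitions-valid d′) (removalTerm-insertˢ i) ⟩
      ∑[ τ′ ← stackPartitions d′ ] (- (𝟙 (admissible (suc K) τ′) * (signedκ τ′ * (fᵢ ·S term F m τ′) D N e)))
    ≡⟨ ∑-neg (stackPartitions d′) _ ⟩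
      - ∑[ τ′ ← stackPartitions d′ ] (𝟙 (admissible (suc K) τ′) * (signedκ τ′ * (fᵢ ·S term F m τ′) D N e))
    ≡⟨ cong -_ (trans (sym (·S-∑ fᵢ (stackPartitions d′) (𝟙 ∘ admissible (suc K)) signedκ (term F m) e))
                      (sym (*-identityˡ _))) ⟩
      - (1ℤ * (fᵢ ·S partialRhs F m (suc K) d′) D N e)
    ∎
    where
    open ≡-Reasoning
    d′ = d ∸ i ℕ.* J
    fᵢ = atStack F (i , m ℕ.* J)

partialRhs-peeling : ∀ F m → Peeling F m (partialRhs F m)
partialRhs-peeling F m K d D N e = begin
    ∑[ τ ← SP ] (𝟙 (admissible (suc K) τ) * X τ)
  ≡⟨ ∑-cong SP (λ τ → trans (cong (_* X τ) (𝟙-admissible-suc K τ))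
                             (*-distribʳ-+ (X τ) (𝟙 (admissible K τ)) (𝟙 (reachesTop K τ)))) ⟩
    ∑[ τ ← SP ] (𝟙 (admissible K τ) * X τ + 𝟙 (reachesTop K τ) * X τ)
  ≡⟨ ∑-distrib-+ SP (λ τ → 𝟙 (admissible K τ) * X τ) (λ τ → 𝟙 (reachesTop K τ) * X τ) ⟩
    partialRhs F m K d D N e + ∑[ τ ← SP ] (𝟙 (reachesTop K τ) * X τ)
  ≡⟨ cong (partialRhs F m K d D N e +_) reaching-top ⟩
    partialRhs F m K d D N e - peel F m K (partialRhs F m (suc K)) d D N e
  ∎
  where
  open ≡-Reasoning
  SP = stackPartitions d
  L = range1 d
  X : List Stack → ℤ
  X τ = signedκ τ * term F m τ D N e
  Y : ℕ → ℤ
  Y i = (𝟙 (i ℕ.* 2 ^ K ≤ᵇ d) * (atStack F (i , m ℕ.* 2 ^ K) ·S partialRhs F m (suc K) (d ∸ i ℕ.* 2 ^ K)) D N e)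
  reaching-top : ∑[ τ ← SP ] (𝟙 (reachesTop K τ) * X τ) ≡ - peel F m K (partialRhs F m (suc K)) d D N e
  reaching-top = begin
      ∑[ τ ← SP ] (𝟙 (reachesTop K τ) * X τ)
    ≡⟨ ∑-cong-All SP (stackPartitions-valid d) (reachesTop-expansion F m K d e) ⟩
      ∑[ τ ← SP ] ∑[ i ← L ] (𝟙 (0 <ᵇ countStack (i , 2 ^ K) τ) * removalTerm F m K d e i τ)
    ≡⟨ ∑-comm SP L (λ τ i → 𝟙 (0 <ᵇ countStack (i , 2 ^ K) τ) * removalTerm F m K d e i τ) ⟩
      ∑[ i ← L ] ∑[ τ ← SP ] (𝟙 (0 <ᵇ countStack (i , 2 ^ K) τ) * removalTerm F m K d e i τ)
    ≡⟨ ∑-cong-All L (range1-positive d) (removal-sum F m K d e) ⟩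
      ∑[ i ← L ] (- Y i)
    ≡⟨ ∑-neg L Y ⟩
      - peel F m K (partialRhs F m (suc K)) d D N e
    ∎

admissible-zero : ∀ d τ → isStackPartition d τ ≡ true → admissible 0 τ ≡ eqL τ []
admissible-zero d []                    _     = refl
admissible-zero d ((a , zero)  ∷ τ)     valid
  with () ← proj₂ (∧-true {0 <ᵇ a} (proj₁ (∧-true {positive (a , 0)} (isStackPartition⇒positive ((a , 0) ∷ τ) valid))))
admissible-zero d ((a , suc b) ∷ τ)     _     = ∧-zeroʳ _

partialRhs-zero : ∀ F m d → 1 ≤ m → partialRhs F m 0 d ≈S weighted (m ℕ.* d) δ₀
partialRhs-zero F m d 1≤m D N e = begin
    ∑[ τ ← stackPartitions d ] (𝟙 (admissible 0 τ) * (signedκ τ * term F m τ D N e))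
  ≡⟨ ∑-cong-All (stackPartitions d) (stackPartitions-valid d)
                (λ τ valid → cong (λ b → 𝟙 b * (signedκ τ * term F m τ D N e)) (admissible-zero d τ valid)) ⟩
    ∑[ τ ← stackPartitions d ] (𝟙 (eqL τ []) * (signedκ τ * term F m τ D N e))
  ≡⟨ ∑-stackPartitions-δ d [] (λ τ → signedκ τ * term F m τ D N e) ⟩
    𝟙 ((0 ≡ᵇ d) ∧ true) * (1ℤ * (if isZeroM e then 1ℤ else 0ℤ))
  ≡⟨ cong (λ z → 𝟙 ((0 ≡ᵇ d) ∧ true) * (1ℤ * z)) (trans (if-𝟙 (isZeroM e)) (trans (𝟙-isZeroM e) (sym (δ₀-degree e)))) ⟩
    𝟙 ((0 ≡ᵇ d) ∧ true) * (1ℤ * δ₀ (degree e))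
  ≡⟨ cases (degree e) d ⟩
    𝟙 (degree e ≡ᵇ m ℕ.* d) * δ₀ (degree e)
  ≡⟨ cong (𝟙 (degree e ≡ᵇ m ℕ.* d) *_) (δ₀-degree e) ⟩
    weighted (m ℕ.* d) δ₀ D N e
  ∎
  where
  open ≡-Reasoning
  cases : ∀ x d → 𝟙 ((0 ≡ᵇ d) ∧ true) * (1ℤ * δ₀ x) ≡ 𝟙 (x ≡ᵇ m ℕ.* d) * δ₀ x
  cases (suc x) d       = trans (*-zeroʳ (𝟙 ((0 ≡ᵇ d) ∧ true))) (sym (*-zeroʳ (𝟙 (suc x ≡ᵇ m ℕ.* d))))
  cases zero    zero    rewrite ℕ.*-zeroʳ m = refl
  cases zero    (suc d) rewrite ≡ᵇ-false {0} {m ℕ.* suc d} (ℕ.<⇒≢ (ℕ.*-mono-≤ 1≤m (s≤s z≤n))) = refl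

rhs-partialRhs : ∀ F d m → rhs F d m ≈S partialRhs F m d d
rhs-partialRhs F d m D N e = begin
    rhs F d m D N e
  ≡⟨ sumS-map (λ τ → scaleS (signedκ τ) (term F m τ)) (pow2StackPartitions d) e ⟩
    ∑[ τ ← pow2StackPartitions d ] (signedκ τ * term F m τ D N e)
  ≡⟨ ∑-filterB multiplicitiesPow2 (stackPartitions d) (λ τ → signedκ τ * term F m τ D N e) ⟩
    ∑[ τ ← stackPartitions d ] (𝟙 (multiplicitiesPow2 τ) * (signedκ τ * term F m τ D N e))
  ≡⟨ ∑-cong-All (stackPartitions d) (stackPartitions-valid d) (λ τ valid →
       cong (λ b → 𝟙 b * (signedκ τ * term F m τ D N e))
            (sym (trans (cong (multiplicitiesPow2 τ ∧_) (below τ valid)) (∧-identityʳ _)))) ⟩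
    partialRhs F m d d D N e
  ∎
  where
  open ≡-Reasoning
  bounded-below : ∀ τ → All (Bounded d) τ → multiplicitiesBelow d τ ≡ true
  bounded-below []      []               = refl
  bounded-below (_ ∷ τ) ((_ , b≤d) ∷ τ≤d) = cong₂ _∧_ (<ᵇ-true (ℕ.≤-<-trans b≤d (n<2^n d))) (bounded-below τ τ≤d)
  below : ∀ τ → isStackPartition d τ ≡ true → multiplicitiesBelow d τ ≡ true
  below τ valid = bounded-below τ (isStackPartition⇒bounded τ valid)

-- Weighted series peel off in the same way

degree-split : ∀ m J d q D₂ → 1 ≤ m → 1 ≤ J →
  𝟙 (inRange1 d q) * (𝟙 (q ℕ.* J ≤ᵇ d) * 𝟙 (D₂ ≡ᵇ m ℕ.* (d ∸ q ℕ.* J))) ≡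
  𝟙 (q ℕ.* (m ℕ.* J) ℕ.+ D₂ ≡ᵇ m ℕ.* d) * 𝟙 (not (q ℕ.* (m ℕ.* J) ≡ᵇ 0))
degree-split m J d zero    D₂ 1≤m 1≤J = sym (*-zeroʳ (𝟙 (D₂ ≡ᵇ m ℕ.* d)))
degree-split m J d (suc q) D₂ 1≤m 1≤J
  rewrite ≡ᵇ-false {suc q ℕ.* (m ℕ.* J)} {0} (ℕ.>⇒≢ (ℕ.*-mono-≤ {1} {suc q} (s≤s z≤n) (ℕ.*-mono-≤ 1≤m 1≤J))) =
  trans (sym (trans (𝟙-∧ (q <ᵇ d) _) (cong (𝟙 (q <ᵇ d) *_) (𝟙-∧ (Q ≤ᵇ d) _))))
        (trans (cong 𝟙 (T-ext ⇒ ⇐)) (sym (*-identityʳ _)))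
  where
  Q = suc q ℕ.* J
  reassoc : ∀ q m J → suc q ℕ.* (m ℕ.* J) ≡ m ℕ.* (suc q ℕ.* J)
  reassoc = ℕ-solve-∀
  ⇒ : T ((q <ᵇ d) ∧ ((Q ≤ᵇ d) ∧ (D₂ ≡ᵇ m ℕ.* (d ∸ Q)))) → T (suc q ℕ.* (m ℕ.* J) ℕ.+ D₂ ≡ᵇ m ℕ.* d)
  ⇒ t with T-∧ {q <ᵇ d} .to t
  ... | _ , r with T-∧ {Q ≤ᵇ d} .to r
  ...   | Q≤d , D₂≡ = ℕ.≡⇒≡ᵇ _ _ (trans (cong₂ ℕ._+_ (reassoc q m J) (ℕ.≡ᵇ⇒≡ D₂ _ D₂≡))
                                        (trans (sym (ℕ.*-distribˡ-+ m Q (d ∸ Q))) (cong (m ℕ.*_) (ℕ.m+[n∸m]≡n (ℕ.≤ᵇ⇒≤ Q d Q≤d)))))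
  ⇐ : T (suc q ℕ.* (m ℕ.* J) ℕ.+ D₂ ≡ᵇ m ℕ.* d) → T ((q <ᵇ d) ∧ ((Q ≤ᵇ d) ∧ (D₂ ≡ᵇ m ℕ.* (d ∸ Q))))
  ⇐ t = T-∧ .from (ℕ.<⇒<ᵇ (ℕ.≤-trans (ℕ.m≤m*n (suc q) J {{ℕ.>-nonZero 1≤J}}) Q≤d) ,
                   T-∧ .from (ℕ.≤⇒≤ᵇ Q≤d , ℕ.≡⇒≡ᵇ _ _ D₂≡))
    where
    total : m ℕ.* Q ℕ.+ D₂ ≡ m ℕ.* d
    total = trans (cong (ℕ._+ D₂) (sym (reassoc q m J))) (ℕ.≡ᵇ⇒≡ _ _ t)
    Q≤d : Q ≤ d
    Q≤d = ℕ.*-cancelˡ-≤ m {{ℕ.>-nonZero 1≤m}} (ℕ.≤-trans (ℕ.m≤m+n (m ℕ.* Q) D₂) (ℕ.≤-reflexive total))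
    D₂≡ : D₂ ≡ m ℕ.* (d ∸ Q)
    D₂≡ = trans (sym (ℕ.m+n∸m≡n (m ℕ.* Q) D₂)) (trans (cong (ℕ._∸ m ℕ.* Q) total) (sym (ℕ.*-distribˡ-∸ m d Q)))

∑-range1-degrees : ∀ φ m J d → 1 ≤ m → 1 ≤ J → {e a : Mono D N} → a ≤ᵐ e →
  ∑[ i ← range1 d ] (𝟙 (i ℕ.* J ≤ᵇ d) * (𝟙 (degree a ≡ᵇ (m ℕ.* J) ℕ.* i) * 𝟙 (degree (e ∸ᵐ a) ≡ᵇ m ℕ.* (d ∸ i ℕ.* J))))
    * ∏ᵉ (dilate (m ℕ.* J) φ) a
  ≡ 𝟙 (degree e ≡ᵇ m ℕ.* d) * 𝟙 (not (degree a ≡ᵇ 0)) * ∏ᵉ (dilate (m ℕ.* J) φ) a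
∑-range1-degrees φ m J d 1≤m 1≤J {e} {a} a≤e with m ℕ.* J in mJ
... | zero  = ⊥-elim (ℕ.<⇒≢ (ℕ.*-mono-≤ 1≤m 1≤J) (sym mJ))
... | suc k rewrite ∏ᵉ-dilate k φ a = by-divisibility (allDivM (suc k) a) refl
  where
  open ≡-Reasoning
  q = degree (divM k a)
  D₂ = degree (e ∸ᵐ a)
  Σ-part : ℤ
  Σ-part = ∑[ i ← range1 d ] (𝟙 (i ℕ.* J ≤ᵇ d) * (𝟙 (degree a ≡ᵇ suc k ℕ.* i) * 𝟙 (D₂ ≡ᵇ m ℕ.* (d ∸ i ℕ.* J))))
  degree-is-multiple : allDivM (suc k) a ≡ true → ∀ i → (degree a ≡ᵇ suc k ℕ.* i) ≡ (i ≡ᵇ q)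
  degree-is-multiple divisible i = T-ext
    (λ t → ℕ.≡⇒≡ᵇ i q (ℕ.*-cancelʳ-≡ i q (suc k) (trans (ℕ.*-comm i (suc k))
             (trans (sym (ℕ.≡ᵇ⇒≡ (degree a) _ t)) (sym (degree-divM k a divisible))))))
    (λ t → ℕ.≡⇒≡ᵇ (degree a) (suc k ℕ.* i) (trans (sym (degree-divM k a divisible))
             (trans (cong (ℕ._* suc k) (sym (ℕ.≡ᵇ⇒≡ i q t))) (ℕ.*-comm i (suc k)))))
  by-divisibility : ∀ b → allDivM (suc k) a ≡ b →
    Σ-part * (𝟙 b * ∏ᵉ φ (divM k a)) ≡ 𝟙 (degree e ≡ᵇ m ℕ.* d) * 𝟙 (not (degree a ≡ᵇ 0)) * (𝟙 b * ∏ᵉ φ (divM k a))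
  by-divisibility false _ = trans (cong (Σ-part *_) (*-zeroˡ (∏ᵉ φ (divM k a))))
    (trans (*-zeroʳ Σ-part) (sym (trans (cong (Z *_) (*-zeroˡ (∏ᵉ φ (divM k a)))) (*-zeroʳ Z))))
    where Z = 𝟙 (degree e ≡ᵇ m ℕ.* d) * 𝟙 (not (degree a ≡ᵇ 0))
  by-divisibility true divisible = cong (_* (1ℤ * ∏ᵉ φ (divM k a))) (begin
      Σ-part
    ≡⟨ ∑-cong (range1 d) (λ i → trans (cong (λ b → 𝟙 (i ℕ.* J ≤ᵇ d) * (𝟙 b * 𝟙 (D₂ ≡ᵇ m ℕ.* (d ∸ i ℕ.* J))))
                                            (degree-is-multiple divisible i))
                                      (*-left-comm (𝟙 (i ℕ.* J ≤ᵇ d)) (𝟙 (i ≡ᵇ q)) _)) ⟩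
      ∑[ i ← range1 d ] (𝟙 (i ≡ᵇ q) * (𝟙 (i ℕ.* J ≤ᵇ d) * 𝟙 (D₂ ≡ᵇ m ℕ.* (d ∸ i ℕ.* J))))
    ≡⟨ ∑-range1-δ d q (λ i → 𝟙 (i ℕ.* J ≤ᵇ d) * 𝟙 (D₂ ≡ᵇ m ℕ.* (d ∸ i ℕ.* J))) ⟩
      𝟙 (inRange1 d q) * (𝟙 (q ℕ.* J ≤ᵇ d) * 𝟙 (D₂ ≡ᵇ m ℕ.* (d ∸ q ℕ.* J)))
    ≡⟨ degree-split m J d q D₂ 1≤m 1≤J ⟩
      𝟙 (q ℕ.* (m ℕ.* J) ℕ.+ D₂ ≡ᵇ m ℕ.* d) * 𝟙 (not (q ℕ.* (m ℕ.* J) ≡ᵇ 0))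
    ≡⟨ cong (λ z → 𝟙 (z ℕ.+ D₂ ≡ᵇ m ℕ.* d) * 𝟙 (not (z ≡ᵇ 0))) (trans (cong (q ℕ.*_) mJ) (degree-divM k a divisible)) ⟩
      𝟙 (degree a ℕ.+ D₂ ≡ᵇ m ℕ.* d) * 𝟙 (not (degree a ≡ᵇ 0))
    ≡⟨ cong (λ z → 𝟙 (z ≡ᵇ m ℕ.* d) * 𝟙 (not (degree a ≡ᵇ 0))) (degree-∸ᵐ a≤e) ⟩
      𝟙 (degree e ≡ᵇ m ℕ.* d) * 𝟙 (not (degree a ≡ᵇ 0))
    ∎)

module _ {F : ℕ → Series} {φ : ℕ → ℤ} (F≈ : ∀ i → F i ≈S weighted i φ) (ψ : ℕ → ℤ) (m K d : ℕ) (1≤m : 1 ≤ m)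
         {D N : ℕ} (e : Mono D N) where

  private
    Q = m ℕ.* 2 ^ K
    1≤Q : 1 ≤ Q
    1≤Q = ℕ.*-mono-≤ 1≤m (ℕ.m^n>0 2 K)
    Z = 𝟙 (degree e ≡ᵇ m ℕ.* d)
    below = monomialsBelow e
    W : Mono D N → ℤ
    W a = ∏ᵉ (dilate Q φ) a * ∏ᵉ ψ (e ∸ᵐ a)

  weighted-⋆ : weighted (m ℕ.* d) (dilate Q φ ⋆ ψ) D N e ≡ Z * ∑ below W
  weighted-⋆ = cong (Z *_) (sym (∑-∏ᵉ-⋆ (dilate Q φ) ψ e))

  weighted-as-constant-part : φ 0 ≡ 1ℤ → weighted (m ℕ.* d) ψ D N e ≡ Z * ∑[ a ← below ] (δ₀ (degree a) * W a)
  weighted-as-constant-part φ0≡1 = cong (Z *_) (sym (begin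
      ∑[ a ← below ] (δ₀ (degree a) * W a)
    ≡⟨ ∑-cong below (λ a → trans (sym (*-assoc (δ₀ (degree a)) _ _))
         (cong (_* ∏ᵉ ψ (e ∸ᵐ a)) (trans (cong (_* ∏ᵉ (dilate Q φ) a) (δ₀-degree a)) (∏ᵉ-* δ₀ (dilate Q φ) a)))) ⟩
      ∑[ a ← below ] (∏ᵉ (λ x → δ₀ x * dilate Q φ x) a * ∏ᵉ ψ (e ∸ᵐ a))
    ≡⟨ ∑-∏ᵉ-⋆ (λ x → δ₀ x * dilate Q φ x) ψ e ⟩
      ∏ᵉ ((λ x → δ₀ x * dilate Q φ x) ⋆ ψ) e
    ≡⟨ ∏ᵉ-cong (λ n → trans (⋆-δ₀ˡ (dilate Q φ) ψ n) (trans (cong (_* ψ n) (trans (dilate-0 Q φ) φ0≡1)) (*-identityˡ _))) e ⟩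
      ∏ᵉ ψ e
    ∎))
    where open ≡-Reasoning

  peel-weighted : peel F m K (λ d′ → weighted (m ℕ.* d′) ψ) d D N e ≡ Z * ∑[ a ← below ] (𝟙 (not (degree a ≡ᵇ 0)) * W a)
  peel-weighted = begin
      ∑[ i ← range1 d ] (𝟙 (i ℕ.* J ≤ᵇ d) * (fᵢ i ·S Y′ (d ∸ i ℕ.* J)) D N e)
    ≡⟨ ∑-cong (range1 d) (λ i → trans (cong (𝟙 (i ℕ.* J ≤ᵇ d) *_) (·S-coefficient (fᵢ i) (Y′ (d ∸ i ℕ.* J)) e))
         (trans (sym (∑-*ˡ below (𝟙 (i ℕ.* J ≤ᵇ d)) _)) (∑-cong below (λ a →
           trans (cong (λ z → 𝟙 (i ℕ.* J ≤ᵇ d) * (z * Y′ (d ∸ i ℕ.* J) D N (e ∸ᵐ a))) (atStack-weighted F≈ i Q 1≤Q D N a))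
                 (regroup (𝟙 (i ℕ.* J ≤ᵇ d)) (𝟙 (degree a ≡ᵇ Q ℕ.* i)) (∏ᵉ (dilate Q φ) a)
                          (𝟙 (degree (e ∸ᵐ a) ≡ᵇ m ℕ.* (d ∸ i ℕ.* J))) (∏ᵉ ψ (e ∸ᵐ a))))))) ⟩
      ∑[ i ← range1 d ] ∑[ a ← below ] (S a i * W a)
    ≡⟨ ∑-comm (range1 d) below (λ i a → S a i * W a) ⟩
      ∑[ a ← below ] ∑[ i ← range1 d ] (S a i * W a)
    ≡⟨ ∑-cong-All below (monomialsBelow-≤ᵐ e) (λ a a≤e →
         trans (∑-*ʳ (range1 d) (W a) (S a))
           (trans (sym (*-assoc (∑ (range1 d) (S a)) (∏ᵉ (dilate Q φ) a) _))
             (trans (cong (_* ∏ᵉ ψ (e ∸ᵐ a)) (∑-range1-degrees φ m J d 1≤m (ℕ.m^n>0 2 K) a≤e))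
                    (*-assoc (Z * 𝟙 (not (degree a ≡ᵇ 0))) (∏ᵉ (dilate Q φ) a) _)))) ⟩
      ∑[ a ← below ] (Z * 𝟙 (not (degree a ≡ᵇ 0)) * W a)
    ≡⟨ trans (∑-cong below (λ a → *-assoc Z (𝟙 (not (degree a ≡ᵇ 0))) (W a))) (∑-*ˡ below Z _) ⟩
      Z * ∑[ a ← below ] (𝟙 (not (degree a ≡ᵇ 0)) * W a)
    ∎
    where
    open ≡-Reasoning
    J = 2 ^ K
    fᵢ : ℕ → Series
    fᵢ i = atStack F (i , Q)
    Y′ : ℕ → Series
    Y′ d′ = weighted (m ℕ.* d′) ψ
    S : Mono D N → ℕ → ℤ
    S a i = 𝟙 (i ℕ.* J ≤ᵇ d) * (𝟙 (degree a ≡ᵇ Q ℕ.* i) * 𝟙 (degree (e ∸ᵐ a) ≡ᵇ m ℕ.* (d ∸ i ℕ.* J)))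
    regroup : ∀ u v p w q → u * ((v * p) * (w * q)) ≡ (u * (v * w)) * (p * q)
    regroup = solve-∀

weighted-peeling : ∀ F φ m (ψ : ℕ → ℕ → ℤ) → 1 ≤ m → φ 0 ≡ 1ℤ → (∀ i → F i ≈S weighted i φ) →
                   (∀ K n → (dilate (m ℕ.* 2 ^ K) φ ⋆ ψ (suc K)) n ≡ ψ K n) →
                   Peeling F m (λ K d → weighted (m ℕ.* d) (ψ K))
weighted-peeling F φ m ψ 1≤m φ0≡1 F≈ ψ-step K d D N e = a+b≡c⇒a≡c-b (begin
    weighted (m ℕ.* d) (ψ (suc K)) D N e + peel F m K (λ d′ → weighted (m ℕ.* d′) (ψ (suc K))) d D N e
  ≡⟨ cong₂ _+_ (weighted-as-constant-part F≈ (ψ (suc K)) m K d 1≤m e φ0≡1) (peel-weighted F≈ (ψ (suc K)) m K d 1≤m e) ⟩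
    Z * ∑[ a ← below ] (δ₀ (degree a) * W a) + Z * ∑[ a ← below ] (𝟙 (not (degree a ≡ᵇ 0)) * W a)
  ≡⟨ trans (sym (*-distribˡ-+ Z _ _)) (cong (Z *_) (∑-𝟙-split below (λ a → degree a ≡ᵇ 0) W)) ⟩
    Z * ∑ below W
  ≡⟨ weighted-⋆ F≈ (ψ (suc K)) m K d 1≤m e ⟨
    weighted (m ℕ.* d) (dilate (m ℕ.* 2 ^ K) φ ⋆ ψ (suc K)) D N e
  ≡⟨ cong (Z *_) (∏ᵉ-cong (ψ-step K) e) ⟩
    weighted (m ℕ.* d) (ψ K) D N e
  ∎)
  where
  open ≡-Reasoning
  Z = 𝟙 (degree e ≡ᵇ m ℕ.* d)
  below = monomialsBelow e
  W : Mono D N → ℤ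
  W a = ∏ᵉ (dilate (m ℕ.* 2 ^ K) φ) a * ∏ᵉ (ψ (suc K)) (e ∸ᵐ a)
  a+b≡c⇒a≡c-b : ∀ {a b c} → a + b ≡ c → a ≡ c - b
  a+b≡c⇒a≡c-b {a} {b} refl = sym (trans (+-assoc a b (- b)) (trans (cong (a +_) (+-inverseʳ b)) (+-identityʳ a)))

-- The weights for E and H

∣ᵇ-false : ∀ {q x} → ¬ q ∣ x → (q ∣ᵇ x) ≡ false
∣ᵇ-false {q} {x} q∤x with q ∣? x
... | yes q∣x = ⊥-elim (q∤x q∣x)
... | no  _   = refl

∣ᵇ-+ : ∀ q p x → q ∣ p → (q ∣ᵇ (p ℕ.+ x)) ≡ (q ∣ᵇ x)
∣ᵇ-+ q p x q∣p with q ∣? x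
... | yes q∣x = ∣ᵇ-true (∣m∣n⇒∣m+n q∣p q∣x)
... | no  q∤x = ∣ᵇ-false (λ q∣p+x → q∤x (∣m+n∣m⇒∣n q∣p+x q∣p))

∣ᵇ-small : ∀ q x → x < q → (q ∣ᵇ x) ≡ (x ≡ᵇ 0)
∣ᵇ-small q zero    _   = ∣ᵇ-true (q ∣0)
∣ᵇ-small q (suc x) x<q = ∣ᵇ-false (>⇒∤ x<q)

÷-small : ∀ {q x} → x < q → x ÷ q ≡ 0
÷-small {suc k} x<q = m<n⇒m/n≡0 x<q

÷-+ : ∀ q x → 1 ≤ q → (q ℕ.+ x) ÷ q ≡ suc (x ÷ q)
÷-+ (suc k) x _ = trans (m/n≡1+[m∸n]/n (ℕ.m≤m+n (suc k) x)) (cong (λ z → suc (z / suc k)) (ℕ.m+n∸m≡n (suc k) x))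

step-induction : ∀ q → 1 ≤ q → (P : ℕ → Set) → (∀ x → x < q → P x) → (∀ x → P x → P (q ℕ.+ x)) → ∀ n → P n
step-induction q 1≤q P small step = <-rec P go
  where
  go : ∀ n → (∀ {n′} → n′ < n → P n′) → P n
  go n rec with n ℕ.<? q
  ... | yes n<q = small n n<q
  ... | no  n≮q = subst P (ℕ.m+[n∸m]≡n (ℕ.≮⇒≥ n≮q)) (step (n ∸ q) (rec (ℕ.∸-monoʳ-< 1≤q (ℕ.≮⇒≥ n≮q))))

-- a multiple of q is an even or an odd multiple of q
∣ᵇ-halve : ∀ q n → 1 ≤ q → 𝟙 (q ∣ᵇ n) ≡ 𝟙 ((q ℕ.+ q) ∣ᵇ n) + 𝟙 (q ≤ᵇ n) * 𝟙 ((q ℕ.+ q) ∣ᵇ (n ∸ q))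
∣ᵇ-halve q n 1≤q = step-induction q 1≤q P small step n
  where
  P : ℕ → Set
  P n = 𝟙 (q ∣ᵇ n) ≡ 𝟙 ((q ℕ.+ q) ∣ᵇ n) + 𝟙 (q ≤ᵇ n) * 𝟙 ((q ℕ.+ q) ∣ᵇ (n ∸ q))
  small : ∀ x → x < q → P x
  small x x<q rewrite ≤ᵇ-false (ℕ.<⇒≱ x<q) | ∣ᵇ-small q x x<q | ∣ᵇ-small (q ℕ.+ q) x (ℕ.<-≤-trans x<q (ℕ.m≤m+n q q)) =
    sym (+-identityʳ _)
  double : ∀ x → 𝟙 ((q ℕ.+ q) ∣ᵇ (q ℕ.+ x)) ≡ 𝟙 (q ≤ᵇ x) * 𝟙 ((q ℕ.+ q) ∣ᵇ (x ∸ q))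
  double x with q ℕ.≤? x
  ... | no  q≰x rewrite ≤ᵇ-false q≰x =
    cong 𝟙 (trans (∣ᵇ-small (q ℕ.+ q) (q ℕ.+ x) (ℕ.+-monoʳ-< q (ℕ.≰⇒> q≰x)))
                  (≡ᵇ-false (ℕ.>⇒≢ (ℕ.<-≤-trans 1≤q (ℕ.m≤m+n q x)))))
  ... | yes q≤x rewrite ≤ᵇ-true q≤x =
    trans (cong (λ z → 𝟙 ((q ℕ.+ q) ∣ᵇ z)) (trans (cong (q ℕ.+_) (sym (ℕ.m+[n∸m]≡n q≤x))) (sym (ℕ.+-assoc q q (x ∸ q)))))
          (trans (cong 𝟙 (∣ᵇ-+ (q ℕ.+ q) (q ℕ.+ q) (x ∸ q) ∣-refl)) (sym (*-identityˡ _)))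
  step : ∀ x → P x → P (q ℕ.+ x)
  step x Px rewrite ∣ᵇ-+ q q x ∣-refl | ≤ᵇ-true (ℕ.m≤m+n q x) | ℕ.m+n∸m≡n q x =
    trans Px (trans (+-comm (𝟙 ((q ℕ.+ q) ∣ᵇ x)) _)
                    (cong₂ _+_ (sym (double x)) (sym (*-identityˡ (𝟙 ((q ℕ.+ q) ∣ᵇ x))))))

≤ᵇ-∸-comm : ∀ n a b → 𝟙 (a ≤ᵇ n) * 𝟙 (b ≤ᵇ n ∸ a) ≡ 𝟙 (b ≤ᵇ n) * 𝟙 (a ≤ᵇ n ∸ b)
≤ᵇ-∸-comm n a b = trans (sym (𝟙-∧ (a ≤ᵇ n) _))
  (trans (cong 𝟙 (trans (fits a b) (trans (cong (_≤ᵇ n) (ℕ.+-comm a b)) (sym (fits b a))))) (𝟙-∧ (b ≤ᵇ n) _))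
  where
  fits : ∀ a b → ((a ≤ᵇ n) ∧ (b ≤ᵇ n ∸ a)) ≡ (a ℕ.+ b ≤ᵇ n)
  fits a b = T-ext
    (λ t → let a≤n , b≤n-a = T-∧ .to t in
       ℕ.≤⇒≤ᵇ (subst (_≤ n) (ℕ.+-comm b a) (ℕ.m≤o∸n⇒m+n≤o b (ℕ.≤ᵇ⇒≤ a n a≤n) (ℕ.≤ᵇ⇒≤ b _ b≤n-a))))
    (λ t → let a+b≤n = ℕ.≤ᵇ⇒≤ (a ℕ.+ b) n t in
       T-∧ .from (ℕ.≤⇒≤ᵇ (ℕ.m+n≤o⇒m≤o a a+b≤n) ,
                  ℕ.≤⇒≤ᵇ (ℕ.m+n≤o⇒m≤o∸n b (subst (_≤ n) (ℕ.+-comm a b) a+b≤n))))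

∣ᵇ-÷-zero : ∀ q → 1 ≤ q → ∀ y → 𝟙 (q ∣ᵇ y) * 𝟙 (y ÷ q ≡ᵇ 0) ≡ δ₀ y
∣ᵇ-÷-zero q       1≤q zero rewrite ∣ᵇ-true (q ∣0) | ÷-small {q} {0} 1≤q = refl
∣ᵇ-÷-zero (suc k) _   (suc y) with suc k ∣? suc y
... | no  _     = refl
... | yes k+1∣y rewrite ≡ᵇ-false {suc y / suc k} {0} (ℕ.>⇒≢ (m≥n⇒m/n>0 (∣⇒≤ k+1∣y))) = refl

agree-by-shift : ∀ q (f g : ℕ → ℤ) → 1 ≤ q → (∀ x → x < q → f x ≡ g x) → (∀ x → f (q ℕ.+ x) ≡ g (q ℕ.+ x)) →
                  ∀ x → f x ≡ g x
agree-by-shift q f g 1≤q small shifted x with x ℕ.<? q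
... | yes x<q = small x x<q
... | no  x≮q = subst (λ z → f z ≡ g z) (ℕ.m+[n∸m]≡n (ℕ.≮⇒≥ x≮q)) (shifted (x ∸ q))

shift-≡ᵇ : ∀ q y → (q ℕ.+ y ≡ᵇ q) ≡ (y ≡ᵇ 0)
shift-≡ᵇ q zero    = ≡ᵇ-true (ℕ.+-identityʳ q)
shift-≡ᵇ q (suc y) = ≡ᵇ-false (λ eq → ℕ.<⇒≢ (ℕ.m<m+n q z<s) (sym eq))

dilate-unital-hᴱ⁺ : ∀ q → 1 ≤ q → ∀ x → dilate q (unital hᴱ⁺) x ≡ onePlusPow q x
dilate-unital-hᴱ⁺ q 1≤q = agree-by-shift q _ _ 1≤q small shifted
  where
  small : ∀ x → x < q → dilate q (unital hᴱ⁺) x ≡ onePlusPow q x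
  small x x<q rewrite ÷-small {q} {x} x<q | ∣ᵇ-small q x x<q | ≡ᵇ-false (ℕ.<⇒≢ x<q) with x
  ... | zero  = refl
  ... | suc _ = refl
  shifted : ∀ y → dilate q (unital hᴱ⁺) (q ℕ.+ y) ≡ onePlusPow q (q ℕ.+ y)
  shifted y rewrite ∣ᵇ-+ q q y ∣-refl | ÷-+ q y 1≤q | ≡ᵇ-false {q ℕ.+ y} {0} (ℕ.>⇒≢ (ℕ.<-≤-trans 1≤q (ℕ.m≤m+n q y))) =
    trans (∣ᵇ-÷-zero q 1≤q y) (sym (trans (+-identityˡ _) (cong 𝟙 (shift-≡ᵇ q y))))

*-double : ∀ m p → m ℕ.* (2 ℕ.* p) ≡ m ℕ.* p ℕ.+ m ℕ.* p
*-double = ℕ-solve-∀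

-- the coefficients of (1 − y^m)/(1 − y^(m·2ᴷ))
ψᴱ : ℕ → ℕ → ℕ → ℤ
ψᴱ m K x = 𝟙 ((m ℕ.* 2 ^ K) ∣ᵇ x) - 𝟙 (m ≤ᵇ x) * 𝟙 ((m ℕ.* 2 ^ K) ∣ᵇ (x ∸ m))

ψᴱ-step : ∀ m K n → 1 ≤ m → (dilate (m ℕ.* 2 ^ K) (unital hᴱ⁺) ⋆ ψᴱ m (suc K)) n ≡ ψᴱ m K n
ψᴱ-step m K n 1≤m = begin
    (dilate q (unital hᴱ⁺) ⋆ ψᴱ m (suc K)) n
  ≡⟨ ⋆-congˡ (ψᴱ m (suc K)) (dilate-unital-hᴱ⁺ q 1≤q) n ⟩
    (onePlusPow q ⋆ ψᴱ m (suc K)) n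
  ≡⟨ onePlusPow-⋆ q (ψᴱ m (suc K)) n 1≤q ⟩
    ψᴱ m (suc K) n + 𝟙 (q ≤ᵇ n) * ψᴱ m (suc K) (n ∸ q)
  ≡⟨ cong₂ (λ u v → u + 𝟙 (q ≤ᵇ n) * v) (doubled n) (doubled (n ∸ q)) ⟩
    ([ n ] - 𝟙 (m ≤ᵇ n) * [ n ∸ m ]) + 𝟙 (q ≤ᵇ n) * ([ n ∸ q ] - 𝟙 (m ≤ᵇ n ∸ q) * [ n ∸ q ∸ m ])
  ≡⟨ cong (λ z → ([ n ] - 𝟙 (m ≤ᵇ n) * [ n ∸ m ]) + 𝟙 (q ≤ᵇ n) * ([ n ∸ q ] - 𝟙 (m ≤ᵇ n ∸ q) * [ z ]))
          (∸-swap n q m) ⟩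
    ([ n ] - 𝟙 (m ≤ᵇ n) * [ n ∸ m ]) + 𝟙 (q ≤ᵇ n) * ([ n ∸ q ] - 𝟙 (m ≤ᵇ n ∸ q) * [ n ∸ m ∸ q ])
  ≡⟨ regroup [ n ] (𝟙 (q ≤ᵇ n)) [ n ∸ q ] (𝟙 (m ≤ᵇ n)) [ n ∸ m ] (𝟙 (m ≤ᵇ n ∸ q)) [ n ∸ m ∸ q ] (𝟙 (q ≤ᵇ n ∸ m))
             (≤ᵇ-∸-comm n q m) ⟩
    ([ n ] + 𝟙 (q ≤ᵇ n) * [ n ∸ q ]) - 𝟙 (m ≤ᵇ n) * ([ n ∸ m ] + 𝟙 (q ≤ᵇ n ∸ m) * [ n ∸ m ∸ q ])
  ≡⟨ cong₂ (λ u v → u - 𝟙 (m ≤ᵇ n) * v) (∣ᵇ-halve q n 1≤q) (∣ᵇ-halve q (n ∸ m) 1≤q) ⟨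
    ψᴱ m K n
  ∎
  where
  open ≡-Reasoning
  q = m ℕ.* 2 ^ K
  1≤q = ℕ.*-mono-≤ 1≤m (ℕ.m^n>0 2 K)
  [_] : ℕ → ℤ
  [ x ] = 𝟙 ((q ℕ.+ q) ∣ᵇ x)
  doubled : ∀ y → ψᴱ m (suc K) y ≡ [ y ] - 𝟙 (m ≤ᵇ y) * [ y ∸ m ]
  doubled y rewrite *-double m (2 ^ K) = refl
  ∸-swap : ∀ x a b → x ∸ a ∸ b ≡ x ∸ b ∸ a
  ∸-swap x a b = trans (ℕ.∸-+-assoc x a b) (trans (cong (x ∸_) (ℕ.+-comm a b)) (sym (ℕ.∸-+-assoc x b a)))
  expand : ∀ a b c u v w x → (a - u * v) + b * (c - w * x) ≡ a + b * c - u * v - (b * w) * x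
  expand = solve-∀
  collect : ∀ a b c u v y x → a + b * c - u * v - (u * y) * x ≡ (a + b * c) - u * (v + y * x)
  collect = solve-∀
  regroup : ∀ a b c u v w x y → b * w ≡ u * y → (a - u * v) + b * (c - w * x) ≡ (a + b * c) - u * (v + y * x)
  regroup a b c u v w x y bw≡uy =
    trans (expand a b c u v w x) (trans (cong (λ z → a + b * c - u * v - z * x) bw≡uy) (collect a b c u v y x))

ψᴱ-zero : ∀ m x → 1 ≤ m → ψᴱ m 0 x ≡ δ₀ x
ψᴱ-zero m x 1≤m rewrite ℕ.*-identityʳ m = agree-by-shift m (ψᴱ′) δ₀ 1≤m small shifted x
  where
  ψᴱ′ : ℕ → ℤ
  ψᴱ′ x = 𝟙 (m ∣ᵇ x) - 𝟙 (m ≤ᵇ x) * 𝟙 (m ∣ᵇ (x ∸ m))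
  small : ∀ x → x < m → ψᴱ′ x ≡ δ₀ x
  small x x<m rewrite ≤ᵇ-false (ℕ.<⇒≱ x<m) | ∣ᵇ-small m x x<m = +-identityʳ (δ₀ x)
  shifted : ∀ y → ψᴱ′ (m ℕ.+ y) ≡ δ₀ (m ℕ.+ y)
  shifted y rewrite ≤ᵇ-true (ℕ.m≤m+n m y) | ℕ.m+n∸m≡n m y | ∣ᵇ-+ m m y ∣-refl
                  | ≡ᵇ-false {m ℕ.+ y} {0} (ℕ.>⇒≢ (ℕ.<-≤-trans 1≤m (ℕ.m≤m+n m y))) =
    trans (cong (𝟙 (m ∣ᵇ y) +_) (cong -_ (*-identityˡ (𝟙 (m ∣ᵇ y))))) (+-inverseʳ (𝟙 (m ∣ᵇ y)))

dilate-unital-hᴱ : ∀ q → 1 ≤ q → ∀ x → dilate q (unital hᴱ) x ≡ δ₀ x - 𝟙 (x ≡ᵇ q)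
dilate-unital-hᴱ q 1≤q = agree-by-shift q _ _ 1≤q small shifted
  where
  small : ∀ x → x < q → dilate q (unital hᴱ) x ≡ δ₀ x - 𝟙 (x ≡ᵇ q)
  small x x<q rewrite ÷-small {q} {x} x<q | ∣ᵇ-small q x x<q | ≡ᵇ-false (ℕ.<⇒≢ x<q) =
    trans (*-identityʳ (δ₀ x)) (sym (+-identityʳ (δ₀ x)))
  shifted : ∀ y → dilate q (unital hᴱ) (q ℕ.+ y) ≡ δ₀ (q ℕ.+ y) - 𝟙 (q ℕ.+ y ≡ᵇ q)
  shifted y rewrite ∣ᵇ-+ q q y ∣-refl | ÷-+ q y 1≤q | ≡ᵇ-false {q ℕ.+ y} {0} (ℕ.>⇒≢ (ℕ.<-≤-trans 1≤q (ℕ.m≤m+n q y)))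
                  | shift-≡ᵇ q y =
    trans (sym (*-assoc (𝟙 (q ∣ᵇ y)) (𝟙 (y ÷ q ≡ᵇ 0)) -1ℤ)) (trans (cong (_* -1ℤ) (∣ᵇ-÷-zero q 1≤q y)) (negate (δ₀ y)))
    where
    negate : ∀ a → a * -1ℤ ≡ 0ℤ - a
    negate = solve-∀

ψᴱ-large : ∀ m d x → 1 ≤ m → x ≤ m ℕ.* d → ψᴱ m d x ≡ δ₀ x - 𝟙 (x ≡ᵇ m)
ψᴱ-large m d x 1≤m x≤md =
  trans (cong₂ (λ u v → 𝟙 u - 𝟙 (m ≤ᵇ x) * 𝟙 v)
               (∣ᵇ-small (m ℕ.* 2 ^ d) x x<q) (∣ᵇ-small (m ℕ.* 2 ^ d) (x ∸ m) (ℕ.≤-<-trans (ℕ.m∸n≤m x m) x<q)))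
        (cong (λ z → δ₀ x - z) exactly-m)
  where
  x<q : x < m ℕ.* 2 ^ d
  x<q = ℕ.≤-<-trans x≤md (ℕ.*-monoʳ-< m {{ℕ.>-nonZero 1≤m}} (n<2^n d))
  exactly-m : 𝟙 (m ≤ᵇ x) * δ₀ (x ∸ m) ≡ 𝟙 (x ≡ᵇ m)
  exactly-m with m ℕ.≤? x
  ... | no  m≰x rewrite ≤ᵇ-false m≰x | ≡ᵇ-false {x} {m} (λ x≡m → m≰x (ℕ.≤-reflexive (sym x≡m))) = refl
  ... | yes m≤x rewrite ≤ᵇ-true m≤x = trans (*-identityˡ _) (cong 𝟙 (T-ext
    (λ t → ℕ.≡⇒≡ᵇ x m (ℕ.≤-antisym (ℕ.m∸n≡0⇒m≤n (ℕ.≡ᵇ⇒≡ (x ∸ m) 0 t)) m≤x))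
    (λ t → ℕ.≡⇒≡ᵇ (x ∸ m) 0 (trans (cong (_∸ m) (ℕ.≡ᵇ⇒≡ x m t)) (ℕ.n∸n≡0 m)))))

-- the coefficients of (1 − y^(m·2ᴷ))/(1 − y^m)
ψᴴ : ℕ → ℕ → ℕ → ℤ
ψᴴ m K x = 𝟙 (m ∣ᵇ x) * 𝟙 (x <ᵇ m ℕ.* 2 ^ K)

dilate-unital-hᴴ⁺-inverse : ∀ q n → 1 ≤ q → (dilate q (unital hᴴ⁺) ⋆ onePlusPow q) n ≡ δ₀ n
dilate-unital-hᴴ⁺-inverse q n 1≤q =
  trans (⋆-comm (dilate q (unital hᴴ⁺)) (onePlusPow q) n)
        (trans (onePlusPow-⋆ q (dilate q (unital hᴴ⁺)) n 1≤q) (agree-by-shift q _ δ₀ 1≤q small shifted n))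
  where
  unital-sign : ∀ y → unital hᴴ⁺ y ≡ sign y
  unital-sign zero    = refl
  unital-sign (suc y) = refl
  small : ∀ n → n < q → dilate q (unital hᴴ⁺) n + 𝟙 (q ≤ᵇ n) * dilate q (unital hᴴ⁺) (n ∸ q) ≡ δ₀ n
  small n n<q rewrite ≤ᵇ-false (ℕ.<⇒≱ n<q) | ÷-small {q} {n} n<q | ∣ᵇ-small q n n<q =
    trans (+-identityʳ _) (*-identityʳ _)
  shifted : ∀ y → dilate q (unital hᴴ⁺) (q ℕ.+ y) + 𝟙 (q ≤ᵇ q ℕ.+ y) * dilate q (unital hᴴ⁺) (q ℕ.+ y ∸ q) ≡ δ₀ (q ℕ.+ y)
  shifted y rewrite ≤ᵇ-true (ℕ.m≤m+n q y) | ℕ.m+n∸m≡n q y | ∣ᵇ-+ q q y ∣-refl | ÷-+ q y 1≤q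
                  | ≡ᵇ-false {q ℕ.+ y} {0} (ℕ.>⇒≢ (ℕ.<-≤-trans 1≤q (ℕ.m≤m+n q y))) | unital-sign (y ÷ q) =
    cancel (𝟙 (q ∣ᵇ y)) (sign (y ÷ q))
    where
    cancel : ∀ a s → a * (-1ℤ * s) + 1ℤ * (a * s) ≡ 0ℤ
    cancel = solve-∀

<ᵇ-+ˡ : ∀ a b c → (a ℕ.+ b <ᵇ a ℕ.+ c) ≡ (b <ᵇ c)
<ᵇ-+ˡ zero    b c = refl
<ᵇ-+ˡ (suc a) b c = <ᵇ-+ˡ a b c

ψᴴ-suc : ∀ m K n → 1 ≤ m → ψᴴ m (suc K) n ≡ ψᴴ m K n + 𝟙 (m ℕ.* 2 ^ K ≤ᵇ n) * ψᴴ m K (n ∸ m ℕ.* 2 ^ K)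
ψᴴ-suc m K n 1≤m rewrite *-double m (2 ^ K) = agree-by-shift q _ _ 1≤q small shifted n
  where
  q = m ℕ.* 2 ^ K
  1≤q = ℕ.*-mono-≤ 1≤m (ℕ.m^n>0 2 K)
  small : ∀ x → x < q → 𝟙 (m ∣ᵇ x) * 𝟙 (x <ᵇ q ℕ.+ q) ≡ ψᴴ m K x + 𝟙 (q ≤ᵇ x) * ψᴴ m K (x ∸ q)
  small x x<q rewrite ≤ᵇ-false (ℕ.<⇒≱ x<q) | <ᵇ-true x<q | <ᵇ-true (ℕ.<-≤-trans x<q (ℕ.m≤m+n q q)) =
    sym (+-identityʳ _)
  shifted : ∀ y → 𝟙 (m ∣ᵇ (q ℕ.+ y)) * 𝟙 (q ℕ.+ y <ᵇ q ℕ.+ q) ≡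
                  ψᴴ m K (q ℕ.+ y) + 𝟙 (q ≤ᵇ q ℕ.+ y) * ψᴴ m K (q ℕ.+ y ∸ q)
  shifted y rewrite ≤ᵇ-true (ℕ.m≤m+n q y) | ℕ.m+n∸m≡n q y | <ᵇ-+ˡ q y q | <ᵇ-false (ℕ.≤⇒≯ (ℕ.m≤m+n q y))
                  | ∣ᵇ-+ m q y (m∣m*n (2 ^ K)) =
    sym (trans (cong (_+ 1ℤ * (𝟙 (m ∣ᵇ y) * 𝟙 (y <ᵇ q))) (*-zeroʳ (𝟙 (m ∣ᵇ y)))) (trans (+-identityˡ _) (*-identityˡ _)))

ψᴴ-step : ∀ m K n → 1 ≤ m → (dilate (m ℕ.* 2 ^ K) (unital hᴴ⁺) ⋆ ψᴴ m (suc K)) n ≡ ψᴴ m K n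
ψᴴ-step m K n 1≤m =
  trans (⋆-congʳ (dilate q (unital hᴴ⁺)) (λ x → trans (ψᴴ-suc m K x 1≤m) (sym (onePlusPow-⋆ q (ψᴴ m K) x 1≤q))) n)
        (⋆-cancel (dilate q (unital hᴴ⁺)) (onePlusPow q) (ψᴴ m K) (λ x → dilate-unital-hᴴ⁺-inverse q x 1≤q) n)
  where
  q = m ℕ.* 2 ^ K
  1≤q = ℕ.*-mono-≤ 1≤m (ℕ.m^n>0 2 K)

ψᴴ-zero : ∀ m x → 1 ≤ m → ψᴴ m 0 x ≡ δ₀ x
ψᴴ-zero m x 1≤m rewrite ℕ.*-identityʳ m with x ℕ.<? m
... | yes x<m rewrite <ᵇ-true x<m | ∣ᵇ-small m x x<m = *-identityʳ (δ₀ x)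
... | no  x≮m rewrite <ᵇ-false x≮m | ≡ᵇ-false {x} {0} (ℕ.>⇒≢ (ℕ.<-≤-trans 1≤m (ℕ.≮⇒≥ x≮m))) = *-zeroʳ (𝟙 (m ∣ᵇ x))

ψᴴ-large : ∀ m d x → 1 ≤ m → x ≤ m ℕ.* d → dilate m (unital hᴴ) x ≡ ψᴴ m d x
ψᴴ-large m d x 1≤m x≤md =
  cong (𝟙 (m ∣ᵇ x) *_) (trans (unital-one (x ÷ m)) (sym (cong 𝟙 (<ᵇ-true x<q))))
  where
  unital-one : ∀ y → unital hᴴ y ≡ 1ℤ
  unital-one zero    = refl
  unital-one (suc y) = refl
  x<q : x < m ℕ.* 2 ^ d
  x<q = ℕ.≤-<-trans x≤md (ℕ.*-monoʳ-< m {{ℕ.>-nonZero 1≤m}} (n<2^n d))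

expansion : ∀ {F F⁺ : ℕ → Series} {φ φ⁺ : ℕ → ℤ} (ψ : ℕ → ℕ → ℤ) d m → 1 ≤ m →
  (∀ i → F i ≈S weighted i φ) → (∀ i → F⁺ i ≈S weighted i φ⁺) → φ⁺ 0 ≡ 1ℤ →
  (∀ K n → (dilate (m ℕ.* 2 ^ K) φ⁺ ⋆ ψ (suc K)) n ≡ ψ K n) → (∀ x → ψ 0 x ≡ δ₀ x) →
  (∀ x → x ≤ m ℕ.* d → dilate m φ x ≡ ψ d x) →
  atStack F (d , m) ≈S rhs F⁺ d m
expansion {F} {F⁺} {φ} {φ⁺} ψ d m 1≤m F≈ F⁺≈ φ⁺0≡1 ψ-step ψ-zero ψ-large D N e = begin
    atStack F (d , m) D N e
  ≡⟨ atStack-weighted F≈ d m 1≤m D N e ⟩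
    weighted (m ℕ.* d) (dilate m φ) D N e
  ≡⟨ weighted-cong-≤ (m ℕ.* d) ψ-large D N e ⟩
    weighted (m ℕ.* d) (ψ d) D N e
  ≡⟨ peeling-unique F⁺ m {λ K d′ → weighted (m ℕ.* d′) (ψ K)} {partialRhs F⁺ m}
       (weighted-peeling F⁺ φ⁺ m ψ 1≤m φ⁺0≡1 F⁺≈ ψ-step) (partialRhs-peeling F⁺ m) base d d D N e ⟩
    partialRhs F⁺ m d d D N e
  ≡⟨ rhs-partialRhs F⁺ d m D N e ⟨
    rhs F⁺ d m D N e
  ∎
  where
  open ≡-Reasoning
  base : ∀ d′ → weighted (m ℕ.* d′) (ψ 0) ≈S partialRhs F⁺ m 0 d′
  base d′ D N e = trans (cong (𝟙 (degree e ≡ᵇ m ℕ.* d′) *_) (∏ᵉ-cong ψ-zero e)) (sym (partialRhs-zero F⁺ m d′ 1≤m D N e))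

mainTheorem7 : (d m : ℕ) → 1 ≤ d → 1 ≤ m →
    (atStack E (d , m) ≈S rhs E⁺ d m) × (atStack H (d , m) ≈S rhs H⁺ d m)
mainTheorem7 d m _ 1≤m =
  expansion (ψᴱ m) d m 1≤m E-weighted E⁺-weighted refl (λ K n → ψᴱ-step m K n 1≤m) (λ x → ψᴱ-zero m x 1≤m)
            (λ x x≤md → trans (dilate-unital-hᴱ m 1≤m x) (sym (ψᴱ-large m d x 1≤m x≤md))) ,
  expansion (ψᴴ m) d m 1≤m H-weighted H⁺-weighted refl (λ K n → ψᴴ-step m K n 1≤m) (λ x → ψᴴ-zero m x 1≤m)
            (λ x x≤md → ψᴴ-large m d x 1≤m x≤md)
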